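{- Let $\sigma$ be a finite relational signature without constants, $k,n\in\mathbb{N}$. (1) For $\sigma$-structures $A,B$: every existential first-order sentence of quantifier rank $\le k$ true in $A$ is true in $B$ if and only if there is a pathwise embedding $F^I(A)\to F^I(B)$ in $\mathrm{EM}(\mathbb{E}_k^I)$. (2) For $\sigma$-structures $A,B$: every existential sentence of $L^n_{\infty,\omega}$ true in $A$ is true in $B$ if and only if there is a pathwise embedding $F^I(A)\to F^I(B)$ in $\mathrm{EM}(\mathbb{P}_n^I)$. (3) If $\sigma$ is a modal signature, for pointed Kripke models $(A,a),(B,b)$: every existential modal formula of modal depth $\le k$ true at $(A,a)$ is true at $(B,b)$ if and only if there is a pathwise embedding $F(A,a)\to F(B,b)$ in $\mathrm{EM}(\mathbb{M}_k)$.
   Context: $\mathbb{E}_k$ (sequences of length $\le k$ of elements, relations on pairwise prefix-comparable sequences whose last elements are related), $\mathbb{P}_n$ (sequences of moves $(p,a)\in\{1..n\}\times A$, relations on pairwise prefix-comparable sequences whose last pebbles were not moved in between and whose last elements are related), and $\mathbb{M}_k$ (on pointed Kripke models: paths from the distinguished point of length $\le k$ along binary relations, unary relations by last element, binary relation $R$ relating a path to its one-step extension along $R$) are comonads with counit "last element" and comultiplication "sequence of prefixes". For a comonad $G$, $\mathrm{EM}(G)$ is its category of Eilenberg--Moore coalgebras $(X,\alpha\colon X\to GX)$. Let $\sigma^I=\sigma\cup\{I\}$ with $I$ binary, $J$ the functor from $\sigma$-structures to $\sigma^I$-structures interpreting $I$ as equality, $G^I$ the comonad $\mathbb{E}_k$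 or $\mathbb{P}_n$ built over $\sigma^I$, and $F^I(A)=(G^I(JA),\delta_{JA})$ the co-free coalgebra; likewise $F(A,a)=(\mathbb{M}_k(A,a),\delta)$. A coalgebra $(X,\alpha)$ carries the order $x\le y$ iff $\alpha(x)$ is a prefix of $\alpha(y)$; it is a path if this order is a finite linear order. A coalgebra morphism is an embedding if its underlying map is injective and reflects all relations; a path embedding is an embedding with domain a path; $f\colon X\to Y$ is a pathwise embedding if $f\circ m$ is a path embedding for every path embedding $m\colon P\to X$. Existential formulas: no universal quantifiers, negations only applied to atomic formulas (first-order with equality); $L^n_{\infty,\omega}$: sentences with arbitrary conjunctions/disjunctions and finitary quantification using only variables $x_1,\dots,x_n$; existential modal formulas: no $\Box$ modalities and negation only on propositional variables; modal depth is maximal nesting of modalities. -}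

module Defs where

open import Level using (0ℓ) renaming (suc to lsuc)
open import Data.Nat using (ℕ; zero; suc; _≤_; _+_; _⊔_; z≤n; s≤s)
open import Data.Nat.Properties using (≤-trans; m≤m+n; +-suc; +-assoc)
open import Data.Fin using (Fin; zero; suc; _≟_)
open import Data.Vec using (Vec; []; _∷_; lookup) renaming (map to vmap)
open import Data.Vec.Relation.Unary.All using (All; []; _∷_)
open import Data.List using (List; []; _∷_; _++_; length) renaming (map to lmap)
open import Data.List.Properties using (length-map; length-++)
open import Data.List.Membership.Propositional using (_∈_)
open import Data.Product using (Σ; _×_; _,_; proj₁; proj₂; map₂)
open import Data.Sum using (_⊎_; inj₁; inj₂)
open import Data.Unit using (⊤; tt)
open import Data.Empty using (⊥)
open import Data.Bool using (Bool; true; false; T; if_then_else_)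
open import Relation.Nullary using (¬_; does; yes; no)
open import Relation.Binary.PropositionalEquality using (_≡_; refl; subst; sym; trans; cong)
open import Function.Bundles using (_↔_)

record Sig : Set₁ where
  field
    Sym   : Set
    arity : Sym → ℕ
open Sig public

FiniteSet : Set → Set
FiniteSet X = Σ ℕ λ m → Fin m ↔ X

record Struct (σ : Sig) : Set₁ where
  field
    Carrier : Set
    rel     : (r : Sym σ) → Vec Carrier (arity σ r) → Set
open Struct public

Preserves : ∀ {σ} (A B : Struct σ) → (Carrier A → Carrier B) → Set
Preserves {σ} A B f =
  ∀ (r : Sym σ) (xs : Vec (Carrier A) (arity σ r)) → rel A r xs → rel B r (vmap f xs)

ReflectsRel : ∀ {σ} (A B : Struct σ) → (Carrier A → Carrier B) → Set
ReflectsRel {σ} A B f =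
  ∀ (r : Sym σ) (xs : Vec (Carrier A) (arity σ r)) → rel B r (vmap f xs) → rel A r xs

record Pointed (σ : Sig) : Set₁ where
  constructor _,*_
  field
    struct : Struct σ
    point  : Carrier struct
open Pointed public

-- σ^I = σ ∪ {I}, I binary (the symbol inj₁ tt), and J : interpret I as equality

arityᴵ : (σ : Sig) → ⊤ ⊎ Sym σ → ℕ
arityᴵ σ (inj₁ _) = 2
arityᴵ σ (inj₂ r) = arity σ r

_ᴵ : Sig → Sig
σ ᴵ = record { Sym = ⊤ ⊎ Sym σ ; arity = arityᴵ σ }

relJ : ∀ {σ} (A : Struct σ) (r : ⊤ ⊎ Sym σ) → Vec (Carrier A) (arityᴵ σ r) → Set
relJ A (inj₁ _) (x ∷ y ∷ []) = x ≡ y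
relJ A (inj₂ r) xs = rel A r xs

J : ∀ {σ} → Struct σ → Struct (σ ᴵ)
J A = record { Carrier = Carrier A ; rel = relJ A }

record Setting : Set₂ where
  field
    Obj      : Set₁
    El       : Obj → Set
    IsHom    : (A B : Obj) → (El A → El B) → Set
    Reflects : (A B : Obj) → (El A → El B) → Set

StructSetting : Sig → Setting
StructSetting σ = record
  { Obj = Struct σ ; El = Carrier ; IsHom = Preserves ; Reflects = ReflectsRel }

PointedSetting : Sig → Setting
PointedSetting σ = record
  { Obj = Pointed σ
  ; El = λ A → Carrier (struct A)
  ; IsHom = λ A B f → Preserves (struct A) (struct B) f × (f (point A) ≡ point B)
  ; Reflects = λ A B f → ReflectsRel (struct A) (struct B) f
  }

-- the data of a comonad G on a setting: object part, action on morphisms,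
-- counit ε, comultiplication δ, and the prefix relation on elements of G A
-- (used to define the order of a coalgebra)
record ComonadData (S : Setting) : Set₂ where
  open Setting S
  field
    G    : Obj → Obj
    Gmap : ∀ {A B} (f : El A → El B) → IsHom A B f → El (G A) → El (G B)
    ε    : ∀ A → El (G A) → El A
    δ    : ∀ A → El (G A) → El (G (G A))
    Pre  : ∀ A → El (G A) → El (G A) → Set

module EMCat {S : Setting} (C : ComonadData S) where
  open Setting S
  open ComonadData C

  record PreCoalg : Set₁ where
    constructor _,ᶜ_
    field
      Ob : Obj
      α  : El Ob → El (G Ob)
  open PreCoalg public

  IsCoalg : PreCoalg → Set
  IsCoalg P = Σ (IsHom (Ob P) (G (Ob P)) (α P)) λ h →
      (∀ x → ε (Ob P) (α P x) ≡ x)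
    × (∀ x → Gmap (α P) h (α P x) ≡ δ (Ob P) (α P x))

  Order : (P : PreCoalg) → El (Ob P) → El (Ob P) → Set
  Order P x y = Pre (Ob P) (α P x) (α P y)

  IsFiniteLinearOrder : (X : Set) → (X → X → Set) → Set
  IsFiniteLinearOrder X _≤_ =
      FiniteSet X
    × (∀ x → x ≤ x)
    × (∀ x y z → x ≤ y → y ≤ z → x ≤ z)
    × (∀ x y → x ≤ y → y ≤ x → x ≡ y)
    × (∀ x y → (x ≤ y) ⊎ (y ≤ x))

  IsPath : PreCoalg → Set
  IsPath P = IsCoalg P × IsFiniteLinearOrder (El (Ob P)) (Order P)

  IsMor : (P Q : PreCoalg) → (El (Ob P) → El (Ob Q)) → Set
  IsMor P Q f = Σ (IsHom (Ob P) (Ob Q) f) λ h →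
    ∀ x → α Q (f x) ≡ Gmap f h (α P x)

  IsEmbedding : (P Q : PreCoalg) → (El (Ob P) → El (Ob Q)) → Set
  IsEmbedding P Q f =
      IsMor P Q f
    × (∀ x y → f x ≡ f y → x ≡ y)
    × Reflects (Ob P) (Ob Q) f

  IsPathwiseEmbedding : (P Q : PreCoalg) → (El (Ob P) → El (Ob Q)) → Set₁
  IsPathwiseEmbedding P Q f =
    ∀ (R : PreCoalg) → IsPath R →
    (m : El (Ob R) → El (Ob P)) → IsEmbedding R P m →
    IsEmbedding R Q (λ x → f (m x))

  PathwiseEmbeddingExists : PreCoalg → PreCoalg → Set₁
  PathwiseEmbeddingExists P Q =
    Σ (El (Ob P) → El (Ob Q)) λ f → IsMor P Q f × IsPathwiseEmbedding P Q f

  Cofree : Obj → PreCoalg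
  Cofree A = G A ,ᶜ δ A

Prefix : {X : Set} → List X → List X → Set
Prefix {X} xs ys = Σ (List X) λ zs → xs ++ zs ≡ ys

Comparable : {X : Set} → List X → List X → Set
Comparable xs ys = Prefix xs ys ⊎ Prefix ys xs

-- The Ehrenfeucht–Fraïssé comonad E_k

-- Seq X k : non-empty sequences of elements of X of length ≤ k
data Seq (X : Set) : ℕ → Set where
  ⟨_⟩ : ∀ {k} → X → Seq X (suc k)
  _◂_ : ∀ {k} → X → Seq X k → Seq X (suc k)

seqList : ∀ {X k} → Seq X k → List X
seqList ⟨ a ⟩ = a ∷ []
seqList (a ◂ s) = a ∷ seqList s

seqLast : ∀ {X k} → Seq X k → X
seqLast ⟨ a ⟩ = a
seqLast (a ◂ s) = seqLast s

seqMap : ∀ {X Y k} → (X → Y) → Seq X k → Seq Y k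
seqMap f ⟨ a ⟩ = ⟨ f a ⟩
seqMap f (a ◂ s) = f a ◂ seqMap f s

seqInits : ∀ {X k} → Seq X k → Seq (Seq X k) k
seqInits ⟨ a ⟩ = ⟨ ⟨ a ⟩ ⟩
seqInits (a ◂ s) = ⟨ a ⟩ ◂ seqMap (a ◂_) (seqInits s)

EkStruct : ∀ {τ} → ℕ → Struct τ → Struct τ
EkStruct {τ} k A = record
  { Carrier = Seq (Carrier A) k
  ; rel = λ r ss →
      (∀ i j → Comparable (seqList (lookup ss i)) (seqList (lookup ss j)))
      × rel A r (vmap seqLast ss)
  }

Ek : (τ : Sig) → ℕ → ComonadData (StructSetting τ)
Ek τ k = record
  { G = EkStruct k
  ; Gmap = λ f _ → seqMap f
  ; ε = λ A → seqLast
  ; δ = λ A → seqInits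
  ; Pre = λ A s t → Prefix (seqList s) (seqList t)
  }

-- The pebbling comonad P_n

data NE (X : Set) : Set where
  ⟪_⟫ : X → NE X
  _◃_ : X → NE X → NE X

neList : ∀ {X} → NE X → List X
neList ⟪ a ⟫ = a ∷ []
neList (a ◃ s) = a ∷ neList s

neLast : ∀ {X} → NE X → X
neLast ⟪ a ⟫ = a
neLast (a ◃ s) = neLast s

neMap : ∀ {X Y} → (X → Y) → NE X → NE Y
neMap f ⟪ a ⟫ = ⟪ f a ⟫
neMap f (a ◃ s) = f a ◃ neMap f s

-- comultiplication: [(p₁,a₁),…,(pₗ,aₗ)] ↦ [(p₁,s₁),…,(pₗ,sₗ)], sᵢ the prefix of length i
pinits : ∀ {n X} → NE (Fin n × X) → NE (Fin n × NE (Fin n × X))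
pinits ⟪ m ⟫ = ⟪ (proj₁ m , ⟪ m ⟫) ⟫
pinits (m ◃ s) = (proj₁ m , ⟪ m ⟫) ◃ neMap (λ qt → (proj₁ qt , m ◃ proj₂ qt)) (pinits s)

NotMovedBetween : ∀ {n X} → NE (Fin n × X) → NE (Fin n × X) → Set
NotMovedBetween s t =
  ∀ u → neList s ++ u ≡ neList t → ¬ (proj₁ (neLast s) ∈ lmap proj₁ u)

PnStruct : ∀ {τ} → ℕ → Struct τ → Struct τ
PnStruct {τ} n A = record
  { Carrier = NE (Fin n × Carrier A)
  ; rel = λ r ss →
      (∀ i j → Comparable (neList (lookup ss i)) (neList (lookup ss j))
             × (Prefix (neList (lookup ss i)) (neList (lookup ss j))
                  → NotMovedBetween (lookup ss i) (lookup ss j)))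
      × rel A r (vmap (λ s → proj₂ (neLast s)) ss)
  }

Pn : (τ : Sig) → ℕ → ComonadData (StructSetting τ)
Pn τ n = record
  { G = PnStruct n
  ; Gmap = λ f _ → neMap (map₂ f)
  ; ε = λ A s → proj₂ (neLast s)
  ; δ = λ A → pinits
  ; Pre = λ A s t → Prefix (neList s) (neList t)
  }

-- Modal signatures and the modal comonad M_k

modalArity : ∀ {p q} → Fin p ⊎ Fin q → ℕ
modalArity (inj₁ _) = 1
modalArity (inj₂ _) = 2

-- p unary relation symbols (propositional variables) and q binary ones (modalities)
modalSig : ℕ → ℕ → Sig
modalSig p q = record { Sym = Fin p ⊎ Fin q ; arity = modalArity }

module Modal (p q : ℕ) where

  σM : Sig
  σM = modalSig p q

  Kripke : Set₁
  Kripke = Struct σM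

  Rb : (A : Kripke) → Fin q → Carrier A → Carrier A → Set
  Rb A j x y = rel A (inj₂ j) (x ∷ y ∷ [])

  Pu : (A : Kripke) → Fin p → Carrier A → Set
  Pu A i x = rel A (inj₁ i) (x ∷ [])

  Valid : (A : Kripke) → Carrier A → List (Fin q × Carrier A) → Set
  Valid A x [] = ⊤
  Valid A x ((j , y) ∷ st) = Rb A j x y × Valid A y st

  endpt : ∀ {X : Set} → X → List (Fin q × X) → X
  endpt x [] = x
  endpt x ((j , y) ∷ st) = endpt y st

  record MPath (A : Pointed σM) (k : ℕ) : Set where
    constructor mpath
    field
      steps : List (Fin q × Carrier (struct A))
      .bound : length steps ≤ k
      .valid : Valid (struct A) (point A) steps
  open MPath public

  Ext : ∀ {A k} → Fin q → MPath A k → MPath A k → Set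
  Ext {A} j π π' = Σ (Carrier (struct A)) λ y → steps π' ≡ steps π ++ ((j , y) ∷ [])

  relM : ∀ {A k} (r : Fin p ⊎ Fin q) → Vec (MPath A k) (modalArity {p} {q} r) → Set
  relM {A} (inj₁ i) (π ∷ []) = Pu (struct A) i (endpt (point A) (steps π))
  relM (inj₂ j) (π ∷ π' ∷ []) = Ext j π π'

  MStruct : ℕ → Pointed σM → Kripke
  MStruct k A = record { Carrier = MPath A k ; rel = relM }

  MPt : ℕ → Pointed σM → Pointed σM
  MPt k A = MStruct k A ,* mpath [] z≤n tt

  valid-map : ∀ {A B : Kripke} (f : Carrier A → Carrier B) → Preserves A B f →
              ∀ x st → Valid A x st → Valid B (f x) (lmap (map₂ f) st)
  valid-map f pr x [] v = tt
  valid-map f pr x ((j , y) ∷ st) (r , v) =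
    pr (inj₂ j) (x ∷ y ∷ []) r , valid-map f pr y st v

  Mmap : ∀ {k} {A B : Pointed σM} (f : Carrier (struct A) → Carrier (struct B)) →
         Preserves (struct A) (struct B) f × (f (point A) ≡ point B) →
         MPath A k → MPath B k
  Mmap {k} {A} {B} f (pr , pe) (mpath st b v) =
    mpath (lmap (map₂ f) st)
          (subst (_≤ k) (sym (length-map (map₂ f) st)) b)
          (subst (λ z → Valid (struct B) z (lmap (map₂ f) st)) pe
                 (valid-map f pr (point A) st v))

  endpt-snoc : ∀ {X : Set} (x : X) st j y → endpt x (st ++ ((j , y) ∷ [])) ≡ y
  endpt-snoc x [] j y = refl
  endpt-snoc x ((i , z) ∷ st) j y = endpt-snoc z st j y

  valid-snoc : ∀ (A : Kripke) x st j y → Valid A x st → Rb A j (endpt x st) y →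
               Valid A x (st ++ ((j , y) ∷ []))
  valid-snoc A x [] j y v r = r , tt
  valid-snoc A x ((i , z) ∷ st) j y (r' , v) r = r' , valid-snoc A z st j y v r

  len-step : ∀ {X : Set} (st : List X) (x : X) (rest : List X) (k : ℕ) →
             length st + suc (length rest) ≤ k →
             length (st ++ (x ∷ [])) + length rest ≤ k
  len-step st x rest k b =
    subst (_≤ k)
      (trans (sym (+-assoc (length st) 1 (length rest)))
        (cong (_+ length rest) (sym (length-++ st))))
      b

  len-now : ∀ {X : Set} (st : List X) (x : X) (rest : List X) (k : ℕ) →
            length st + suc (length rest) ≤ k → length (st ++ (x ∷ [])) ≤ k
  len-now st x rest k b = ≤-trans (m≤m+n _ (length rest)) (len-step st x rest k b)

  -- the list of (label , prefix) pairs after the current prefix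
  go : ∀ {k} (A : Pointed σM) (cur : MPath A k) (rest : List (Fin q × Carrier (struct A))) →
       .(Valid (struct A) (endpt (point A) (steps cur)) rest) →
       .(length (steps cur) + length rest ≤ k) →
       List (Fin q × MPath A k)
  go A cur [] v b = []
  go {k} A (mpath st b₀ v₀) ((j , y) ∷ rest) v b =
    (j , mpath (st ++ ((j , y) ∷ []))
               (len-now st (j , y) rest k b)
               (valid-snoc (struct A) (point A) st j y v₀ (proj₁ v)))
    ∷ go A (mpath (st ++ ((j , y) ∷ []))
                  (len-now st (j , y) rest k b)
                  (valid-snoc (struct A) (point A) st j y v₀ (proj₁ v)))
         rest
         (subst (λ z → Valid (struct A) z rest)
                (sym (endpt-snoc (point A) st j y)) (proj₂ v))
         (len-step st (j , y) rest k b)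

  go-length : ∀ {k} A cur rest .v .b → length (go {k} A cur rest v b) ≡ length rest
  go-length A cur [] v b = refl
  go-length A (mpath st b₀ v₀) ((j , y) ∷ rest) v b = cong suc (go-length A _ rest _ _)

  go-valid : ∀ {k} A cur rest .v .b →
             Valid (MStruct k A) cur (go {k} A cur rest v b)
  go-valid A cur [] v b = tt
  go-valid A (mpath st b₀ v₀) ((j , y) ∷ rest) v b = (y , refl) , go-valid A _ rest _ _

  Mδ : ∀ {k} (A : Pointed σM) → MPath A k → MPath (MPt k A) k
  Mδ {k} A (mpath st b v) =
    mpath (go A (mpath [] z≤n tt) st v b)
          (subst (_≤ k) (sym (go-length A (mpath [] z≤n tt) st v b)) b)
          (go-valid A (mpath [] z≤n tt) st v b)

  Mk : ℕ → ComonadData (PointedSetting σM)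
  Mk k = record
    { G = MPt k
    ; Gmap = λ f h → Mmap f h
    ; ε = λ A π → endpt (point A) (steps π)
    ; δ = Mδ
    ; Pre = λ A π π' → Prefix (steps π) (steps π')
    }

  -- existential modal formulas: no □, negation only on propositional variables

  data MForm : Set where
    ⊤ᵐ ⊥ᵐ     : MForm
    var nvar  : Fin p → MForm
    _∧ᵐ_ _∨ᵐ_ : MForm → MForm → MForm
    ◇         : Fin q → MForm → MForm

  depth : MForm → ℕ
  depth ⊤ᵐ = 0
  depth ⊥ᵐ = 0
  depth (var i) = 0
  depth (nvar i) = 0
  depth (φ ∧ᵐ ψ) = depth φ ⊔ depth ψ
  depth (φ ∨ᵐ ψ) = depth φ ⊔ depth ψ
  depth (◇ j φ) = suc (depth φ)

  sat : MForm → (A : Kripke) → Carrier A → Set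
  sat ⊤ᵐ A x = ⊤
  sat ⊥ᵐ A x = ⊥
  sat (var i) A x = Pu A i x
  sat (nvar i) A x = ¬ Pu A i x
  sat (φ ∧ᵐ ψ) A x = sat φ A x × sat ψ A x
  sat (φ ∨ᵐ ψ) A x = sat φ A x ⊎ sat ψ A x
  sat (◇ j φ) A x = Σ (Carrier A) λ y → Rb A j x y × sat φ A y

  ModalPres : ℕ → Pointed σM → Pointed σM → Set
  ModalPres k A B =
    ∀ (φ : MForm) → depth φ ≤ k →
    sat φ (struct A) (point A) → sat φ (struct B) (point B)

-- Existential first-order formulas (with equality), de Bruijn variables

data EFO (σ : Sig) : ℕ → Set where
  atom natom : ∀ {m} (r : Sym σ) → Vec (Fin m) (arity σ r) → EFO σ m
  eq neq     : ∀ {m} → Fin m → Fin m → EFO σ m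
  _∧ᶠ_ _∨ᶠ_  : ∀ {m} → EFO σ m → EFO σ m → EFO σ m
  ex         : ∀ {m} → EFO σ (suc m) → EFO σ m

qr : ∀ {σ m} → EFO σ m → ℕ
qr (atom r vs) = 0
qr (natom r vs) = 0
qr (eq i j) = 0
qr (neq i j) = 0
qr (φ ∧ᶠ ψ) = qr φ ⊔ qr ψ
qr (φ ∨ᶠ ψ) = qr φ ⊔ qr ψ
qr (ex φ) = suc (qr φ)

⟦_⟧ᶠ : ∀ {σ m} → EFO σ m → (A : Struct σ) → Vec (Carrier A) m → Set
⟦ atom r vs ⟧ᶠ A env = rel A r (vmap (lookup env) vs)
⟦ natom r vs ⟧ᶠ A env = ¬ rel A r (vmap (lookup env) vs)
⟦ eq i j ⟧ᶠ A env = lookup env i ≡ lookup env j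
⟦ neq i j ⟧ᶠ A env = ¬ (lookup env i ≡ lookup env j)
⟦ φ ∧ᶠ ψ ⟧ᶠ A env = ⟦ φ ⟧ᶠ A env × ⟦ ψ ⟧ᶠ A env
⟦ φ ∨ᶠ ψ ⟧ᶠ A env = ⟦ φ ⟧ᶠ A env ⊎ ⟦ ψ ⟧ᶠ A env
⟦ ex φ ⟧ᶠ A env = Σ (Carrier A) λ a → ⟦ φ ⟧ᶠ A (a ∷ env)

ExPresFO : (σ : Sig) → ℕ → Struct σ → Struct σ → Set
ExPresFO σ k A B =
  ∀ (φ : EFO σ 0) → qr φ ≤ k → ⟦ φ ⟧ᶠ A [] → ⟦ φ ⟧ᶠ B []

-- Existential formulas of L^n_{∞,ω}: variables x₁..xₙ (as Fin n),
-- indexed by the set S of variables allowed to occur free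

Scope : ℕ → Set
Scope n = Fin n → Bool

bind : ∀ {n} → Scope n → Fin n → Scope n
bind S i j = if does (j ≟ i) then true else S j

data ELinf (σ : Sig) (n : ℕ) : Scope n → Set₁ where
  atom natom : ∀ {S} (r : Sym σ) (vs : Vec (Fin n) (arity σ r)) →
               All (λ i → T (S i)) vs → ELinf σ n S
  eq neq     : ∀ {S} (i j : Fin n) → T (S i) → T (S j) → ELinf σ n S
  ⋀ ⋁        : ∀ {S} (I : Set) → (I → ELinf σ n S) → ELinf σ n S
  ex         : ∀ {S} (i : Fin n) → ELinf σ n (bind S i) → ELinf σ n S

Env : ∀ {n} → Set → Scope n → Set
Env X S = ∀ i → T (S i) → X

evalVars : ∀ {n m X} {S : Scope n} (vs : Vec (Fin n) m) → All (λ i → T (S i)) vs →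
           Env X S → Vec X m
evalVars [] [] env = []
evalVars (v ∷ vs) (p ∷ ps) env = env v p ∷ evalVars vs ps env

extend : ∀ {n X} {S : Scope n} → Env X S → (i : Fin n) → X → Env X (bind S i)
extend env i a j p with j ≟ i
... | yes _ = a
... | no _ = env j p

⟦_⟧ˡ : ∀ {σ n S} → ELinf σ n S → (A : Struct σ) → Env (Carrier A) S → Set
⟦ atom r vs ps ⟧ˡ A env = rel A r (evalVars vs ps env)
⟦ natom r vs ps ⟧ˡ A env = ¬ rel A r (evalVars vs ps env)
⟦ eq i j p p' ⟧ˡ A env = env i p ≡ env j p'
⟦ neq i j p p' ⟧ˡ A env = ¬ (env i p ≡ env j p')
⟦ ⋀ I φs ⟧ˡ A env = ∀ (x : I) → ⟦ φs x ⟧ˡ A env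
⟦ ⋁ I φs ⟧ˡ A env = Σ I λ x → ⟦ φs x ⟧ˡ A env
⟦ ex i φ ⟧ˡ A env = Σ (Carrier A) λ a → ⟦ φ ⟧ˡ A (extend env i a)

noVars : ∀ {n} → Scope n
noVars _ = false

emptyEnv : ∀ {n X} → Env X (noVars {n})
emptyEnv i ()

ExPresLinf : (σ : Sig) → ℕ → Struct σ → Struct σ → Set₁
ExPresLinf σ n A B =
  ∀ (φ : ELinf σ n noVars) → ⟦ φ ⟧ˡ A emptyEnv → ⟦ φ ⟧ˡ B emptyEnv

PWEᴱ : (σ : Sig) → ℕ → Struct σ → Struct σ → Set₁
PWEᴱ σ k A B = PathwiseEmbeddingExists (Cofree (J A)) (Cofree (J B))
  where open EMCat (Ek (σ ᴵ) k)

PWEᴾ : (σ : Sig) → ℕ → Struct σ → Struct σ → Set₁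
PWEᴾ σ n A B = PathwiseEmbeddingExists (Cofree (J A)) (Cofree (J B))
  where open EMCat (Pn (σ ᴵ) n)

PWEᴹ : (p q k : ℕ) → Pointed (modalSig p q) → Pointed (modalSig p q) → Set₁
PWEᴹ p q k A B = PathwiseEmbeddingExists (Cofree A) (Cofree B)
  where open EMCat (Modal.Mk p q k)

{-# OPTIONS --safe #-}
-- Both directions go through bounded existential games. Preservation of the relevant existential
-- sentences from A to B is equivalent to Duplicator winning the forth-only game (Ehrenfeucht–Fraïssé,
-- pebble, or bisimulation game): one way by induction on formulas, the other through Hintikka
-- formulas, which for L^n_{∞,ω} are replaced by an infinitary conjunction of counterexamples.
-- A winning strategy, applied move by move, is a coalgebra morphism between the cofree coalgebras;
-- it is a pathwise embedding because a path is sent to pairwise comparable plays, all prefixes of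
-- one play, on which the strategy answers consistently. Conversely, a pathwise embedding restricted
-- to the prefixes of a play (a path) maps it onto a play of B whose atomic type it reflects, and
-- this yields a winning strategy.
module Submission where

open import Defs
open import Level using (0ℓ) renaming (suc to lsuc)
open import Axiom.ExcludedMiddle using (ExcludedMiddle)
open import Data.Nat using (ℕ; zero; suc; _≤_; _<_; _+_; z≤n; s≤s; _≤?_)
open import Data.Nat.Properties
  using (≤-trans; ≤-refl; ≤-reflexive; ≤-antisym; ≤-irrelevant; n≤1+n; m≤m+n; m≤n+m; +-suc; +-comm;
         +-cancelˡ-≡; +-assoc; suc-injective; ⊔-lub; m⊔n≤o⇒m≤o; m⊔n≤o⇒n≤o)
open import Data.Fin using (Fin; zero; suc; toℕ; fromℕ; _≟_)
open import Data.Fin.Properties using (toℕ-injective)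
open import Data.Vec using (Vec; []; _∷_; lookup; tabulate) renaming (map to vmap)
import Data.Vec.Properties as Vecₚ
open import Data.Vec.Relation.Unary.All using (All; []; _∷_)
open import Data.List using (List; []; _∷_; _++_; length; concatMap; allFin; filter; foldr) renaming (map to lmap)
import Data.List.Properties as Listₚ
open import Data.List.Properties using (length-map; length-++; map-++; ++-assoc)
open import Data.List.Membership.Propositional using (_∈_)
open import Data.List.Membership.Propositional.Properties
  using (∈-map⁺; ∈-map⁻; ∈-++⁺ˡ; ∈-++⁺ʳ; ∈-++⁻; ∈-concat⁺′; ∈-allFin; ∈-filter⁺; ∈-filter⁻)
open import Data.List.Relation.Unary.Any using (here; there)
open import Data.Product using (Σ; ∃; _×_; _,_; proj₁; proj₂; map₂)
open import Data.Sum using (_⊎_; inj₁; inj₂)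
open import Data.Unit using (⊤; tt)
open import Data.Empty using (⊥-elim)
open import Data.Bool using (true; false; T)
open import Data.Bool.Properties using (T-irrelevant)
open import Relation.Nullary using (¬_; Dec; yes; no; does; _×-dec_; recompute)
import Relation.Unary as U
open import Relation.Binary.PropositionalEquality hiding (J)
open import Function using (_∘_; id)
open import Function.Bundles using (Inverse; _⇔_; mk⇔; Equivalence)
open import Function.Construct.Identity using (↔-id)

module Lists where

  module _ {X : Set} where

    prefix-refl : (xs : List X) → Prefix xs xs
    prefix-refl xs = [] , Listₚ.++-identityʳ xs

    prefix-[] : (xs : List X) → Prefix [] xs
    prefix-[] xs = xs , refl

    prefix-++ : (xs ys : List X) → Prefix xs (xs ++ ys)
    prefix-++ xs ys = ys , refl

    prefix-trans : {xs ys zs : List X} → Prefix xs ys → Prefix ys zs → Prefix xs zs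
    prefix-trans {xs} (u , refl) (v , refl) = u ++ v , sym (++-assoc xs u v)

    prefix-∷ : {x : X} {xs ys : List X} → Prefix xs ys → Prefix (x ∷ xs) (x ∷ ys)
    prefix-∷ (u , refl) = u , refl

    prefix-∷⁻ : {x y : X} {xs ys : List X} → Prefix (x ∷ xs) (y ∷ ys) → (x ≡ y) × Prefix xs ys
    prefix-∷⁻ (u , refl) = refl , (u , refl)

    prefix-length : {xs ys : List X} → Prefix xs ys → length xs ≤ length ys
    prefix-length {[]} _ = z≤n
    prefix-length {x ∷ xs} {[]} (u , ())
    prefix-length {x ∷ xs} {y ∷ ys} p = s≤s (prefix-length (proj₂ (prefix-∷⁻ p)))

    prefix-length-≡ : {xs ys : List X} → Prefix xs ys → length xs ≡ length ys → xs ≡ ys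
    prefix-length-≡ {[]} {[]} _ _ = refl
    prefix-length-≡ {[]} {y ∷ ys} _ ()
    prefix-length-≡ {x ∷ xs} {[]} (u , ()) _
    prefix-length-≡ {x ∷ xs} {y ∷ ys} p e with prefix-∷⁻ p
    ... | refl , q = cong (x ∷_) (prefix-length-≡ q (suc-injective e))

    prefix-length-suc : {xs ys : List X} → Prefix xs ys → length ys ≡ suc (length xs) →
                        ∃ λ y → ys ≡ xs ++ y ∷ []
    prefix-length-suc {xs} (u , refl) e
      with u | +-cancelˡ-≡ (length xs) (length u) 1 (trans (sym (length-++ xs)) (trans e (+-comm 1 _)))
    ... | [] | ()
    ... | y ∷ [] | _ = y , refl
    ... | y ∷ z ∷ u′ | ()

    prefixes-comparable : {xs ys zs : List X} → Prefix xs zs → Prefix ys zs → Comparable xs ys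
    prefixes-comparable {[]} _ _ = inj₁ (prefix-[] _)
    prefixes-comparable {x ∷ xs} {[]} _ _ = inj₂ (prefix-[] _)
    prefixes-comparable {x ∷ xs} {y ∷ ys} {[]} (u , ()) _
    prefixes-comparable {x ∷ xs} {y ∷ ys} {z ∷ zs} p q with prefix-∷⁻ p | prefix-∷⁻ q
    ... | refl , p′ | refl , q′ with prefixes-comparable p′ q′
    ... | inj₁ r = inj₁ (prefix-∷ r)
    ... | inj₂ r = inj₂ (prefix-∷ r)

    comparable-∷⁻ : {x y : X} {xs ys : List X} → Comparable (x ∷ xs) (y ∷ ys) → (x ≡ y) × Comparable xs ys
    comparable-∷⁻ (inj₁ p) = proj₁ (prefix-∷⁻ p) , inj₁ (proj₂ (prefix-∷⁻ p))
    comparable-∷⁻ (inj₂ p) = sym (proj₁ (prefix-∷⁻ p)) , inj₂ (proj₂ (prefix-∷⁻ p))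

    comparable-∷ : {x : X} {xs ys : List X} → Comparable xs ys → Comparable (x ∷ xs) (x ∷ ys)
    comparable-∷ (inj₁ p) = inj₁ (prefix-∷ p)
    comparable-∷ (inj₂ p) = inj₂ (prefix-∷ p)

    comparable-length-≡ : {xs ys : List X} → Comparable xs ys → length xs ≡ length ys → xs ≡ ys
    comparable-length-≡ (inj₁ p) e = prefix-length-≡ p e
    comparable-length-≡ (inj₂ p) e = sym (prefix-length-≡ p (sym e))

    comparable-length-≤ : {xs ys : List X} → Comparable xs ys → length xs ≤ length ys → Prefix xs ys
    comparable-length-≤ (inj₁ p) _ = p
    comparable-length-≤ {xs} (inj₂ p) l =
      subst (Prefix xs) (sym (prefix-length-≡ p (≤-antisym (prefix-length p) l))) (prefix-refl xs)

    prefix-∈ : {xs ys : List X} {z : X} → Prefix xs ys → z ∈ xs → z ∈ ys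
    prefix-∈ (u , refl) m = ∈-++⁺ˡ m

  prefix-map : {X Y : Set} (f : X → Y) {xs ys : List X} → Prefix xs ys → Prefix (lmap f xs) (lmap f ys)
  prefix-map f {xs} (u , refl) = lmap f u , sym (map-++ f xs u)

  comparable-map : {X Y : Set} (f : X → Y) {xs ys : List X} → Comparable xs ys → Comparable (lmap f xs) (lmap f ys)
  comparable-map f (inj₁ p) = inj₁ (prefix-map f p)
  comparable-map f (inj₂ p) = inj₂ (prefix-map f p)

  map-proj-injective : {X Y : Set} (L₁ L₂ : List (X × Y)) →
                       lmap proj₁ L₁ ≡ lmap proj₁ L₂ → lmap proj₂ L₁ ≡ lmap proj₂ L₂ → L₁ ≡ L₂
  map-proj-injective [] [] _ _ = refl
  map-proj-injective ((a , b) ∷ L₁) ((c , d) ∷ L₂) e₁ e₂ with Listₚ.∷-injective e₁ | Listₚ.∷-injective e₂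
  ... | refl , e₁′ | refl , e₂′ = cong ((a , b) ∷_) (map-proj-injective L₁ L₂ e₁′ e₂′)

  ∈-concatMap⁺ : {X Y : Set} (f : X → List Y) {x : X} {y : Y} {xs : List X} → x ∈ xs → y ∈ f x → y ∈ concatMap f xs
  ∈-concatMap⁺ f x∈xs y∈fx = ∈-concat⁺′ y∈fx (∈-map⁺ f x∈xs)

  inits⁺ : {X : Set} → List X → List (List X)
  inits⁺ [] = []
  inits⁺ (x ∷ xs) = (x ∷ []) ∷ lmap (x ∷_) (inits⁺ xs)

  ∈-inits⁺⇒prefix : {X : Set} {l : List X} (xs : List X) → l ∈ inits⁺ xs → Prefix l xs
  ∈-inits⁺⇒prefix [] ()
  ∈-inits⁺⇒prefix (x ∷ xs) (here refl) = xs , refl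
  ∈-inits⁺⇒prefix (x ∷ xs) (there m) with ∈-map⁻ (x ∷_) m
  ... | l′ , m′ , refl = prefix-∷ (∈-inits⁺⇒prefix xs m′)

  prefix⇒∈-inits⁺ : {X : Set} (y : X) (ys xs : List X) → Prefix (y ∷ ys) xs → (y ∷ ys) ∈ inits⁺ xs
  prefix⇒∈-inits⁺ y ys [] (u , ())
  prefix⇒∈-inits⁺ y [] (x ∷ xs) p with prefix-∷⁻ p
  ... | refl , _ = here refl
  prefix⇒∈-inits⁺ y (y′ ∷ ys) (x ∷ xs) p with prefix-∷⁻ p
  ... | refl , q = there (∈-map⁺ (y ∷_) (prefix⇒∈-inits⁺ y′ ys xs q))

  inits⁺-map : {X Y : Set} (f : X → Y) (xs : List X) → inits⁺ (lmap f xs) ≡ lmap (lmap f) (inits⁺ xs)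
  inits⁺-map f [] = refl
  inits⁺-map f (x ∷ xs) = cong ((f x ∷ []) ∷_) (begin
      lmap (f x ∷_) (inits⁺ (lmap f xs))
    ≡⟨ cong (lmap (f x ∷_)) (inits⁺-map f xs) ⟩
      lmap (f x ∷_) (lmap (lmap f) (inits⁺ xs))
    ≡⟨ sym (Listₚ.map-∘ (inits⁺ xs)) ⟩
      lmap (λ l → f x ∷ lmap f l) (inits⁺ xs)
    ≡⟨ Listₚ.map-∘ (inits⁺ xs) ⟩
      lmap (lmap f) (lmap (x ∷_) (inits⁺ xs))
    ∎)
    where open ≡-Reasoning

  inits⁺-∷ʳ : {X : Set} (xs : List X) (x : X) → inits⁺ (xs ++ x ∷ []) ≡ inits⁺ xs ++ (xs ++ x ∷ []) ∷ []
  inits⁺-∷ʳ [] x = refl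
  inits⁺-∷ʳ (y ∷ ys) x =
    cong ((y ∷ []) ∷_) (trans (cong (lmap (y ∷_)) (inits⁺-∷ʳ ys x)) (map-++ (y ∷_) (inits⁺ ys) ((ys ++ x ∷ []) ∷ [])))

  -- The reason why coalgebra morphisms between cofree coalgebras preserve lengths and prefixes.
  module _ {Y X Z : Set} (h : Y → List X) (g : Y → List Z) where
    inits⁺-aligned : (P : List Y) (pre₁ : List X) (pre₂ : List Z) (xs : List X) (ys : List Z) →
                     length pre₁ ≡ length pre₂ →
                     lmap h P ≡ lmap (pre₁ ++_) (inits⁺ xs) →
                     lmap g P ≡ lmap (pre₂ ++_) (inits⁺ ys) →
                     ∀ {p} → p ∈ P → (length (g p) ≡ length (h p)) × Prefix (g p) (pre₂ ++ ys)
    inits⁺-aligned [] pre₁ pre₂ xs ys e e₁ e₂ ()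
    inits⁺-aligned (p ∷ P) pre₁ pre₂ [] ys e () e₂ m
    inits⁺-aligned (p ∷ P) pre₁ pre₂ (x ∷ xs) [] e e₁ () m
    inits⁺-aligned (p ∷ P) pre₁ pre₂ (x ∷ xs) (y ∷ ys) e e₁ e₂ (here refl) =
      trans (cong length (Listₚ.∷-injectiveˡ e₂))
        (trans (length-++ pre₂) (trans (cong (_+ 1) (sym e))
          (trans (sym (length-++ pre₁)) (cong length (sym (Listₚ.∷-injectiveˡ e₁)))))) ,
      subst (λ l → Prefix l (pre₂ ++ y ∷ ys)) (sym (Listₚ.∷-injectiveˡ e₂)) (ys , ++-assoc pre₂ (y ∷ []) ys)
    inits⁺-aligned (p ∷ P) pre₁ pre₂ (x ∷ xs) (y ∷ ys) e e₁ e₂ (there m) =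
      let r = inits⁺-aligned P (pre₁ ++ x ∷ []) (pre₂ ++ y ∷ []) xs ys
                (trans (length-++ pre₁) (trans (cong (_+ 1) e) (sym (length-++ pre₂))))
                (trans (Listₚ.∷-injectiveʳ e₁) (shift pre₁ x xs))
                (trans (Listₚ.∷-injectiveʳ e₂) (shift pre₂ y ys)) m
      in proj₁ r , subst (Prefix _) (++-assoc pre₂ (y ∷ []) ys) (proj₂ r)
      where
      shift : {W : Set} (pre : List W) (w : W) (ws : List W) →
              lmap (pre ++_) (lmap (w ∷_) (inits⁺ ws)) ≡ lmap ((pre ++ w ∷ []) ++_) (inits⁺ ws)
      shift pre w ws = trans (sym (Listₚ.map-∘ (inits⁺ ws)))
                             (Listₚ.map-cong (λ l → sym (++-assoc pre (w ∷ []) l)) (inits⁺ ws))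

  map-cong-entries : {X Y : Set} {n : ℕ} (F G : X → Y) (ts : Vec X n) →
                     (∀ i → F (lookup ts i) ≡ G (lookup ts i)) → vmap F ts ≡ vmap G ts
  map-cong-entries F G [] h = refl
  map-cong-entries F G (t ∷ ts) h = cong₂ _∷_ (h zero) (map-cong-entries F G ts (λ i → h (suc i)))

  sublists : {X : Set} → List X → List (List X)
  sublists [] = [] ∷ []
  sublists (x ∷ xs) = lmap (x ∷_) (sublists xs) ++ sublists xs

  filter∈sublists : {X : Set} {P : X → Set} (P? : U.Decidable P) (xs : List X) → filter P? xs ∈ sublists xs
  filter∈sublists P? [] = here refl
  filter∈sublists P? (x ∷ xs) with does (P? x)
  ... | true = ∈-++⁺ˡ (∈-map⁺ (x ∷_) (filter∈sublists P? xs))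
  ... | false = ∈-++⁺ʳ (lmap (x ∷_) (sublists xs)) (filter∈sublists P? xs)

  choices : {X F : Set} → (X → F) → (X → F) → List X → List (List F)
  choices pos neg [] = [] ∷ []
  choices pos neg (x ∷ xs) = lmap (pos x ∷_) (choices pos neg xs) ++ lmap (neg x ∷_) (choices pos neg xs)

  ∈-choices : {X F : Set} (pos neg pick : X → F) → (∀ x → (pick x ≡ pos x) ⊎ (pick x ≡ neg x)) →
              (xs : List X) → lmap pick xs ∈ choices pos neg xs
  ∈-choices pos neg pick pick-cases [] = here refl
  ∈-choices pos neg pick pick-cases (x ∷ xs) with pick x | pick-cases x
  ... | _ | inj₁ refl = ∈-++⁺ˡ (∈-map⁺ (pos x ∷_) (∈-choices pos neg pick pick-cases xs))
  ... | _ | inj₂ refl =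
    ∈-++⁺ʳ (lmap (pos x ∷_) (choices pos neg xs)) (∈-map⁺ (neg x ∷_) (∈-choices pos neg pick pick-cases xs))

-- Indices into a play (a vector whose entry 0 is the latest move): allFinDesc m lists them from
-- the oldest (m - 1) to the latest (0), and downTo i is its prefix ending in i.
module Indices where
  open Lists

  allFinDesc : (m : ℕ) → List (Fin m)
  allFinDesc zero = []
  allFinDesc (suc m) = lmap suc (allFinDesc m) ++ zero ∷ []

  downTo : {m : ℕ} → Fin m → List (Fin m)
  downTo {suc m} zero = allFinDesc (suc m)
  downTo {suc m} (suc i) = lmap suc (downTo i)

  length-allFinDesc : (m : ℕ) → length (allFinDesc m) ≡ m
  length-allFinDesc zero = refl
  length-allFinDesc (suc m) =
    trans (length-++ (lmap suc (allFinDesc m)))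
          (trans (cong (_+ 1) (trans (length-map suc (allFinDesc m)) (length-allFinDesc m))) (+-comm m 1))

  downTo-prefix : {m : ℕ} (i : Fin m) → Prefix (downTo i) (allFinDesc m)
  downTo-prefix {suc m} zero = prefix-refl _
  downTo-prefix {suc m} (suc i) = prefix-trans (prefix-map suc (downTo-prefix i)) (prefix-++ _ _)

  downTo-comparable : {m : ℕ} (i j : Fin m) → Comparable (downTo i) (downTo j)
  downTo-comparable i j = prefixes-comparable (downTo-prefix i) (downTo-prefix j)

  downTo-∷ʳ : {m : ℕ} (i : Fin m) → ∃ λ l → downTo i ≡ l ++ i ∷ []
  downTo-∷ʳ {suc m} zero = lmap suc (allFinDesc m) , refl
  downTo-∷ʳ {suc m} (suc i) with downTo-∷ʳ i
  ... | l , e = lmap suc l , trans (cong (lmap suc) e) (map-++ suc l (i ∷ []))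

  downTo-nonempty : {m : ℕ} (i : Fin m) → 1 ≤ length (downTo i)
  downTo-nonempty i with downTo-∷ʳ i
  ... | l , e = subst (λ x → 1 ≤ length x) (sym e) (subst (1 ≤_) (sym (length-++ l)) (subst (1 ≤_) (+-comm 1 (length l)) (s≤s z≤n)))

  downTo-bounded : {m : ℕ} (i : Fin m) → length (downTo i) ≤ m
  downTo-bounded {m} i = subst (length (downTo i) ≤_) (length-allFinDesc m) (prefix-length (downTo-prefix i))

  downTo-injective : {m : ℕ} (i j : Fin m) → downTo i ≡ downTo j → i ≡ j
  downTo-injective i j e with downTo-∷ʳ i | downTo-∷ʳ j
  ... | l , e₁ | l′ , e₂ = Listₚ.∷ʳ-injectiveʳ l l′ (trans (sym e₁) (trans e e₂))

  downTo-length-injective : {m : ℕ} (i j : Fin m) → length (downTo i) ≡ length (downTo j) → i ≡ j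
  downTo-length-injective i j e = downTo-injective i j (comparable-length-≡ (downTo-comparable i j) e)

  inits⁺-allFinDesc : (m : ℕ) → inits⁺ (allFinDesc m) ≡ lmap downTo (allFinDesc m)
  inits⁺-allFinDesc zero = refl
  inits⁺-allFinDesc (suc m) = begin
      inits⁺ (lmap suc (allFinDesc m) ++ zero ∷ [])
    ≡⟨ inits⁺-∷ʳ (lmap suc (allFinDesc m)) zero ⟩
      inits⁺ (lmap suc (allFinDesc m)) ++ allFinDesc (suc m) ∷ []
    ≡⟨ cong (_++ allFinDesc (suc m) ∷ []) (trans (inits⁺-map suc (allFinDesc m)) (cong (lmap (lmap suc)) (inits⁺-allFinDesc m))) ⟩
      lmap (lmap suc) (lmap downTo (allFinDesc m)) ++ allFinDesc (suc m) ∷ []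
    ≡⟨ cong (_++ allFinDesc (suc m) ∷ []) (trans (sym (Listₚ.map-∘ (allFinDesc m))) (Listₚ.map-∘ (allFinDesc m))) ⟩
      lmap downTo (lmap suc (allFinDesc m)) ++ lmap downTo (zero ∷ [])
    ≡⟨ sym (map-++ downTo (lmap suc (allFinDesc m)) (zero ∷ [])) ⟩
      lmap downTo (lmap suc (allFinDesc m) ++ zero ∷ [])
    ∎
    where open ≡-Reasoning

  inits⁺-downTo : {m : ℕ} (i : Fin m) → inits⁺ (downTo i) ≡ lmap downTo (downTo i)
  inits⁺-downTo {suc m} zero = inits⁺-allFinDesc (suc m)
  inits⁺-downTo {suc m} (suc i) = begin
      inits⁺ (lmap suc (downTo i))
    ≡⟨ inits⁺-map suc (downTo i) ⟩
      lmap (lmap suc) (inits⁺ (downTo i))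
    ≡⟨ cong (lmap (lmap suc)) (inits⁺-downTo i) ⟩
      lmap (lmap suc) (lmap downTo (downTo i))
    ≡⟨ trans (sym (Listₚ.map-∘ (downTo i))) (Listₚ.map-∘ (downTo i)) ⟩
      lmap downTo (lmap suc (downTo i))
    ∎
    where open ≡-Reasoning

  play : {X : Set} {m : ℕ} → Vec X m → List X
  play {m = m} v = lmap (lookup v) (allFinDesc m)

  length-play : {X : Set} {m : ℕ} (v : Vec X m) → length (play v) ≡ m
  length-play {m = m} v = trans (length-map (lookup v) (allFinDesc m)) (length-allFinDesc m)

  play-∷ : {X : Set} {m : ℕ} (x : X) (v : Vec X m) → play (x ∷ v) ≡ play v ++ x ∷ []
  play-∷ {m = m} x v =
    trans (map-++ (lookup (x ∷ v)) (lmap suc (allFinDesc m)) (zero ∷ [])) (cong (_++ x ∷ []) (sym (Listₚ.map-∘ (allFinDesc m))))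

  playUpTo : {X : Set} {m : ℕ} → Vec X m → Fin m → List X
  playUpTo v i = lmap (lookup v) (downTo i)

  playUpTo-prefix : {X : Set} {m : ℕ} (v : Vec X m) (i : Fin m) → Prefix (playUpTo v i) (play v)
  playUpTo-prefix v i = prefix-map (lookup v) (downTo-prefix i)

  length-playUpTo : {X : Set} {m : ℕ} (v : Vec X m) (i : Fin m) → length (playUpTo v i) ≡ length (downTo i)
  length-playUpTo v i = length-map (lookup v) (downTo i)

  playUpTo-nonempty : {X : Set} {m : ℕ} (v : Vec X m) (i : Fin m) → 1 ≤ length (playUpTo v i)
  playUpTo-nonempty v i = subst (1 ≤_) (sym (length-playUpTo v i)) (downTo-nonempty i)

  playUpTo-∷ʳ : {X : Set} {m : ℕ} (v : Vec X m) (i : Fin m) → ∃ λ l → playUpTo v i ≡ l ++ lookup v i ∷ []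
  playUpTo-∷ʳ v i with downTo-∷ʳ i
  ... | l , e = lmap (lookup v) l , trans (cong (lmap (lookup v)) e) (map-++ (lookup v) l (i ∷ []))

  playUpTo-suc : {X : Set} {m : ℕ} (x : X) (v : Vec X m) (i : Fin m) → playUpTo (x ∷ v) (suc i) ≡ playUpTo v i
  playUpTo-suc x v i = sym (Listₚ.map-∘ (downTo i))

  Descending : {m : ℕ} → List (Fin m) → Set
  Descending [] = ⊤
  Descending (x ∷ xs) = (∀ {y} → y ∈ xs → toℕ y < toℕ x) × Descending xs

  Descending-++⁻ˡ : {m : ℕ} (a b : List (Fin m)) → Descending (a ++ b) → Descending a
  Descending-++⁻ˡ [] b d = tt
  Descending-++⁻ˡ (x ∷ a) b (h , d) = (λ mem → h (∈-++⁺ˡ mem)) , Descending-++⁻ˡ a b d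

  Descending-after : {m : ℕ} (l : List (Fin m)) (x : Fin m) (u : List (Fin m)) →
                     Descending (l ++ x ∷ u) → ∀ {y} → y ∈ u → toℕ y < toℕ x
  Descending-after [] x u (h , d) mem = h mem
  Descending-after (z ∷ l) x u (h , d) mem = Descending-after l x u d mem

  Descending-map-suc : {m : ℕ} (xs : List (Fin m)) → Descending xs → Descending (lmap suc xs)
  Descending-map-suc [] d = tt
  Descending-map-suc (x ∷ xs) (h , d) = below , Descending-map-suc xs d
    where
    below : ∀ {y} → y ∈ lmap suc xs → toℕ y < toℕ (suc x)
    below mem with ∈-map⁻ suc mem
    ... | y′ , m′ , refl = s≤s (h m′)

  Descending-∷ʳ : {m : ℕ} (xs : List (Fin m)) (z : Fin m) → Descending xs →
                  (∀ {y} → y ∈ xs → toℕ z < toℕ y) → Descending (xs ++ z ∷ [])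
  Descending-∷ʳ [] z d h = (λ ()) , tt
  Descending-∷ʳ (x ∷ xs) z (h₁ , d) h = below , Descending-∷ʳ xs z d (λ mem → h (there mem))
    where
    below : ∀ {y} → y ∈ xs ++ z ∷ [] → toℕ y < toℕ x
    below mem with ∈-++⁻ xs mem
    ... | inj₁ m₁ = h₁ m₁
    ... | inj₂ (here refl) = h (here refl)

  Descending-allFinDesc : (m : ℕ) → Descending (allFinDesc m)
  Descending-allFinDesc zero = tt
  Descending-allFinDesc (suc m) =
    Descending-∷ʳ (lmap suc (allFinDesc m)) zero (Descending-map-suc (allFinDesc m) (Descending-allFinDesc m)) positive
    where
    positive : ∀ {y} → y ∈ lmap suc (allFinDesc m) → toℕ (zero {m}) < toℕ y
    positive mem with ∈-map⁻ suc mem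
    ... | y′ , m′ , refl = s≤s z≤n

  downTo-extension-< : {m : ℕ} (x x′ : Fin m) (u : List (Fin m)) → downTo x ++ u ≡ downTo x′ →
                       ∀ {y} → y ∈ u → toℕ y < toℕ x
  downTo-extension-< {m} x x′ u e mem = Descending-after (proj₁ (downTo-∷ʳ x)) x u descending mem
    where
    descending : Descending (proj₁ (downTo-∷ʳ x) ++ x ∷ u)
    descending =
      subst Descending (trans (sym e) (trans (cong (_++ u) (proj₂ (downTo-∷ʳ x))) (++-assoc (proj₁ (downTo-∷ʳ x)) (x ∷ []) u)))
        (Descending-++⁻ˡ (downTo x′) (proj₁ (downTo-prefix x′))
          (subst Descending (sym (proj₂ (downTo-prefix x′))) (Descending-allFinDesc m)))

module Sequences where
  open Lists

  module _ {X : Set} where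

    seqList-nonempty : ∀ {k} (s : Seq X k) → ∃ λ x → ∃ λ xs → seqList s ≡ x ∷ xs
    seqList-nonempty ⟨ a ⟩ = a , [] , refl
    seqList-nonempty (a ◂ s) = a , seqList s , refl

    seqList-injective : ∀ {k} (s t : Seq X k) → seqList s ≡ seqList t → s ≡ t
    seqList-injective ⟨ a ⟩ ⟨ .a ⟩ refl = refl
    seqList-injective ⟨ a ⟩ (b ◂ t) e with seqList-nonempty t | Listₚ.∷-injectiveʳ e
    ... | x , xs , e′ | e″ with trans e″ e′
    ... | ()
    seqList-injective (a ◂ s) ⟨ b ⟩ e with seqList-nonempty s | Listₚ.∷-injectiveʳ e
    ... | x , xs , e′ | e″ with trans (sym e′) e″
    ... | ()
    seqList-injective (a ◂ s) (b ◂ t) e with Listₚ.∷-injective e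
    ... | refl , e′ = cong (a ◂_) (seqList-injective s t e′)

    seqList-∷ʳ : ∀ {k} (s : Seq X k) → ∃ λ l → seqList s ≡ l ++ seqLast s ∷ []
    seqList-∷ʳ ⟨ a ⟩ = [] , refl
    seqList-∷ʳ (a ◂ s) with seqList-∷ʳ s
    ... | l , e = a ∷ l , cong (a ∷_) e

    seqLast-∷ʳ : ∀ {k} (s : Seq X k) (l : List X) (x : X) → seqList s ≡ l ++ x ∷ [] → seqLast s ≡ x
    seqLast-∷ʳ s l x e with seqList-∷ʳ s
    ... | l′ , e′ = Listₚ.∷ʳ-injectiveʳ l′ l (trans (sym e′) e)

    toSeq : ∀ {k} (l : List X) → 1 ≤ length l → length l ≤ k → Seq X k
    toSeq {suc k} (x ∷ []) _ _ = ⟨ x ⟩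
    toSeq {suc k} (x ∷ y ∷ l) _ (s≤s p) = x ◂ toSeq (y ∷ l) (s≤s z≤n) p

    seqList-toSeq : ∀ {k} (l : List X) (p : 1 ≤ length l) (q : length l ≤ k) → seqList (toSeq l p q) ≡ l
    seqList-toSeq {suc k} (x ∷ []) _ _ = refl
    seqList-toSeq {suc k} (x ∷ y ∷ l) _ (s≤s q) = cong (x ∷_) (seqList-toSeq (y ∷ l) (s≤s z≤n) q)

    toSeq-cong : ∀ {k} {l l′ : List X} (p : 1 ≤ length l) (q : length l ≤ k)
                 (p′ : 1 ≤ length l′) (q′ : length l′ ≤ k) → l ≡ l′ → toSeq l p q ≡ toSeq l′ p′ q′
    toSeq-cong {l = l} p q p′ q′ refl = cong₂ (toSeq l) (≤-irrelevant p p′) (≤-irrelevant q q′)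

  seqList-map : {X Y : Set} {k : ℕ} (f : X → Y) (s : Seq X k) → seqList (seqMap f s) ≡ lmap f (seqList s)
  seqList-map f ⟨ a ⟩ = refl
  seqList-map f (a ◂ s) = cong (f a ∷_) (seqList-map f s)

  seqMap-∘ : {X Y Z : Set} {k : ℕ} (f : Y → Z) (g : X → Y) (s : Seq X k) → seqMap f (seqMap g s) ≡ seqMap (f ∘ g) s
  seqMap-∘ f g ⟨ a ⟩ = refl
  seqMap-∘ f g (a ◂ s) = cong (f (g a) ◂_) (seqMap-∘ f g s)

  seqInits-list : {X : Set} {k : ℕ} (s : Seq X k) → lmap seqList (seqList (seqInits s)) ≡ inits⁺ (seqList s)
  seqInits-list ⟨ a ⟩ = refl
  seqInits-list (a ◂ s) = cong ((a ∷ []) ∷_) (begin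
      lmap seqList (seqList (seqMap (a ◂_) (seqInits s)))
    ≡⟨ cong (lmap seqList) (seqList-map (a ◂_) (seqInits s)) ⟩
      lmap seqList (lmap (a ◂_) (seqList (seqInits s)))
    ≡⟨ trans (sym (Listₚ.map-∘ (seqList (seqInits s)))) (Listₚ.map-∘ (seqList (seqInits s))) ⟩
      lmap (a ∷_) (lmap seqList (seqList (seqInits s)))
    ≡⟨ cong (lmap (a ∷_)) (seqInits-list s) ⟩
      lmap (a ∷_) (inits⁺ (seqList s))
    ∎)
    where open ≡-Reasoning

  prefix⇒∈-seqInits : {X : Set} {k : ℕ} (s₀ s : Seq X k) → Prefix (seqList s₀) (seqList s) → s₀ ∈ seqList (seqInits s)
  prefix⇒∈-seqInits s₀ s p with seqList-nonempty s₀
  ... | y , ys , e with ∈-map⁻ seqList (subst ((y ∷ ys) ∈_) (sym (seqInits-list s))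
                         (prefix⇒∈-inits⁺ y ys (seqList s) (subst (λ l → Prefix l (seqList s)) e p)))
  ... | t , m , e′ = subst (_∈ seqList (seqInits s)) (sym (seqList-injective s₀ t (trans e e′))) m

  ∈-seqInits⇒prefix : {X : Set} {k : ℕ} (s₀ s : Seq X k) → s₀ ∈ seqList (seqInits s) → Prefix (seqList s₀) (seqList s)
  ∈-seqInits⇒prefix s₀ s m = ∈-inits⁺⇒prefix (seqList s) (subst (seqList s₀ ∈_) (seqInits-list s) (∈-map⁺ seqList m))

  module SeqMorphism {X Z : Set} {k : ℕ} (f : Seq X k → Seq Z k)
                     (mor : ∀ s → seqInits (f s) ≡ seqMap f (seqInits s)) where

    private
      image-aligned : ∀ s → lmap (seqList ∘ f) (seqList (seqInits s)) ≡ lmap ([] ++_) (inits⁺ (seqList (f s)))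
      image-aligned s = begin
          lmap (seqList ∘ f) (seqList (seqInits s))
        ≡⟨ Listₚ.map-∘ (seqList (seqInits s)) ⟩
          lmap seqList (lmap f (seqList (seqInits s)))
        ≡⟨ cong (lmap seqList) (sym (seqList-map f (seqInits s))) ⟩
          lmap seqList (seqList (seqMap f (seqInits s)))
        ≡⟨ cong (λ t → lmap seqList (seqList t)) (sym (mor s)) ⟩
          lmap seqList (seqList (seqInits (f s)))
        ≡⟨ seqInits-list (f s) ⟩
          inits⁺ (seqList (f s))
        ≡⟨ sym (Listₚ.map-id (inits⁺ (seqList (f s)))) ⟩
          lmap ([] ++_) (inits⁺ (seqList (f s)))
        ∎
        where open ≡-Reasoning

      length-prefix-preserved : ∀ s₀ s → Prefix (seqList s₀) (seqList s) →
        (length (seqList (f s₀)) ≡ length (seqList s₀)) × Prefix (seqList (f s₀)) (seqList (f s))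
      length-prefix-preserved s₀ s p =
        inits⁺-aligned seqList (seqList ∘ f) (seqList (seqInits s)) [] [] (seqList s) (seqList (f s)) refl
          (trans (seqInits-list s) (sym (Listₚ.map-id _))) (image-aligned s) (prefix⇒∈-seqInits s₀ s p)

    length-preserved : ∀ s → length (seqList (f s)) ≡ length (seqList s)
    length-preserved s = proj₁ (length-prefix-preserved s s (prefix-refl _))

    prefix-preserved : ∀ s₀ s → Prefix (seqList s₀) (seqList s) → Prefix (seqList (f s₀)) (seqList (f s))
    prefix-preserved s₀ s p = proj₂ (length-prefix-preserved s₀ s p)

    comparable-preserved : ∀ s t → Comparable (seqList s) (seqList t) → Comparable (seqList (f s)) (seqList (f t))
    comparable-preserved s t (inj₁ p) = inj₁ (prefix-preserved s t p)
    comparable-preserved s t (inj₂ p) = inj₂ (prefix-preserved t s p)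

module Plays where
  open Lists

  module _ {X : Set} where

    neList-nonempty : (s : NE X) → ∃ λ x → ∃ λ xs → neList s ≡ x ∷ xs
    neList-nonempty ⟪ a ⟫ = a , [] , refl
    neList-nonempty (a ◃ s) = a , neList s , refl

    neList-injective : (s t : NE X) → neList s ≡ neList t → s ≡ t
    neList-injective ⟪ a ⟫ ⟪ .a ⟫ refl = refl
    neList-injective ⟪ a ⟫ (b ◃ t) e with neList-nonempty t | Listₚ.∷-injectiveʳ e
    ... | x , xs , e′ | e″ with trans e″ e′
    ... | ()
    neList-injective (a ◃ s) ⟪ b ⟫ e with neList-nonempty s | Listₚ.∷-injectiveʳ e
    ... | x , xs , e′ | e″ with trans (sym e′) e″
    ... | ()
    neList-injective (a ◃ s) (b ◃ t) e with Listₚ.∷-injective e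
    ... | refl , e′ = cong (a ◃_) (neList-injective s t e′)

    neList-∷ʳ : (s : NE X) → ∃ λ l → neList s ≡ l ++ neLast s ∷ []
    neList-∷ʳ ⟪ a ⟫ = [] , refl
    neList-∷ʳ (a ◃ s) with neList-∷ʳ s
    ... | l , e = a ∷ l , cong (a ∷_) e

    neLast-∷ʳ : (s : NE X) (l : List X) (x : X) → neList s ≡ l ++ x ∷ [] → neLast s ≡ x
    neLast-∷ʳ s l x e with neList-∷ʳ s
    ... | l′ , e′ = Listₚ.∷ʳ-injectiveʳ l′ l (trans (sym e′) e)

    neList-nonempty-length : (s : NE X) → 1 ≤ length (neList s)
    neList-nonempty-length ⟪ _ ⟫ = s≤s z≤n
    neList-nonempty-length (_ ◃ _) = s≤s z≤n

    toNE : (l : List X) → 1 ≤ length l → NE X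
    toNE (x ∷ []) _ = ⟪ x ⟫
    toNE (x ∷ y ∷ l) _ = x ◃ toNE (y ∷ l) (s≤s z≤n)

    neList-toNE : (l : List X) (p : 1 ≤ length l) → neList (toNE l p) ≡ l
    neList-toNE (x ∷ []) _ = refl
    neList-toNE (x ∷ y ∷ l) _ = cong (x ∷_) (neList-toNE (y ∷ l) (s≤s z≤n))

    toNE-cong : {l l′ : List X} (p : 1 ≤ length l) (p′ : 1 ≤ length l′) → l ≡ l′ → toNE l p ≡ toNE l′ p′
    toNE-cong {l} p p′ refl = cong (toNE l) (≤-irrelevant p p′)

  neList-map : {X Y : Set} (f : X → Y) (s : NE X) → neList (neMap f s) ≡ lmap f (neList s)
  neList-map f ⟪ a ⟫ = refl
  neList-map f (a ◃ s) = cong (f a ∷_) (neList-map f s)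

  neMap-∘ : {X Y Z : Set} (f : Y → Z) (g : X → Y) (s : NE X) → neMap f (neMap g s) ≡ neMap (f ∘ g) s
  neMap-∘ f g ⟪ a ⟫ = refl
  neMap-∘ f g (a ◃ s) = cong (f (g a) ◃_) (neMap-∘ f g s)

  labels : {n : ℕ} {X : Set} → NE (Fin n × X) → List (Fin n)
  labels s = lmap proj₁ (neList s)

  prefixes : {n : ℕ} {X : Set} → NE (Fin n × X) → List (NE (Fin n × X))
  prefixes s = lmap proj₂ (neList (pinits s))

  module _ {n : ℕ} {X : Set} where

    labels-pinits : (s : NE (Fin n × X)) → lmap proj₁ (neList (pinits s)) ≡ labels s
    labels-pinits ⟪ m ⟫ = refl
    labels-pinits (m ◃ s) = cong (proj₁ m ∷_) (begin
        lmap proj₁ (neList (neMap (λ qt → (proj₁ qt , m ◃ proj₂ qt)) (pinits s)))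
      ≡⟨ cong (lmap proj₁) (neList-map _ (pinits s)) ⟩
        lmap proj₁ (lmap (λ qt → (proj₁ qt , m ◃ proj₂ qt)) (neList (pinits s)))
      ≡⟨ sym (Listₚ.map-∘ (neList (pinits s))) ⟩
        lmap proj₁ (neList (pinits s))
      ≡⟨ labels-pinits s ⟩
        labels s
      ∎)
      where open ≡-Reasoning

    prefixes-list : (s : NE (Fin n × X)) → lmap neList (prefixes s) ≡ inits⁺ (neList s)
    prefixes-list ⟪ m ⟫ = refl
    prefixes-list (m ◃ s) = cong ((m ∷ []) ∷_) (begin
        lmap neList (lmap proj₂ (neList (neMap (λ qt → (proj₁ qt , m ◃ proj₂ qt)) (pinits s))))
      ≡⟨ cong (λ L → lmap neList (lmap proj₂ L)) (neList-map _ (pinits s)) ⟩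
        lmap neList (lmap proj₂ (lmap (λ qt → (proj₁ qt , m ◃ proj₂ qt)) (neList (pinits s))))
      ≡⟨ cong (lmap neList) (sym (Listₚ.map-∘ (neList (pinits s)))) ⟩
        lmap neList (lmap (λ qt → m ◃ proj₂ qt) (neList (pinits s)))
      ≡⟨ sym (Listₚ.map-∘ (neList (pinits s))) ⟩
        lmap (λ qt → m ∷ neList (proj₂ qt)) (neList (pinits s))
      ≡⟨ trans (Listₚ.map-∘ (neList (pinits s))) (cong (lmap (m ∷_)) (Listₚ.map-∘ (neList (pinits s)))) ⟩
        lmap (m ∷_) (lmap neList (prefixes s))
      ≡⟨ cong (lmap (m ∷_)) (prefixes-list s) ⟩
        lmap (m ∷_) (inits⁺ (neList s))
      ∎)
      where open ≡-Reasoning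

    prefix⇒∈-prefixes : (s₀ s : NE (Fin n × X)) → Prefix (neList s₀) (neList s) → s₀ ∈ prefixes s
    prefix⇒∈-prefixes s₀ s p with neList-nonempty s₀
    ... | y , ys , e with ∈-map⁻ neList (subst ((y ∷ ys) ∈_) (sym (prefixes-list s))
                           (prefix⇒∈-inits⁺ y ys (neList s) (subst (λ l → Prefix l (neList s)) e p)))
    ... | t , m , e′ = subst (_∈ prefixes s) (sym (neList-injective s₀ t (trans e e′))) m

    ∈-prefixes⇒prefix : (s₀ s : NE (Fin n × X)) → s₀ ∈ prefixes s → Prefix (neList s₀) (neList s)
    ∈-prefixes⇒prefix s₀ s m = ∈-inits⁺⇒prefix (neList s) (subst (neList s₀ ∈_) (prefixes-list s) (∈-map⁺ neList m))

  labels-∷ʳ : {n : ℕ} {X : Set} (s : NE (Fin n × X)) → ∃ λ l → labels s ≡ l ++ proj₁ (neLast s) ∷ []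
  labels-∷ʳ s with neList-∷ʳ s
  ... | l , e = lmap proj₁ l , trans (cong (lmap proj₁) e) (map-++ proj₁ l _)

  same-labels⇒same-last-pebble : {n : ℕ} {X Y : Set} (s : NE (Fin n × X)) (s′ : NE (Fin n × Y)) →
                                 labels s ≡ labels s′ → proj₁ (neLast s) ≡ proj₁ (neLast s′)
  same-labels⇒same-last-pebble s s′ e with labels-∷ʳ s | labels-∷ʳ s′
  ... | l , e₁ | l′ , e₂ = Listₚ.∷ʳ-injectiveʳ l l′ (trans (sym e₁) (trans e e₂))

  NotMovedBetween-transfer : {n : ℕ} {X Y : Set} (s t : NE (Fin n × X)) (s′ t′ : NE (Fin n × Y)) →
                             labels s ≡ labels s′ → labels t ≡ labels t′ →
                             Prefix (neList s) (neList t) → NotMovedBetween s t → NotMovedBetween s′ t′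
  NotMovedBetween-transfer s t s′ t′ ls lt (u , eu) nm u′ eu′ mem =
    nm u eu (subst (_∈ lmap proj₁ u) (sym (same-labels⇒same-last-pebble s s′ ls))
                   (subst (proj₁ (neLast s′) ∈_) (sym same-labels-after) mem))
    where
    same-labels-after : lmap proj₁ u ≡ lmap proj₁ u′
    same-labels-after = Listₚ.++-cancelˡ (labels s) _ _
      (trans (sym (map-++ proj₁ (neList s) u)) (trans (cong (lmap proj₁) eu) (trans lt
        (trans (sym (cong (lmap proj₁) eu′)) (trans (map-++ proj₁ (neList s′) u′) (cong (_++ lmap proj₁ u′) (sym ls)))))))

  module PlayMorphism {n : ℕ} {X Z : Set} (f : NE (Fin n × X) → NE (Fin n × Z))
                      (mor : ∀ s → pinits (f s) ≡ neMap (map₂ f) (pinits s)) where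

    private
      image-aligned : ∀ s → lmap (neList ∘ f) (prefixes s) ≡ lmap ([] ++_) (inits⁺ (neList (f s)))
      image-aligned s = begin
          lmap (neList ∘ f) (lmap proj₂ (neList (pinits s)))
        ≡⟨ sym (Listₚ.map-∘ (neList (pinits s))) ⟩
          lmap (λ qt → neList (f (proj₂ qt))) (neList (pinits s))
        ≡⟨ Listₚ.map-∘ (neList (pinits s)) ⟩
          lmap (λ qt → neList (proj₂ qt)) (lmap (map₂ f) (neList (pinits s)))
        ≡⟨ Listₚ.map-∘ (lmap (map₂ f) (neList (pinits s))) ⟩
          lmap neList (lmap proj₂ (lmap (map₂ f) (neList (pinits s))))
        ≡⟨ cong (λ L → lmap neList (lmap proj₂ L)) (sym (neList-map (map₂ f) (pinits s))) ⟩
          lmap neList (lmap proj₂ (neList (neMap (map₂ f) (pinits s))))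
        ≡⟨ cong (λ t → lmap neList (lmap proj₂ (neList t))) (sym (mor s)) ⟩
          lmap neList (prefixes (f s))
        ≡⟨ prefixes-list (f s) ⟩
          inits⁺ (neList (f s))
        ≡⟨ sym (Listₚ.map-id _) ⟩
          lmap ([] ++_) (inits⁺ (neList (f s)))
        ∎
        where open ≡-Reasoning

      length-prefix-preserved : ∀ s₀ s → Prefix (neList s₀) (neList s) →
        (length (neList (f s₀)) ≡ length (neList s₀)) × Prefix (neList (f s₀)) (neList (f s))
      length-prefix-preserved s₀ s p =
        inits⁺-aligned neList (neList ∘ f) (prefixes s) [] [] (neList s) (neList (f s)) refl
          (trans (prefixes-list s) (sym (Listₚ.map-id _))) (image-aligned s) (prefix⇒∈-prefixes s₀ s p)

    length-preserved : ∀ s → length (neList (f s)) ≡ length (neList s)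
    length-preserved s = proj₁ (length-prefix-preserved s s (prefix-refl _))

    prefix-preserved : ∀ s₀ s → Prefix (neList s₀) (neList s) → Prefix (neList (f s₀)) (neList (f s))
    prefix-preserved s₀ s p = proj₂ (length-prefix-preserved s₀ s p)

    comparable-preserved : ∀ s t → Comparable (neList s) (neList t) → Comparable (neList (f s)) (neList (f t))
    comparable-preserved s t (inj₁ p) = inj₁ (prefix-preserved s t p)
    comparable-preserved s t (inj₂ p) = inj₂ (prefix-preserved t s p)

    labels-preserved : ∀ s → labels (f s) ≡ labels s
    labels-preserved s = begin
        labels (f s)
      ≡⟨ sym (labels-pinits (f s)) ⟩
        lmap proj₁ (neList (pinits (f s)))
      ≡⟨ cong (λ t → lmap proj₁ (neList t)) (mor s) ⟩
        lmap proj₁ (neList (neMap (map₂ f) (pinits s)))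
      ≡⟨ cong (lmap proj₁) (neList-map (map₂ f) (pinits s)) ⟩
        lmap proj₁ (lmap (map₂ f) (neList (pinits s)))
      ≡⟨ sym (Listₚ.map-∘ (neList (pinits s))) ⟩
        lmap proj₁ (neList (pinits s))
      ≡⟨ labels-pinits s ⟩
        labels s
      ∎
      where open ≡-Reasoning

  PebbleCompatible : {n : ℕ} {X : Set} → NE (Fin n × X) → NE (Fin n × X) → Set
  PebbleCompatible s t = Comparable (neList s) (neList t) × (Prefix (neList s) (neList t) → NotMovedBetween s t)

  PebbleCoherent : {n : ℕ} {X : Set} {m : ℕ} → Vec (NE (Fin n × X)) m → Set
  PebbleCoherent ss = ∀ i j → PebbleCompatible (lookup ss i) (lookup ss j)

  module PnMorphism {n : ℕ} {X Z : Set} (f : NE (Fin n × X) → NE (Fin n × Z))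
                    (mor : ∀ s → pinits (f s) ≡ neMap (map₂ f) (pinits s)) where
    open PlayMorphism f mor public

    NotMovedBetween-preserved : ∀ s t → Comparable (neList s) (neList t) →
      (Prefix (neList s) (neList t) → NotMovedBetween s t) →
      Prefix (neList (f s)) (neList (f t)) → NotMovedBetween (f s) (f t)
    NotMovedBetween-preserved s t (inj₁ p) nm _ =
      NotMovedBetween-transfer s t (f s) (f t) (sym (labels-preserved s)) (sym (labels-preserved t)) p (nm p)
    NotMovedBetween-preserved s t (inj₂ p) nm pf =
      NotMovedBetween-transfer s t (f s) (f t) (sym (labels-preserved s)) (sym (labels-preserved t)) p′ (nm p′)
      where
      p′ : Prefix (neList s) (neList t)
      p′ = comparable-length-≤ (inj₂ p)
             (subst₂ _≤_ (length-preserved s) (length-preserved t) (prefix-length pf))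

    PebbleCompatible-preserved : ∀ s t → PebbleCompatible s t → PebbleCompatible (f s) (f t)
    PebbleCompatible-preserved s t (c , nm) = comparable-preserved s t c , NotMovedBetween-preserved s t c nm

    PebbleCoherent-preserved : ∀ {m} (ss : Vec (NE (Fin n × X)) m) → PebbleCoherent ss → PebbleCoherent (vmap f ss)
    PebbleCoherent-preserved ss c i j =
      subst₂ PebbleCompatible (sym (Vecₚ.lookup-map i f ss)) (sym (Vecₚ.lookup-map j f ss)) (PebbleCompatible-preserved _ _ (c i j))

    NotMovedBetween-reflected : ∀ s t → Prefix (neList s) (neList t) → NotMovedBetween (f s) (f t) → NotMovedBetween s t
    NotMovedBetween-reflected s t p nm =
      NotMovedBetween-transfer (f s) (f t) s t (labels-preserved s) (labels-preserved t) (prefix-preserved s t p) nm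

module FiniteSignature (σ : Sig) (fin : FiniteSet (Sym σ)) where
  open Lists

  symbols : List (Sym σ)
  symbols = lmap (Inverse.to (proj₂ fin)) (allFin (proj₁ fin))

  ∈-symbols : (r : Sym σ) → r ∈ symbols
  ∈-symbols r = subst (_∈ symbols) (Inverse.strictlyInverseˡ (proj₂ fin) r) (∈-map⁺ (Inverse.to (proj₂ fin)) (∈-allFin _))

  symbolsᴵ : List (Sym (σ ᴵ))
  symbolsᴵ = inj₁ tt ∷ lmap inj₂ symbols

  ∈-symbolsᴵ : (r : Sym (σ ᴵ)) → r ∈ symbolsᴵ
  ∈-symbolsᴵ (inj₁ tt) = here refl
  ∈-symbolsᴵ (inj₂ r) = there (∈-map⁺ inj₂ (∈-symbols r))

  tuples : (m n : ℕ) → List (Vec (Fin m) n)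
  tuples m zero = [] ∷ []
  tuples m (suc n) = concatMap (λ i → lmap (i ∷_) (tuples m n)) (allFin m)

  ∈-tuples : (m n : ℕ) (v : Vec (Fin m) n) → v ∈ tuples m n
  ∈-tuples m zero [] = here refl
  ∈-tuples m (suc n) (i ∷ v) = ∈-concatMap⁺ (λ i → lmap (i ∷_) (tuples m n)) (∈-allFin i) (∈-map⁺ (i ∷_) (∈-tuples m n v))

  Atom : ℕ → Set
  Atom m = Σ (Sym (σ ᴵ)) λ r → Vec (Fin m) (arity (σ ᴵ) r)

  atoms : (m : ℕ) → List (Atom m)
  atoms m = concatMap (λ r → lmap (r ,_) (tuples m (arity (σ ᴵ) r))) symbolsᴵ

  ∈-atoms : (m : ℕ) (r : Sym (σ ᴵ)) (vs : Vec (Fin m) (arity (σ ᴵ) r)) → (r , vs) ∈ atoms m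
  ∈-atoms m r vs = ∈-concatMap⁺ (λ r → lmap (r ,_) (tuples m (arity (σ ᴵ) r))) (∈-symbolsᴵ r) (∈-map⁺ (r ,_) (∈-tuples m _ vs))

module ExistentialFO {σ : Sig} where

  atomᴵ negAtomᴵ : ∀ {m} (r : Sym (σ ᴵ)) → Vec (Fin m) (arity (σ ᴵ) r) → EFO σ m
  atomᴵ (inj₁ _) (i ∷ j ∷ []) = eq i j
  atomᴵ (inj₂ r) vs = atom r vs
  negAtomᴵ (inj₁ _) (i ∷ j ∷ []) = neq i j
  negAtomᴵ (inj₂ r) vs = natom r vs

  qr-atomᴵ : ∀ {m} r (vs : Vec (Fin m) _) → qr (atomᴵ r vs) ≡ 0
  qr-atomᴵ (inj₁ _) (i ∷ j ∷ []) = refl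
  qr-atomᴵ (inj₂ r) vs = refl

  qr-negAtomᴵ : ∀ {m} r (vs : Vec (Fin m) _) → qr (negAtomᴵ r vs) ≡ 0
  qr-negAtomᴵ (inj₁ _) (i ∷ j ∷ []) = refl
  qr-negAtomᴵ (inj₂ r) vs = refl

  module _ (C : Struct σ) {m} (env : Vec (Carrier C) m) where

    ⟦atomᴵ⟧ : ∀ r vs → ⟦ atomᴵ r vs ⟧ᶠ C env ≡ relJ C r (vmap (lookup env) vs)
    ⟦atomᴵ⟧ (inj₁ _) (i ∷ j ∷ []) = refl
    ⟦atomᴵ⟧ (inj₂ r) vs = refl

    ⟦negAtomᴵ⟧ : ∀ r vs → ⟦ negAtomᴵ r vs ⟧ᶠ C env ≡ (¬ relJ C r (vmap (lookup env) vs))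
    ⟦negAtomᴵ⟧ (inj₁ _) (i ∷ j ∷ []) = refl
    ⟦negAtomᴵ⟧ (inj₂ r) vs = refl

  conj : ∀ {m} → EFO σ m → List (EFO σ m) → EFO σ m
  conj = foldr _∧ᶠ_

  module _ (C : Struct σ) {m} (env : Vec (Carrier C) m) where
    conj-intro : ∀ s L → ⟦ s ⟧ᶠ C env → (∀ {φ} → φ ∈ L → ⟦ φ ⟧ᶠ C env) → ⟦ conj s L ⟧ᶠ C env
    conj-intro s [] hs hL = hs
    conj-intro s (x ∷ L) hs hL = hL (here refl) , conj-intro s L hs (λ m → hL (there m))

    conj-seed : ∀ s L → ⟦ conj s L ⟧ᶠ C env → ⟦ s ⟧ᶠ C env
    conj-seed s [] h = h
    conj-seed s (x ∷ L) h = conj-seed s L (proj₂ h)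

    conj-∈ : ∀ s L → ⟦ conj s L ⟧ᶠ C env → ∀ {φ} → φ ∈ L → ⟦ φ ⟧ᶠ C env
    conj-∈ s (x ∷ L) h (here refl) = proj₁ h
    conj-∈ s (x ∷ L) h (there p) = conj-∈ s L (proj₂ h) p

  qr-conj : ∀ {m} j (s : EFO σ m) L → qr s ≤ j → (∀ {φ} → φ ∈ L → qr φ ≤ j) → qr (conj s L) ≤ j
  qr-conj j s [] hs hL = hs
  qr-conj j s (x ∷ L) hs hL = ⊔-lub (hL (here refl)) (qr-conj j s L hs (λ p → hL (there p)))

  trueᶠ : ∀ {m} → EFO σ (suc m)
  trueᶠ = eq zero zero

module ExistentialGame {σ : Sig} (A B : Struct σ) where
  open ExistentialFO

  PartialIso : ∀ {m} → Vec (Carrier A) m → Vec (Carrier B) m → Set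
  PartialIso {m} ā b̄ = ∀ (r : Sym (σ ᴵ)) (vs : Vec (Fin m) (arity (σ ᴵ) r)) →
    relJ A r (vmap (lookup ā) vs) ⇔ relJ B r (vmap (lookup b̄) vs)

  -- Duplicator wins the j-round existential Ehrenfeucht–Fraïssé game from (ā , b̄).
  Sim : ℕ → ∀ {m} → Vec (Carrier A) m → Vec (Carrier B) m → Set
  Sim zero ā b̄ = PartialIso ā b̄
  Sim (suc j) ā b̄ = PartialIso ā b̄ × (∀ a → Σ (Carrier B) λ b → Sim j (a ∷ ā) (b ∷ b̄))

  Sim⇒PartialIso : ∀ j {m} {ā : Vec (Carrier A) m} {b̄} → Sim j ā b̄ → PartialIso ā b̄
  Sim⇒PartialIso zero g = g
  Sim⇒PartialIso (suc j) g = proj₁ g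

  ExPres : ℕ → ∀ {m} → Vec (Carrier A) m → Vec (Carrier B) m → Set
  ExPres j {m} ā b̄ = ∀ (φ : EFO σ m) → qr φ ≤ j → ⟦ φ ⟧ᶠ A ā → ⟦ φ ⟧ᶠ B b̄

  Sim⇒ExPres : ∀ j {m} (ā : Vec (Carrier A) m) b̄ → Sim j ā b̄ → ExPres j ā b̄
  Sim⇒ExPres j ā b̄ g (atom r vs) q h = Equivalence.to (Sim⇒PartialIso j g (inj₂ r) vs) h
  Sim⇒ExPres j ā b̄ g (natom r vs) q h hb = h (Equivalence.from (Sim⇒PartialIso j g (inj₂ r) vs) hb)
  Sim⇒ExPres j ā b̄ g (eq i i′) q h = Equivalence.to (Sim⇒PartialIso j g (inj₁ tt) (i ∷ i′ ∷ [])) h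
  Sim⇒ExPres j ā b̄ g (neq i i′) q h hb = h (Equivalence.from (Sim⇒PartialIso j g (inj₁ tt) (i ∷ i′ ∷ [])) hb)
  Sim⇒ExPres j ā b̄ g (φ ∧ᶠ ψ) q (h₁ , h₂) =
    Sim⇒ExPres j ā b̄ g φ (m⊔n≤o⇒m≤o (qr φ) (qr ψ) q) h₁ , Sim⇒ExPres j ā b̄ g ψ (m⊔n≤o⇒n≤o (qr φ) (qr ψ) q) h₂
  Sim⇒ExPres j ā b̄ g (φ ∨ᶠ ψ) q (inj₁ h) = inj₁ (Sim⇒ExPres j ā b̄ g φ (m⊔n≤o⇒m≤o (qr φ) (qr ψ) q) h)
  Sim⇒ExPres j ā b̄ g (φ ∨ᶠ ψ) q (inj₂ h) = inj₂ (Sim⇒ExPres j ā b̄ g ψ (m⊔n≤o⇒n≤o (qr φ) (qr ψ) q) h)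
  Sim⇒ExPres (suc j) ā b̄ g (ex φ) (s≤s q) (a , h) =
    proj₁ (proj₂ g a) , Sim⇒ExPres j (a ∷ ā) (proj₁ (proj₂ g a) ∷ b̄) (proj₂ (proj₂ g a)) φ q h

module HintikkaFO (em : ExcludedMiddle 0ℓ) {σ : Sig} (fin : FiniteSet (Sym σ)) (A B : Struct σ) where
  open Lists
  open FiniteSignature σ fin
  open ExistentialFO
  open ExistentialGame A B

  ExPres⇒PartialIso : ∀ j {m} (ā : Vec (Carrier A) m) b̄ → ExPres j ā b̄ → PartialIso ā b̄
  ExPres⇒PartialIso j ā b̄ p r vs = mk⇔ forth back
    where
    forth : relJ A r (vmap (lookup ā) vs) → relJ B r (vmap (lookup b̄) vs)
    forth h = subst id (⟦atomᴵ⟧ B b̄ r vs)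
                (p (atomᴵ r vs) (subst (_≤ j) (sym (qr-atomᴵ r vs)) z≤n) (subst id (sym (⟦atomᴵ⟧ A ā r vs)) h))
    back : relJ B r (vmap (lookup b̄) vs) → relJ A r (vmap (lookup ā) vs)
    back hb with em {relJ A r (vmap (lookup ā) vs)}
    ... | yes h = h
    ... | no nh = ⊥-elim (subst id (⟦negAtomᴵ⟧ B b̄ r vs)
                    (p (negAtomᴵ r vs) (subst (_≤ j) (sym (qr-negAtomᴵ r vs)) z≤n) (subst id (sym (⟦negAtomᴵ⟧ A ā r vs)) nh)) hb)

  literal : ∀ {m} → Vec (Carrier A) m → Atom m → EFO σ m
  literal ā (r , vs) with em {relJ A r (vmap (lookup ā) vs)}
  ... | yes _ = atomᴵ r vs
  ... | no _ = negAtomᴵ r vs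

  literal-cases : ∀ {m} (ā : Vec (Carrier A) m) at →
                  (literal ā at ≡ atomᴵ (proj₁ at) (proj₂ at)) ⊎ (literal ā at ≡ negAtomᴵ (proj₁ at) (proj₂ at))
  literal-cases ā (r , vs) with em {relJ A r (vmap (lookup ā) vs)}
  ... | yes _ = inj₁ refl
  ... | no _ = inj₂ refl

  qr-literal : ∀ {m} (ā : Vec (Carrier A) m) at → qr (literal ā at) ≡ 0
  qr-literal ā (r , vs) with em {relJ A r (vmap (lookup ā) vs)}
  ... | yes _ = qr-atomᴵ r vs
  ... | no _ = qr-negAtomᴵ r vs

  literal-holds : ∀ {m} (ā : Vec (Carrier A) m) at → ⟦ literal ā at ⟧ᶠ A ā
  literal-holds ā (r , vs) with em {relJ A r (vmap (lookup ā) vs)}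
  ... | yes h = subst id (sym (⟦atomᴵ⟧ A ā r vs)) h
  ... | no nh = subst id (sym (⟦negAtomᴵ⟧ A ā r vs)) nh

  literal⇒⇔ : ∀ {m} (ā : Vec (Carrier A) m) (b̄ : Vec (Carrier B) m) r vs → ⟦ literal ā (r , vs) ⟧ᶠ B b̄ →
              relJ A r (vmap (lookup ā) vs) ⇔ relJ B r (vmap (lookup b̄) vs)
  literal⇒⇔ ā b̄ r vs h with em {relJ A r (vmap (lookup ā) vs)}
  ... | yes ha = mk⇔ (λ _ → subst id (⟦atomᴵ⟧ B b̄ r vs) h) (λ _ → ha)
  ... | no nh = mk⇔ (λ ha → ⊥-elim (nh ha)) (λ hb → ⊥-elim (subst id (⟦negAtomᴵ⟧ B b̄ r vs) h hb))

  atomicType : ∀ {m} → Vec (Carrier A) (suc m) → EFO σ (suc m)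
  atomicType {m} ā = conj trueᶠ (lmap (literal ā) (atoms (suc m)))

  qr-atomicType : ∀ {m} (ā : Vec (Carrier A) (suc m)) j → qr (atomicType ā) ≤ j
  qr-atomicType {m} ā j = qr-conj j trueᶠ (lmap (literal ā) (atoms (suc m))) z≤n literal-qr
    where
    literal-qr : ∀ {φ} → φ ∈ lmap (literal ā) (atoms (suc m)) → qr φ ≤ j
    literal-qr p with ∈-map⁻ (literal ā) p
    ... | at , _ , refl = subst (_≤ j) (sym (qr-literal ā at)) z≤n

  atomicType-holds : ∀ {m} (ā : Vec (Carrier A) (suc m)) → ⟦ atomicType ā ⟧ᶠ A ā
  atomicType-holds {m} ā = conj-intro A ā trueᶠ _ refl literal-true
    where
    literal-true : ∀ {φ} → φ ∈ lmap (literal ā) (atoms (suc m)) → ⟦ φ ⟧ᶠ A ā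
    literal-true p with ∈-map⁻ (literal ā) p
    ... | at , _ , refl = literal-holds ā at

  atomicType⇒PartialIso : ∀ {m} (ā : Vec (Carrier A) (suc m)) b̄ → ⟦ atomicType ā ⟧ᶠ B b̄ → PartialIso ā b̄
  atomicType⇒PartialIso {m} ā b̄ h r vs =
    literal⇒⇔ ā b̄ r vs (conj-∈ B b̄ trueᶠ _ h (∈-map⁺ (literal ā) (∈-atoms (suc m) r vs)))

  Realized : ℕ → ∀ {m} → Vec (Carrier A) m → EFO σ m → Set
  Realized j ā φ = qr φ ≤ j × ⟦ φ ⟧ᶠ A ā

  realized? : ∀ j {m} (ā : Vec (Carrier A) m) → U.Decidable (Realized j ā)
  realized? j ā φ = (qr φ ≤? j) ×-dec em

  literalChoices : (m : ℕ) → List (List (EFO σ m))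
  literalChoices m = choices (λ at → atomᴵ (proj₁ at) (proj₂ at)) (λ at → negAtomᴵ (proj₁ at) (proj₂ at)) (atoms m)

  -- A finite list containing every Hintikka formula of rank j in m + 1 free variables.
  candidates : ℕ → (m : ℕ) → List (EFO σ (suc m))
  candidates zero m = lmap (conj trueᶠ) (literalChoices (suc m))
  candidates (suc j) m =
    concatMap (λ ls → lmap (conj (conj trueᶠ ls)) (sublists (lmap ex (candidates j (suc m))))) (literalChoices (suc m))

  realizedExtensions : ℕ → ∀ {m} → Vec (Carrier A) m → List (EFO σ m)
  realizedExtensions j {m} ā = filter (realized? (suc j) ā) (lmap ex (candidates j m))

  ∈-realizedExtensions⁻ : ∀ j {m} (ā : Vec (Carrier A) m) {φ} → φ ∈ realizedExtensions j ā → Realized (suc j) ā φ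
  ∈-realizedExtensions⁻ j {m} ā p = proj₂ (∈-filter⁻ (realized? (suc j) ā) {xs = lmap ex (candidates j m)} p)

  hintikka : ℕ → ∀ {m} → Vec (Carrier A) (suc m) → EFO σ (suc m)
  hintikka zero ā = atomicType ā
  hintikka (suc j) ā = conj (atomicType ā) (realizedExtensions j ā)

  qr-hintikka : ∀ j {m} (ā : Vec (Carrier A) (suc m)) → qr (hintikka j ā) ≤ j
  qr-hintikka zero ā = qr-atomicType ā zero
  qr-hintikka (suc j) ā =
    qr-conj (suc j) (atomicType ā) (realizedExtensions j ā) (qr-atomicType ā (suc j)) (λ p → proj₁ (∈-realizedExtensions⁻ j ā p))

  hintikka-holds : ∀ j {m} (ā : Vec (Carrier A) (suc m)) → ⟦ hintikka j ā ⟧ᶠ A ā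
  hintikka-holds zero ā = atomicType-holds ā
  hintikka-holds (suc j) ā =
    conj-intro A ā (atomicType ā) (realizedExtensions j ā) (atomicType-holds ā) (λ p → proj₂ (∈-realizedExtensions⁻ j ā p))

  literals∈literalChoices : ∀ {m} (ā : Vec (Carrier A) m) → lmap (literal ā) (atoms m) ∈ literalChoices m
  literals∈literalChoices {m} ā = ∈-choices _ _ (literal ā) (literal-cases ā) (atoms m)

  hintikka∈candidates : ∀ j {m} (ā : Vec (Carrier A) (suc m)) → hintikka j ā ∈ candidates j m
  hintikka∈candidates zero ā = ∈-map⁺ (conj trueᶠ) (literals∈literalChoices ā)
  hintikka∈candidates (suc j) {m} ā =
    ∈-concatMap⁺ (λ ls → lmap (conj (conj trueᶠ ls)) (sublists (lmap ex (candidates j (suc m)))))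
      (literals∈literalChoices ā) (∈-map⁺ (conj (atomicType ā)) (filter∈sublists (realized? (suc j) ā) (lmap ex (candidates j (suc m)))))

  hintikka⇒Sim : ∀ j {m} (ā : Vec (Carrier A) (suc m)) b̄ → ⟦ hintikka j ā ⟧ᶠ B b̄ → Sim j ā b̄
  hintikka⇒Sim zero ā b̄ h = atomicType⇒PartialIso ā b̄ h
  hintikka⇒Sim (suc j) {m} ā b̄ h = atomicType⇒PartialIso ā b̄ (conj-seed B b̄ (atomicType ā) (realizedExtensions j ā) h) , forth
    where
    forth : ∀ a → Σ (Carrier B) λ b → Sim j (a ∷ ā) (b ∷ b̄)
    forth a with conj-∈ B b̄ (atomicType ā) (realizedExtensions j ā) h
                   (∈-filter⁺ (realized? (suc j) ā) (∈-map⁺ ex (hintikka∈candidates j (a ∷ ā)))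
                     (s≤s (qr-hintikka j (a ∷ ā)) , a , hintikka-holds j (a ∷ ā)))
    ... | b , hb = b , hintikka⇒Sim j (a ∷ ā) (b ∷ b̄) hb

  ExPres⇒Sim : ∀ j {m} (ā : Vec (Carrier A) m) b̄ → ExPres j ā b̄ → Sim j ā b̄
  ExPres⇒Sim zero ā b̄ p = ExPres⇒PartialIso zero ā b̄ p
  ExPres⇒Sim (suc j) ā b̄ p = ExPres⇒PartialIso (suc j) ā b̄ p , forth
    where
    forth : ∀ a → Σ (Carrier B) λ b → Sim j (a ∷ ā) (b ∷ b̄)
    forth a with p (ex (hintikka j (a ∷ ā))) (s≤s (qr-hintikka j (a ∷ ā))) (a , hintikka-holds j (a ∷ ā))
    ... | b , hb = b , hintikka⇒Sim j (a ∷ ā) (b ∷ b̄) hb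

module EkStrategy {σ : Sig} (k : ℕ) (A B : Struct σ) where
  open Lists
  open Sequences
  open ExistentialGame A B
  open EMCat (Ek (σ ᴵ) k)

  CA CB : Set
  CA = Carrier A
  CB = Carrier B

  strategy : ∀ {j m} {ā : Vec CA m} {b̄ : Vec CB m} → Sim j ā b̄ → Seq CA j → Seq CB j
  strategy {suc j} g ⟨ a ⟩ = ⟨ proj₁ (proj₂ g a) ⟩
  strategy {suc j} g (a ◂ s) = proj₁ (proj₂ g a) ◂ strategy (proj₂ (proj₂ g a)) s

  strategy-seqInits : ∀ {j m} {ā : Vec CA m} {b̄ : Vec CB m} (g : Sim j ā b̄) s →
                      seqInits (strategy g s) ≡ seqMap (strategy g) (seqInits s)
  strategy-seqInits {suc j} g ⟨ a ⟩ = refl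
  strategy-seqInits {suc j} g (a ◂ s) =
    cong (⟨ b ⟩ ◂_)
      (trans (cong (seqMap (b ◂_)) (strategy-seqInits g′ s))
      (trans (seqMap-∘ (b ◂_) (strategy g′) (seqInits s))
             (sym (seqMap-∘ (strategy g) (a ◂_) (seqInits s)))))
    where
    b = proj₁ (proj₂ g a)
    g′ = proj₂ (proj₂ g a)

  -- An element named either by a variable of the current position or by a play of at most j moves.
  Term : ℕ → ℕ → Set
  Term m j = Fin m ⊎ Seq CA j

  evalA : ∀ {m j} → Vec CA m → Term m j → CA
  evalA ā (inj₁ i) = lookup ā i
  evalA ā (inj₂ s) = seqLast s

  evalB : ∀ {j m} {ā : Vec CA m} {b̄ : Vec CB m} → Sim j ā b̄ → Term m j → CB
  evalB {b̄ = b̄} g (inj₁ i) = lookup b̄ i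
  evalB g (inj₂ s) = seqLast (strategy g s)

  Compatible : ∀ {m j} → Term m j → Term m j → Set
  Compatible (inj₂ s) (inj₂ t) = Comparable (seqList s) (seqList t)
  Compatible (inj₁ _) _ = ⊤
  Compatible (inj₂ _) (inj₁ _) = ⊤

  Coherent : ∀ {m j n} → Vec (Term m j) n → Set
  Coherent ts = ∀ i i′ → Compatible (lookup ts i) (lookup ts i′)

  head : ∀ {X : Set} {j} → Seq X (suc j) → X
  head ⟨ a ⟩ = a
  head (a ◂ s) = a

  StartsWith : ∀ {m j} → CA → Term m (suc j) → Set
  StartsWith a (inj₁ _) = ⊤
  StartsWith a (inj₂ s) = head s ≡ a

  -- Play the first move: a one-move play becomes the new variable zero.
  peel : ∀ {m j} → Term m (suc j) → Term (suc m) j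
  peel (inj₁ i) = inj₁ (suc i)
  peel (inj₂ ⟨ x ⟩) = inj₁ zero
  peel (inj₂ (x ◂ s)) = inj₂ s

  evalA-peel : ∀ {m j} (ā : Vec CA m) a (t : Term m (suc j)) → StartsWith a t → evalA (a ∷ ā) (peel t) ≡ evalA ā t
  evalA-peel ā a (inj₁ i) h = refl
  evalA-peel ā a (inj₂ ⟨ x ⟩) refl = refl
  evalA-peel ā a (inj₂ (x ◂ s)) h = refl

  evalB-peel : ∀ {j m} {ā : Vec CA m} {b̄ : Vec CB m} (g : Sim (suc j) ā b̄) a (t : Term m (suc j)) → StartsWith a t →
               evalB (proj₂ (proj₂ g a)) (peel t) ≡ evalB g t
  evalB-peel g a (inj₁ i) h = refl
  evalB-peel g a (inj₂ ⟨ x ⟩) refl = refl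
  evalB-peel g a (inj₂ (x ◂ s)) refl = refl

  Compatible-peel : ∀ {m j} (t u : Term m (suc j)) → Compatible t u → Compatible (peel t) (peel u)
  Compatible-peel (inj₁ i) u c = tt
  Compatible-peel (inj₂ ⟨ x ⟩) u c = tt
  Compatible-peel (inj₂ (x ◂ s)) (inj₁ i) c = tt
  Compatible-peel (inj₂ (x ◂ s)) (inj₂ ⟨ y ⟩) c = tt
  Compatible-peel (inj₂ (x ◂ s)) (inj₂ (y ◂ t)) c = proj₂ (comparable-∷⁻ c)

  Compatible⇒StartsWith : ∀ {m j} (s : Seq CA (suc j)) (t : Term m (suc j)) → Compatible (inj₂ s) t → StartsWith (head s) t
  Compatible⇒StartsWith s (inj₁ i) c = tt
  Compatible⇒StartsWith ⟨ x ⟩ (inj₂ ⟨ y ⟩) c = sym (proj₁ (comparable-∷⁻ c))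
  Compatible⇒StartsWith ⟨ x ⟩ (inj₂ (y ◂ t)) c = sym (proj₁ (comparable-∷⁻ c))
  Compatible⇒StartsWith (x ◂ s) (inj₂ ⟨ y ⟩) c = sym (proj₁ (comparable-∷⁻ c))
  Compatible⇒StartsWith (x ◂ s) (inj₂ (y ◂ t)) c = sym (proj₁ (comparable-∷⁻ c))

  someSeq⊎allVars : ∀ {m j n} (ts : Vec (Term m j) n) →
                    (∃ λ i → ∃ λ s → lookup ts i ≡ inj₂ s) ⊎ (∃ λ (vs : Vec (Fin m) n) → ts ≡ vmap inj₁ vs)
  someSeq⊎allVars [] = inj₂ ([] , refl)
  someSeq⊎allVars (inj₂ s ∷ ts) = inj₁ (zero , s , refl)
  someSeq⊎allVars (inj₁ i ∷ ts) with someSeq⊎allVars ts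
  ... | inj₁ (i′ , s , e) = inj₁ (suc i′ , s , e)
  ... | inj₂ (vs , e) = inj₂ (i ∷ vs , cong (inj₁ i ∷_) e)

  -- Coherent plays all begin with the same move, so they can be peeled together until only
  -- variables remain, where the partial isomorphism of the current position applies.
  strategy-respects-relations : ∀ j {m} {ā : Vec CA m} {b̄ : Vec CB m} (g : Sim j ā b̄) r (ts : Vec (Term m j) (arity (σ ᴵ) r)) →
    Coherent ts → relJ A r (vmap (evalA ā) ts) ⇔ relJ B r (vmap (evalB g) ts)
  strategy-respects-relations j {ā = ā} {b̄} g r ts coh with someSeq⊎allVars ts
  ... | inj₂ (vs , refl) = subst₂ _⇔_ (cong (relJ A r) (Vecₚ.map-∘ (evalA {j = j} ā) inj₁ vs))
                                      (cong (relJ B r) (Vecₚ.map-∘ (evalB g) inj₁ vs)) (Sim⇒PartialIso j g r vs)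
  strategy-respects-relations zero g r ts coh | inj₁ (i , () , e)
  strategy-respects-relations (suc j) {ā = ā} {b̄} g r ts coh | inj₁ (i , s , e) =
    subst₂ _⇔_ peeledA peeledB (strategy-respects-relations j g′ r (vmap peel ts) coh′)
    where
    a = head s
    g′ = proj₂ (proj₂ g a)
    starts : ∀ i′ → StartsWith a (lookup ts i′)
    starts i′ = Compatible⇒StartsWith s (lookup ts i′) (subst (λ x → Compatible x (lookup ts i′)) e (coh i i′))
    coh′ : Coherent (vmap peel ts)
    coh′ i₁ i₂ = subst₂ Compatible (sym (Vecₚ.lookup-map i₁ peel ts)) (sym (Vecₚ.lookup-map i₂ peel ts))
                   (Compatible-peel (lookup ts i₁) (lookup ts i₂) (coh i₁ i₂))
    peeledA : relJ A r (vmap (evalA (a ∷ ā)) (vmap peel ts)) ≡ relJ A r (vmap (evalA ā) ts)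
    peeledA = cong (relJ A r) (trans (sym (Vecₚ.map-∘ (evalA (a ∷ ā)) peel ts))
                (map-cong-entries _ _ ts (λ i′ → evalA-peel ā a (lookup ts i′) (starts i′))))
    peeledB : relJ B r (vmap (evalB g′) (vmap peel ts)) ≡ relJ B r (vmap (evalB g) ts)
    peeledB = cong (relJ B r) (trans (sym (Vecₚ.map-∘ (evalB g′) peel ts))
                (map-cong-entries _ _ ts (λ i′ → evalB-peel g a (lookup ts i′) (starts i′))))

  comparable-plays-respected : (g₀ : Sim k [] []) → ∀ r (ss : Vec (Seq CA k) (arity (σ ᴵ) r)) →
    (∀ i i′ → Comparable (seqList (lookup ss i)) (seqList (lookup ss i′))) →
    relJ A r (vmap seqLast ss) ⇔ relJ B r (vmap seqLast (vmap (strategy g₀) ss))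
  comparable-plays-respected g₀ r ss c =
    subst₂ _⇔_ (cong (relJ A r) (sym (Vecₚ.map-∘ (evalA []) inj₂ ss)))
               (cong (relJ B r) (trans (sym (Vecₚ.map-∘ (evalB g₀) inj₂ ss)) (Vecₚ.map-∘ seqLast (strategy g₀) ss)))
      (strategy-respects-relations k g₀ r (vmap inj₂ ss) coh)
    where
    coh : Coherent (vmap inj₂ ss)
    coh i i′ = subst₂ Compatible (sym (Vecₚ.lookup-map i inj₂ ss)) (sym (Vecₚ.lookup-map i′ inj₂ ss)) (c i i′)

  morphism-monotone : (R : PreCoalg) (m : Carrier (Ob R) → Seq CA k) → (∀ x → seqInits (m x) ≡ seqMap m (α R x)) →
                      ∀ x y → Order R x y → Prefix (seqList (m x)) (seqList (m y))
  morphism-monotone R m meq x y p = ∈-seqInits⇒prefix (m x) (m y)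
    (subst (m x ∈_) (sym (prefixes-of y))
      (prefix-∈ (prefix-map m p) (subst (m x ∈_) (prefixes-of x) (prefix⇒∈-seqInits (m x) (m x) (prefix-refl _)))))
    where
    prefixes-of : ∀ z → seqList (seqInits (m z)) ≡ lmap m (seqList (α R z))
    prefixes-of z = trans (cong seqList (meq z)) (seqList-map m (α R z))

  module StrategyEmbedding (g₀ : Sim k [] []) where
    f : Seq CA k → Seq CB k
    f = strategy g₀
    open SeqMorphism f (strategy-seqInits g₀)

    comparable-map-f : ∀ {n} (ss : Vec (Seq CA k) n) → (∀ i i′ → Comparable (seqList (lookup ss i)) (seqList (lookup ss i′))) →
                       ∀ i i′ → Comparable (seqList (lookup (vmap f ss) i)) (seqList (lookup (vmap f ss) i′))
    comparable-map-f ss c i i′ =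
      subst₂ (λ x y → Comparable (seqList x) (seqList y)) (sym (Vecₚ.lookup-map i f ss)) (sym (Vecₚ.lookup-map i′ f ss))
        (comparable-preserved _ _ (c i i′))

    homomorphism : Preserves (EkStruct k (J A)) (EkStruct k (J B)) f
    homomorphism r ss (c , h) = comparable-map-f ss c , Equivalence.to (comparable-plays-respected g₀ r ss c) h

    isMor : IsMor (Cofree (J A)) (Cofree (J B)) f
    isMor = homomorphism , strategy-seqInits g₀

    -- The elements of a path are mapped to pairwise comparable plays, on which f is injective
    -- (it preserves lengths) and reflects relations.
    pathwise : IsPathwiseEmbedding (Cofree (J A)) (Cofree (J B)) f
    pathwise R (_ , (_ , _ , _ , _ , total)) m ((m-hom , m-coalg) , m-inj , m-refl) = (hom∘ , coalg∘) , inj∘ , refl∘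
      where
      chain : ∀ x y → Comparable (seqList (m x)) (seqList (m y))
      chain x y with total x y
      ... | inj₁ p = inj₁ (morphism-monotone R m m-coalg x y p)
      ... | inj₂ p = inj₂ (morphism-monotone R m m-coalg y x p)
      hom∘ : Preserves (Ob R) (EkStruct k (J B)) (λ x → f (m x))
      hom∘ r xs h = subst (rel (EkStruct k (J B)) r) (sym (Vecₚ.map-∘ f m xs)) (homomorphism r (vmap m xs) (m-hom r xs h))
      coalg∘ : ∀ x → seqInits (f (m x)) ≡ seqMap (λ x → f (m x)) (α R x)
      coalg∘ x = trans (strategy-seqInits g₀ (m x)) (trans (cong (seqMap f) (m-coalg x)) (seqMap-∘ f m (α R x)))
      inj∘ : ∀ x y → f (m x) ≡ f (m y) → x ≡ y
      inj∘ x y e = m-inj x y (seqList-injective (m x) (m y) (comparable-length-≡ (chain x y)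
        (trans (sym (length-preserved (m x))) (trans (cong (λ z → length (seqList z)) e) (length-preserved (m y))))))
      chainV : ∀ {n} (xs : Vec (Carrier (Ob R)) n) i i′ →
               Comparable (seqList (lookup (vmap m xs) i)) (seqList (lookup (vmap m xs) i′))
      chainV xs i i′ = subst₂ (λ x y → Comparable (seqList x) (seqList y))
                         (sym (Vecₚ.lookup-map i m xs)) (sym (Vecₚ.lookup-map i′ m xs)) (chain (lookup xs i) (lookup xs i′))
      refl∘ : ReflectsRel (Ob R) (EkStruct k (J B)) (λ x → f (m x))
      refl∘ r xs (_ , h) = m-refl r xs (chainV xs , Equivalence.from (comparable-plays-respected g₀ r (vmap m xs) (chainV xs))
                             (subst (relJ B r) (cong (vmap seqLast) (Vecₚ.map-∘ f m xs)) h))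

  Sim⇒PWE : Sim k [] [] → PWEᴱ σ k A B
  Sim⇒PWE g₀ = StrategyEmbedding.f g₀ , StrategyEmbedding.isMor g₀ , StrategyEmbedding.pathwise g₀

module EkPlays {σ : Sig} (k : ℕ) (A : Struct σ) where
  open Lists
  open Indices
  open Sequences
  open EMCat (Ek (σ ᴵ) k)

  playPrefix : {X : Set} {m : ℕ} → m ≤ k → Vec X m → Fin m → Seq X k
  playPrefix mk v i =
    toSeq (playUpTo v i) (playUpTo-nonempty v i) (subst (_≤ k) (sym (length-playUpTo v i)) (≤-trans (downTo-bounded i) mk))

  module _ {X : Set} {m : ℕ} (mk : m ≤ k) (v : Vec X m) where

    seqList-playPrefix : ∀ i → seqList (playPrefix mk v i) ≡ playUpTo v i
    seqList-playPrefix i = seqList-toSeq _ _ _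

    length-playPrefix : ∀ i → length (seqList (playPrefix mk v i)) ≡ length (downTo i)
    length-playPrefix i = trans (cong length (seqList-playPrefix i)) (length-playUpTo v i)

    seqLast-playPrefix : ∀ i → seqLast (playPrefix mk v i) ≡ lookup v i
    seqLast-playPrefix i = seqLast-∷ʳ (playPrefix mk v i) _ (lookup v i) (trans (seqList-playPrefix i) (proj₂ (playUpTo-∷ʳ v i)))

    seqLast-playPrefixes : ∀ {n} (vs : Vec (Fin m) n) → vmap seqLast (vmap (playPrefix mk v) vs) ≡ vmap (lookup v) vs
    seqLast-playPrefixes vs =
      trans (sym (Vecₚ.map-∘ seqLast (playPrefix mk v) vs)) (map-cong-entries _ _ vs (λ i → seqLast-playPrefix (lookup vs i)))

    playPrefix-comparable : ∀ i i′ → Comparable (seqList (playPrefix mk v i)) (seqList (playPrefix mk v i′))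
    playPrefix-comparable i i′ =
      subst₂ Comparable (sym (seqList-playPrefix i)) (sym (seqList-playPrefix i′))
        (prefixes-comparable (playUpTo-prefix v i) (playUpTo-prefix v i′))

    playPrefixes-comparable : ∀ {n} (vs : Vec (Fin m) n) i i′ →
      Comparable (seqList (lookup (vmap (playPrefix mk v) vs) i)) (seqList (lookup (vmap (playPrefix mk v) vs) i′))
    playPrefixes-comparable vs i i′ =
      subst₂ (λ x y → Comparable (seqList x) (seqList y))
        (sym (Vecₚ.lookup-map i (playPrefix mk v) vs)) (sym (Vecₚ.lookup-map i′ (playPrefix mk v) vs))
        (playPrefix-comparable (lookup vs i) (lookup vs i′))

    prefixes-playPrefix : ∀ x → lmap seqList (seqList (seqInits (playPrefix mk v x))) ≡ lmap (playUpTo v) (downTo x)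
    prefixes-playPrefix x = begin
        lmap seqList (seqList (seqInits (playPrefix mk v x)))
      ≡⟨ seqInits-list (playPrefix mk v x) ⟩
        inits⁺ (seqList (playPrefix mk v x))
      ≡⟨ cong inits⁺ (seqList-playPrefix x) ⟩
        inits⁺ (lmap (lookup v) (downTo x))
      ≡⟨ inits⁺-map (lookup v) (downTo x) ⟩
        lmap (lmap (lookup v)) (inits⁺ (downTo x))
      ≡⟨ cong (lmap (lmap (lookup v))) (inits⁺-downTo x) ⟩
        lmap (lmap (lookup v)) (lmap downTo (downTo x))
      ≡⟨ sym (Listₚ.map-∘ (downTo x)) ⟩
        lmap (playUpTo v) (downTo x)
      ∎
      where open ≡-Reasoning

  playPrefix-suc : {X : Set} {m : ℕ} (mk : m ≤ k) (mk′ : suc m ≤ k) (x : X) (v : Vec X m) (i : Fin m) →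
                   playPrefix mk′ (x ∷ v) (suc i) ≡ playPrefix mk v i
  playPrefix-suc mk mk′ x v i = toSeq-cong _ _ _ _ (playUpTo-suc x v i)

  seqList-playPrefix-zero : {X : Set} {m : ℕ} (mk′ : suc m ≤ k) (x : X) (v : Vec X m) →
                            seqList (playPrefix mk′ (x ∷ v) zero) ≡ play v ++ x ∷ []
  seqList-playPrefix-zero mk′ x v = trans (seqList-playPrefix mk′ (x ∷ v) zero) (play-∷ x v)

  positions : (m : ℕ) → Vec (Fin m) m
  positions m = tabulate id

  lookup-positions : {m : ℕ} (i : Fin m) → lookup (positions m) i ≡ i
  lookup-positions i = Vecₚ.lookup∘tabulate id i

  -- The path whose elements are the prefixes of the play ā, embedded in G(J A).
  module PlayPath {m : ℕ} (mk : m ≤ k) (ā : Vec (Carrier A) m) where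
    ι : Fin m → Seq (Carrier A) k
    ι = playPrefix mk ā

    α′ : Fin m → Seq (Fin m) k
    α′ = playPrefix mk (positions m)

    Rs : Struct (σ ᴵ)
    Rs = record { Carrier = Fin m ; rel = λ r xs → rel (EkStruct k (J A)) r (vmap ι xs) }

    R : PreCoalg
    R = Rs ,ᶜ α′

    playUpTo-positions : ∀ i → playUpTo (positions m) i ≡ downTo i
    playUpTo-positions i = trans (Listₚ.map-cong lookup-positions (downTo i)) (Listₚ.map-id (downTo i))

    playPrefix-coalgebraic : {X : Set} (v : Vec X m) (x : Fin m) → seqInits (playPrefix mk v x) ≡ seqMap (playPrefix mk v) (α′ x)
    playPrefix-coalgebraic v x = seqList-injective _ _ (Listₚ.map-injective (seqList-injective _ _) (begin
        lmap seqList (seqList (seqInits (playPrefix mk v x)))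
      ≡⟨ prefixes-playPrefix mk v x ⟩
        lmap (playUpTo v) (downTo x)
      ≡⟨ cong (lmap (playUpTo v)) (sym (trans (seqList-playPrefix mk (positions m) x) (playUpTo-positions x))) ⟩
        lmap (playUpTo v) (seqList (α′ x))
      ≡⟨ sym (Listₚ.map-cong (seqList-playPrefix mk v) (seqList (α′ x))) ⟩
        lmap (seqList ∘ playPrefix mk v) (seqList (α′ x))
      ≡⟨ Listₚ.map-∘ (seqList (α′ x)) ⟩
        lmap seqList (lmap (playPrefix mk v) (seqList (α′ x)))
      ≡⟨ cong (lmap seqList) (sym (seqList-map (playPrefix mk v) (α′ x))) ⟩
        lmap seqList (seqList (seqMap (playPrefix mk v) (α′ x)))
      ∎))
      where open ≡-Reasoning

    α′-hom : Preserves Rs (EkStruct k Rs) α′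
    α′-hom r xs h =
      playPrefixes-comparable mk (positions m) xs ,
      subst (rel Rs r) (sym (trans (seqLast-playPrefixes mk (positions m) xs)
                              (trans (map-cong-entries _ id xs (λ i → lookup-positions (lookup xs i))) (Vecₚ.map-id xs)))) h

    α′-counit : ∀ i → seqLast (α′ i) ≡ i
    α′-counit i = trans (seqLast-playPrefix mk (positions m) i) (lookup-positions i)

    isPath : IsPath R
    isPath = (α′-hom , α′-counit , λ x → sym (playPrefix-coalgebraic (positions m) x)) ,
             (m , ↔-id (Fin m)) ,
             (λ x → prefix-refl _) ,
             (λ x y z → prefix-trans) ,
             (λ x y p q → downTo-length-injective x y
                (trans (sym (length-playPrefix mk (positions m) x))
                  (trans (≤-antisym (prefix-length p) (prefix-length q)) (length-playPrefix mk (positions m) y)))) ,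
             playPrefix-comparable mk (positions m)

    ι-embedding : IsEmbedding R (Cofree (J A)) ι
    ι-embedding =
      ((λ r xs h → h) , playPrefix-coalgebraic ā) ,
      (λ x y e → downTo-length-injective x y
         (trans (sym (length-playPrefix mk ā x)) (trans (cong (length ∘ seqList) e) (length-playPrefix mk ā y)))) ,
      (λ r xs h → h)

module EkEmbeddingStrategy {σ : Sig} (k : ℕ) (A B : Struct σ) where
  open Lists
  open Indices
  open Sequences
  open ExistentialGame A B
  open EMCat (Ek (σ ᴵ) k)
  open EkPlays {σ} k
  open PlayPath A

  module _ (f : Seq (Carrier A) k → Seq (Carrier B) k) (f-mor : IsMor (Cofree (J A)) (Cofree (J B)) f)
           (f-pathwise : IsPathwiseEmbedding (Cofree (J A)) (Cofree (J B)) f) where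
    open SeqMorphism f (proj₂ f-mor)

    MapsPlay : ∀ {m} → m ≤ k → Vec (Carrier A) m → Vec (Carrier B) m → Set
    MapsPlay mk ā b̄ = ∀ i → f (playPrefix A mk ā i) ≡ playPrefix B mk b̄ i

    MapsPlay⇒PartialIso : ∀ {m} (mk : m ≤ k) (ā : Vec (Carrier A) m) (b̄ : Vec (Carrier B) m) → MapsPlay mk ā b̄ → PartialIso ā b̄
    MapsPlay⇒PartialIso mk ā b̄ maps r vs = mk⇔ forth back
      where
      image : vmap f (vmap (playPrefix A mk ā) vs) ≡ vmap (playPrefix B mk b̄) vs
      image = trans (sym (Vecₚ.map-∘ f (playPrefix A mk ā) vs)) (map-cong-entries _ _ vs (λ i → maps (lookup vs i)))
      forth : relJ A r (vmap (lookup ā) vs) → relJ B r (vmap (lookup b̄) vs)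
      forth h = subst (relJ B r) (trans (cong (vmap seqLast) image) (seqLast-playPrefixes B mk b̄ vs))
                  (proj₂ (proj₁ f-mor r (vmap (playPrefix A mk ā) vs)
                     (playPrefixes-comparable A mk ā vs , subst (relJ A r) (sym (seqLast-playPrefixes A mk ā vs)) h)))
      back : relJ B r (vmap (lookup b̄) vs) → relJ A r (vmap (lookup ā) vs)
      back hb = subst (relJ A r) (seqLast-playPrefixes A mk ā vs)
        (proj₂ (proj₂ (proj₂ (f-pathwise (R mk ā) (isPath mk ā) (ι mk ā) (ι-embedding mk ā))) r vs
          (subst (rel (EkStruct k (J B)) r) (trans (sym image) (sym (Vecₚ.map-∘ f (ι mk ā) vs)))
            (playPrefixes-comparable B mk b̄ vs , subst (relJ B r) (sym (seqLast-playPrefixes B mk b̄ vs)) hb))))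

    play-prefix-preserved : ∀ {m} (mk : m ≤ k) (ā : Vec (Carrier A) m) (b̄ : Vec (Carrier B) m) → MapsPlay mk ā b̄ →
                            (s : Seq (Carrier A) k) → Prefix (play ā) (seqList s) → Prefix (play b̄) (seqList (f s))
    play-prefix-preserved mk [] [] maps s p = prefix-[] _
    play-prefix-preserved mk (a ∷ ā) (b ∷ b̄) maps s p =
      subst (λ l → Prefix l (seqList (f s))) (trans (cong seqList (maps zero)) (seqList-playPrefix B mk (b ∷ b̄) zero))
        (prefix-preserved _ s (subst (λ l → Prefix l (seqList s)) (sym (seqList-playPrefix A mk (a ∷ ā) zero)) p))

    -- The answer b is the last element of the image of the extended play.
    MapsPlay-extend : ∀ {m} (mk : m ≤ k) (mk′ : suc m ≤ k) (ā : Vec (Carrier A) m) (b̄ : Vec (Carrier B) m) →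
                      MapsPlay mk ā b̄ → ∀ a → Σ (Carrier B) λ b → MapsPlay mk′ (a ∷ ā) (b ∷ b̄)
    MapsPlay-extend {m} mk mk′ ā b̄ maps a = b , maps′
      where
      s = playPrefix A mk′ (a ∷ ā) zero
      b = seqLast (f s)
      extends : ∃ λ y → seqList (f s) ≡ play b̄ ++ y ∷ []
      extends = prefix-length-suc
        (play-prefix-preserved mk ā b̄ maps s (subst (Prefix (play ā)) (sym (seqList-playPrefix-zero A mk′ a ā)) (prefix-++ _ _)))
        (trans (length-preserved s) (trans (length-playPrefix A mk′ (a ∷ ā) zero)
          (trans (length-allFinDesc (suc m)) (cong suc (sym (length-play b̄))))))
      seqList-fs : seqList (f s) ≡ play b̄ ++ b ∷ []
      seqList-fs with extends
      ... | y , e = trans e (cong (λ w → play b̄ ++ w ∷ []) (sym (seqLast-∷ʳ (f s) (play b̄) y e)))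
      maps′ : MapsPlay mk′ (a ∷ ā) (b ∷ b̄)
      maps′ zero = seqList-injective _ _ (trans seqList-fs (sym (seqList-playPrefix-zero B mk′ b b̄)))
      maps′ (suc i) = trans (cong f (playPrefix-suc A mk mk′ a ā i)) (trans (maps i) (sym (playPrefix-suc B mk mk′ b b̄ i)))

    MapsPlay⇒Sim : ∀ j {m} (ā : Vec (Carrier A) m) (b̄ : Vec (Carrier B) m) (mk : m + j ≤ k) →
                   MapsPlay (≤-trans (m≤m+n m j) mk) ā b̄ → Sim j ā b̄
    MapsPlay⇒Sim zero ā b̄ mk maps = MapsPlay⇒PartialIso _ ā b̄ maps
    MapsPlay⇒Sim (suc j) {m} ā b̄ mk maps = MapsPlay⇒PartialIso _ ā b̄ maps , forth
      where
      mk′ : suc m + j ≤ k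
      mk′ = subst (_≤ k) (+-suc m j) mk
      forth : ∀ a → Σ (Carrier B) λ b → Sim j (a ∷ ā) (b ∷ b̄)
      forth a with MapsPlay-extend _ (≤-trans (m≤m+n (suc m) j) mk′) ā b̄ maps a
      ... | b , maps′ = b , MapsPlay⇒Sim j (a ∷ ā) (b ∷ b̄) mk′ maps′

  PWE⇒Sim : PWEᴱ σ k A B → Sim k [] []
  PWE⇒Sim (f , f-mor , f-pathwise) = MapsPlay⇒Sim f f-mor f-pathwise k [] [] ≤-refl (λ ())

module Classical (em₀ : ExcludedMiddle 0ℓ) (em₁ : ExcludedMiddle (lsuc 0ℓ)) where

  ¬preserves⇒counterexample : {F : Set₁} {P Q : F → Set} → ¬ (∀ φ → P φ → Q φ) → Σ F λ φ → P φ × ¬ Q φ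
  ¬preserves⇒counterexample {F} {P} {Q} ¬pres with em₁ {Σ F λ φ → P φ × ¬ Q φ}
  ... | yes c = c
  ... | no ¬c = ⊥-elim (¬pres λ φ pφ → decide φ pφ (em₀ {Q φ}))
    where
    decide : ∀ φ → P φ → Dec (Q φ) → Q φ
    decide φ pφ (yes qφ) = qφ
    decide φ pφ (no ¬qφ) = ⊥-elim (¬c (φ , pφ , ¬qφ))

module Scopes (n : ℕ) where

  bind-self : (S : Scope n) (i : Fin n) → T (bind S i i)
  bind-self S i with i ≟ i
  ... | yes _ = tt
  ... | no i≢i = ⊥-elim (i≢i refl)

  bind-keep : (S : Scope n) (i j : Fin n) → T (S j) → T (bind S i j)
  bind-keep S i j q with j ≟ i
  ... | yes _ = tt
  ... | no _ = q

  unbind : (S : Scope n) (i j : Fin n) → ¬ j ≡ i → T (bind S i j) → T (S j)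
  unbind S i j j≢i q with j ≟ i
  ... | yes e = ⊥-elim (j≢i e)
  ... | no _ = q

  extend-self : ∀ {X : Set} {S : Scope n} (env : Env X S) (i : Fin n) (a : X) (p : T (bind S i i)) → extend env i a i p ≡ a
  extend-self env i a p with i ≟ i
  ... | yes _ = refl
  ... | no i≢i = ⊥-elim (i≢i refl)

  extend-other : ∀ {X : Set} {S : Scope n} (env : Env X S) (i : Fin n) (a : X) (j : Fin n)
                 (p : T (bind S i j)) (q : T (S j)) → ¬ j ≡ i → extend env i a j p ≡ env j q
  extend-other env i a j p q j≢i with j ≟ i
  ... | yes e = ⊥-elim (j≢i e)
  ... | no _ = cong (env j) (T-irrelevant p q)

module ExistentialLinf {σ : Sig} {n : ℕ} where

  InScope : Scope n → ∀ {m} → Vec (Fin n) m → Set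
  InScope S vs = All (λ i → T (S i)) vs

  atomᴵ negAtomᴵ : ∀ {S} (r : Sym (σ ᴵ)) (vs : Vec (Fin n) (arity (σ ᴵ) r)) → InScope S vs → ELinf σ n S
  atomᴵ (inj₁ _) (i ∷ j ∷ []) (p ∷ q ∷ []) = eq i j p q
  atomᴵ (inj₂ r) vs ps = atom r vs ps
  negAtomᴵ (inj₁ _) (i ∷ j ∷ []) (p ∷ q ∷ []) = neq i j p q
  negAtomᴵ (inj₂ r) vs ps = natom r vs ps

  module _ (C : Struct σ) {S : Scope n} (env : Env (Carrier C) S) where

    ⟦atomᴵ⟧ : ∀ r vs ps → ⟦ atomᴵ r vs ps ⟧ˡ C env ≡ relJ C r (evalVars vs ps env)
    ⟦atomᴵ⟧ (inj₁ _) (i ∷ j ∷ []) (p ∷ q ∷ []) = refl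
    ⟦atomᴵ⟧ (inj₂ r) vs ps = refl

    ⟦negAtomᴵ⟧ : ∀ r vs ps → ⟦ negAtomᴵ r vs ps ⟧ˡ C env ≡ (¬ relJ C r (evalVars vs ps env))
    ⟦negAtomᴵ⟧ (inj₁ _) (i ∷ j ∷ []) (p ∷ q ∷ []) = refl
    ⟦negAtomᴵ⟧ (inj₂ r) vs ps = refl

module LinfGame (em₀ : ExcludedMiddle 0ℓ) (em₁ : ExcludedMiddle (lsuc 0ℓ)) {σ : Sig} (n : ℕ) (A B : Struct σ) where
  open ExistentialLinf {σ} {n}
  open Classical em₀ em₁

  ExPres : (S : Scope n) → Env (Carrier A) S → Env (Carrier B) S → Set₁
  ExPres S eA eB = ∀ (φ : ELinf σ n S) → ⟦ φ ⟧ˡ A eA → ⟦ φ ⟧ˡ B eB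

  PartialIso : (S : Scope n) → Env (Carrier A) S → Env (Carrier B) S → Set
  PartialIso S eA eB = ∀ (r : Sym (σ ᴵ)) (vs : Vec (Fin n) (arity (σ ᴵ) r)) (ps : InScope S vs) →
                       relJ A r (evalVars vs ps eA) ⇔ relJ B r (evalVars vs ps eB)

  ExPres⇒PartialIso : ∀ {S eA eB} → ExPres S eA eB → PartialIso S eA eB
  ExPres⇒PartialIso {S} {eA} {eB} w r vs ps = mk⇔ forth back
    where
    forth : relJ A r (evalVars vs ps eA) → relJ B r (evalVars vs ps eB)
    forth h = subst id (⟦atomᴵ⟧ B eB r vs ps) (w (atomᴵ r vs ps) (subst id (sym (⟦atomᴵ⟧ A eA r vs ps)) h))
    back : relJ B r (evalVars vs ps eB) → relJ A r (evalVars vs ps eA)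
    back hb with em₀ {relJ A r (evalVars vs ps eA)}
    ... | yes h = h
    ... | no nh = ⊥-elim (subst id (⟦negAtomᴵ⟧ B eB r vs ps)
                    (w (negAtomᴵ r vs ps) (subst id (sym (⟦negAtomᴵ⟧ A eA r vs ps)) nh)) hb)

  -- If no answer b worked, choose for every b a formula true at a and false at b; their
  -- (infinitary) conjunction, existentially quantified, then holds in A but fails in B.
  ExPres-forth : ∀ {S eA eB} → ExPres S eA eB →
                 ∀ i a → Σ (Carrier B) λ b → ExPres (bind S i) (extend eA i a) (extend eB i b)
  ExPres-forth {S} {eA} {eB} w i a with em₁ {Σ (Carrier B) λ b → ExPres (bind S i) (extend eA i a) (extend eB i b)}
  ... | yes answer = answer
  ... | no no-answer = ⊥-elim (proj₂ (proj₂ (counterexample b′)) (holds b′))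
    where
    counterexample : ∀ b → Σ (ELinf σ n (bind S i)) λ φ → ⟦ φ ⟧ˡ A (extend eA i a) × ¬ ⟦ φ ⟧ˡ B (extend eB i b)
    counterexample b = ¬preserves⇒counterexample {P = λ φ → ⟦ φ ⟧ˡ A (extend eA i a)} (λ pres → no-answer (b , pres))
    φ : ELinf σ n S
    φ = ex i (⋀ (Carrier B) (λ b → proj₁ (counterexample b)))
    distinguishing : ⟦ φ ⟧ˡ B eB
    distinguishing = w φ (a , λ b → proj₁ (proj₂ (counterexample b)))
    b′ = proj₁ distinguishing
    holds : ∀ b → ⟦ proj₁ (counterexample b) ⟧ˡ B (extend eB i b′)
    holds = proj₂ distinguishing

module PnStrategy (em₀ : ExcludedMiddle 0ℓ) (em₁ : ExcludedMiddle (lsuc 0ℓ)) {σ : Sig} (n : ℕ) (A B : Struct σ) where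
  open Lists
  open Plays
  open Scopes n
  open ExistentialLinf {σ} {n}
  open LinfGame em₀ em₁ n A B
  open EMCat (Pn (σ ᴵ) n)

  CA CB : Set
  CA = Carrier A
  CB = Carrier B

  strategy : ∀ {S eA eB} → ExPres S eA eB → NE (Fin n × CA) → NE (Fin n × CB)
  strategy w ⟪ (p , a) ⟫ = ⟪ (p , proj₁ (ExPres-forth w p a)) ⟫
  strategy w ((p , a) ◃ s) = (p , proj₁ (ExPres-forth w p a)) ◃ strategy (proj₂ (ExPres-forth w p a)) s

  strategy-pinits : ∀ {S eA eB} (w : ExPres S eA eB) s → pinits (strategy w s) ≡ neMap (map₂ (strategy w)) (pinits s)
  strategy-pinits w ⟪ (p , a) ⟫ = refl
  strategy-pinits w ((p , a) ◃ s) =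
    cong ((p , ⟪ (p , b) ⟫) ◃_)
      (trans (cong (neMap (λ qt → (proj₁ qt , (p , b) ◃ proj₂ qt))) (strategy-pinits w′ s))
      (trans (neMap-∘ (λ qt → (proj₁ qt , (p , b) ◃ proj₂ qt)) (map₂ (strategy w′)) (pinits s))
             (sym (neMap-∘ (map₂ (strategy w)) (λ qt → (proj₁ qt , (p , a) ◃ proj₂ qt)) (pinits s)))))
    where
    b = proj₁ (ExPres-forth w p a)
    w′ = proj₂ (ExPres-forth w p a)

  Var : Scope n → Set
  Var S = Σ (Fin n) λ i → T (S i)

  -- An element named either by a variable in scope or by a play.
  Term : Scope n → Set
  Term S = Var S ⊎ NE (Fin n × CA)

  evalA : ∀ {S} → Env CA S → Term S → CA
  evalA eA (inj₁ (i , p)) = eA i p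
  evalA eA (inj₂ s) = proj₂ (neLast s)

  evalB : ∀ {S eA eB} → ExPres S eA eB → Term S → CB
  evalB {eB = eB} w (inj₁ (i , p)) = eB i p
  evalB w (inj₂ s) = proj₂ (neLast (strategy w s))

  Compatible : ∀ {S} → Term S → Term S → Set
  Compatible (inj₂ s) (inj₂ t) = PebbleCompatible s t
  Compatible (inj₁ (v , _)) (inj₂ t) = ¬ (v ∈ labels t)
  Compatible (inj₁ _) (inj₁ _) = ⊤
  Compatible (inj₂ _) (inj₁ _) = ⊤

  Coherent : ∀ {S m} → Vec (Term S) m → Set
  Coherent ts = ∀ i i′ → Compatible (lookup ts i) (lookup ts i′)

  -- Play the first move with pebble p: a one-move play becomes the variable p.
  peel : ∀ {S} (p : Fin n) → Term S → Term (bind S p)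
  peel {S} p (inj₁ (v , q)) = inj₁ (v , bind-keep S p v q)
  peel {S} p (inj₂ ⟪ _ ⟫) = inj₁ (p , bind-self S p)
  peel p (inj₂ (_ ◃ s)) = inj₂ s

  first : ∀ {X : Set} → NE X → X
  first ⟪ m ⟫ = m
  first (m ◃ _) = m

  Unaffected : ∀ {S} → Fin n × CA → Term S → Set
  Unaffected (p , a) (inj₁ (v , _)) = ¬ v ≡ p
  Unaffected m (inj₂ s) = first s ≡ m

  Compatible⇒Unaffected : ∀ {S} (s : NE (Fin n × CA)) (t : Term S) → Compatible t (inj₂ s) → Compatible (inj₂ s) t →
                          Unaffected (first s) t
  Compatible⇒Unaffected ⟪ m ⟫ (inj₁ (v , q)) c₁ c₂ = λ e → c₁ (here e)
  Compatible⇒Unaffected (m ◃ s) (inj₁ (v , q)) c₁ c₂ = λ e → c₁ (here e)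
  Compatible⇒Unaffected ⟪ m ⟫ (inj₂ ⟪ m′ ⟫) c₁ c₂ = sym (proj₁ (comparable-∷⁻ (proj₁ c₂)))
  Compatible⇒Unaffected ⟪ m ⟫ (inj₂ (m′ ◃ t)) c₁ c₂ = sym (proj₁ (comparable-∷⁻ (proj₁ c₂)))
  Compatible⇒Unaffected (m ◃ s) (inj₂ ⟪ m′ ⟫) c₁ c₂ = sym (proj₁ (comparable-∷⁻ (proj₁ c₂)))
  Compatible⇒Unaffected (m ◃ s) (inj₂ (m′ ◃ t)) c₁ c₂ = sym (proj₁ (comparable-∷⁻ (proj₁ c₂)))

  evalA-peel : ∀ {S} (eA : Env CA S) p a (t : Term S) → Unaffected (p , a) t → evalA (extend eA p a) (peel p t) ≡ evalA eA t
  evalA-peel {S} eA p a (inj₁ (v , q)) v≢p = extend-other eA p a v (bind-keep S p v q) q v≢p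
  evalA-peel {S} eA p a (inj₂ ⟪ .(p , a) ⟫) refl = extend-self eA p a (bind-self S p)
  evalA-peel eA p a (inj₂ (m ◃ s)) _ = refl

  evalB-peel : ∀ {S eA eB} (w : ExPres S eA eB) p a (t : Term S) → Unaffected (p , a) t →
               evalB (proj₂ (ExPres-forth w p a)) (peel p t) ≡ evalB w t
  evalB-peel {S} {eB = eB} w p a (inj₁ (v , q)) v≢p = extend-other eB p _ v (bind-keep S p v q) q v≢p
  evalB-peel {S} {eB = eB} w p a (inj₂ ⟪ .(p , a) ⟫) refl = extend-self eB p _ (bind-self S p)
  evalB-peel w p a (inj₂ (.(p , a) ◃ s)) refl = refl

  Compatible-peel : ∀ {S} p a (t u : Term S) → Unaffected (p , a) t → Unaffected (p , a) u → Compatible t u →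
                    Compatible (peel p t) (peel p u)
  Compatible-peel p a (inj₁ _) (inj₁ _) _ _ c = tt
  Compatible-peel p a (inj₁ _) (inj₂ ⟪ _ ⟫) _ _ c = tt
  Compatible-peel p a (inj₁ (v , q)) (inj₂ (m′ ◃ s)) _ _ c = λ mem → c (there mem)
  Compatible-peel p a (inj₂ ⟪ _ ⟫) (inj₁ _) _ _ c = tt
  Compatible-peel p a (inj₂ ⟪ _ ⟫) (inj₂ ⟪ _ ⟫) _ _ c = tt
  Compatible-peel p a (inj₂ ⟪ .(p , a) ⟫) (inj₂ (.(p , a) ◃ t)) refl refl c =
    λ mem → proj₂ c (neList t , refl) (neList t) refl mem
  Compatible-peel p a (inj₂ (_ ◃ s)) (inj₁ _) _ _ c = tt
  Compatible-peel p a (inj₂ (_ ◃ s)) (inj₂ ⟪ _ ⟫) _ _ c = tt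
  Compatible-peel p a (inj₂ (.(p , a) ◃ s)) (inj₂ (.(p , a) ◃ t)) refl refl c =
    proj₂ (comparable-∷⁻ (proj₁ c)) , λ pr u e → proj₂ c (prefix-∷ pr) u (cong ((p , a) ∷_) e)

  size : ∀ {S} → Term S → ℕ
  size (inj₁ _) = 0
  size (inj₂ s) = length (neList s)

  size-peel : ∀ {S} p N (t : Term S) → size t ≤ suc N → size (peel p t) ≤ N
  size-peel p N (inj₁ _) b = z≤n
  size-peel p N (inj₂ ⟪ _ ⟫) b = z≤n
  size-peel p N (inj₂ (_ ◃ s)) (s≤s b) = b

  someSeq⊎allVars : ∀ {S m} (ts : Vec (Term S) m) →
                    (∃ λ i → ∃ λ s → lookup ts i ≡ inj₂ s) ⊎ (∃ λ (vs : Vec (Var S) m) → ts ≡ vmap inj₁ vs)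
  someSeq⊎allVars [] = inj₂ ([] , refl)
  someSeq⊎allVars (inj₂ s ∷ ts) = inj₁ (zero , s , refl)
  someSeq⊎allVars (inj₁ i ∷ ts) with someSeq⊎allVars ts
  ... | inj₁ (i′ , s , e) = inj₁ (suc i′ , s , e)
  ... | inj₂ (vs , e) = inj₂ (i ∷ vs , cong (inj₁ i ∷_) e)

  vars-InScope : ∀ {S m} (vars : Vec (Var S) m) → InScope S (vmap proj₁ vars)
  vars-InScope [] = []
  vars-InScope ((v , q) ∷ vars) = q ∷ vars-InScope vars

  evalVars-vars : ∀ {X S m} (env : Env X S) (vars : Vec (Var S) m) →
                  evalVars (vmap proj₁ vars) (vars-InScope vars) env ≡ vmap (λ v → env (proj₁ v) (proj₂ v)) vars
  evalVars-vars env [] = refl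
  evalVars-vars env ((v , q) ∷ vars) = cong (env v q ∷_) (evalVars-vars env vars)

  -- As for E_k, but a variable survives peeling only if its pebble is not the one being moved,
  -- which is exactly what Compatible guarantees; N bounds the length of the plays.
  strategy-respects-relations : ∀ N {S eA eB} (w : ExPres S eA eB) r (ts : Vec (Term S) (arity (σ ᴵ) r)) →
    Coherent ts → (∀ i → size (lookup ts i) ≤ N) → relJ A r (vmap (evalA eA) ts) ⇔ relJ B r (vmap (evalB w) ts)
  strategy-respects-relations N {S} {eA} {eB} w r ts coh bounded with someSeq⊎allVars ts
  ... | inj₂ (vars , refl) =
    subst₂ _⇔_ (cong (relJ A r) (trans (evalVars-vars eA vars) (Vecₚ.map-∘ (evalA eA) inj₁ vars)))
               (cong (relJ B r) (trans (evalVars-vars eB vars) (Vecₚ.map-∘ (evalB w) inj₁ vars)))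
               (ExPres⇒PartialIso w r (vmap proj₁ vars) (vars-InScope vars))
  strategy-respects-relations zero w r ts coh bounded | inj₁ (i , s , e) with subst (λ x → size x ≤ 0) e (bounded i)
  ... | b with ≤-trans (neList-nonempty-length s) b
  ... | ()
  strategy-respects-relations (suc N) {S} {eA} {eB} w r ts coh bounded | inj₁ (i , s , e) =
    subst₂ _⇔_ peeledA peeledB (strategy-respects-relations N w′ r (vmap (peel p) ts) coh′ bounded′)
    where
    p = proj₁ (first s)
    a = proj₂ (first s)
    w′ = proj₂ (ExPres-forth w p a)
    unaffected : ∀ i′ → Unaffected (p , a) (lookup ts i′)
    unaffected i′ = Compatible⇒Unaffected s (lookup ts i′) (subst (Compatible (lookup ts i′)) e (coh i′ i))
                      (subst (λ x → Compatible x (lookup ts i′)) e (coh i i′))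
    coh′ : Coherent (vmap (peel p) ts)
    coh′ i₁ i₂ = subst₂ Compatible (sym (Vecₚ.lookup-map i₁ (peel p) ts)) (sym (Vecₚ.lookup-map i₂ (peel p) ts))
                   (Compatible-peel p a (lookup ts i₁) (lookup ts i₂) (unaffected i₁) (unaffected i₂) (coh i₁ i₂))
    bounded′ : ∀ i′ → size (lookup (vmap (peel p) ts) i′) ≤ N
    bounded′ i′ = subst (λ x → size x ≤ N) (sym (Vecₚ.lookup-map i′ (peel p) ts)) (size-peel p N (lookup ts i′) (bounded i′))
    peeledA : relJ A r (vmap (evalA (extend eA p a)) (vmap (peel p) ts)) ≡ relJ A r (vmap (evalA eA) ts)
    peeledA = cong (relJ A r) (trans (sym (Vecₚ.map-∘ (evalA (extend eA p a)) (peel p) ts))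
                (map-cong-entries _ _ ts (λ i′ → evalA-peel eA p a (lookup ts i′) (unaffected i′))))
    peeledB : relJ B r (vmap (evalB w′) (vmap (peel p) ts)) ≡ relJ B r (vmap (evalB w) ts)
    peeledB = cong (relJ B r) (trans (sym (Vecₚ.map-∘ (evalB w′) (peel p) ts))
                (map-cong-entries _ _ ts (λ i′ → evalB-peel w p a (lookup ts i′) (unaffected i′))))

  totalLength : ∀ {X : Set} {m} → Vec (NE (Fin n × X)) m → ℕ
  totalLength [] = 0
  totalLength (s ∷ ss) = length (neList s) + totalLength ss

  length≤totalLength : ∀ {X : Set} {m} (ss : Vec (NE (Fin n × X)) m) i → length (neList (lookup ss i)) ≤ totalLength ss
  length≤totalLength (s ∷ ss) zero = m≤m+n _ _
  length≤totalLength (s ∷ ss) (suc i) = ≤-trans (length≤totalLength ss i) (m≤n+m _ _)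

  coherent-plays-respected : (w₀ : ExPres noVars emptyEnv emptyEnv) → ∀ r (ss : Vec (NE (Fin n × CA)) (arity (σ ᴵ) r)) →
    PebbleCoherent ss → relJ A r (vmap (λ s → proj₂ (neLast s)) ss) ⇔ relJ B r (vmap (λ s → proj₂ (neLast s)) (vmap (strategy w₀) ss))
  coherent-plays-respected w₀ r ss c =
    subst₂ _⇔_ (cong (relJ A r) (sym (Vecₚ.map-∘ (evalA emptyEnv) inj₂ ss)))
               (cong (relJ B r) (trans (sym (Vecₚ.map-∘ (evalB w₀) inj₂ ss)) (Vecₚ.map-∘ (λ s → proj₂ (neLast s)) (strategy w₀) ss)))
      (strategy-respects-relations (totalLength ss) w₀ r (vmap inj₂ ss) coh bounded)
    where
    coh : Coherent (vmap inj₂ ss)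
    coh i i′ = subst₂ Compatible (sym (Vecₚ.lookup-map i inj₂ ss)) (sym (Vecₚ.lookup-map i′ inj₂ ss)) (c i i′)
    bounded : ∀ i → size (lookup (vmap (inj₂ {A = Var noVars}) ss) i) ≤ totalLength ss
    bounded i = subst (λ x → size {noVars} x ≤ totalLength ss) (sym (Vecₚ.lookup-map i inj₂ ss)) (length≤totalLength ss i)

  morphism-monotone : (R : PreCoalg) (m : Carrier (Ob R) → NE (Fin n × CA)) → (∀ x → pinits (m x) ≡ neMap (map₂ m) (α R x)) →
                      ∀ x y → Order R x y → Prefix (neList (m x)) (neList (m y))
  morphism-monotone R m meq x y p = ∈-prefixes⇒prefix (m x) (m y)
    (subst (m x ∈_) (sym (prefixes-of y))
      (prefix-∈ (prefix-map (λ y → m (proj₂ y)) p) (subst (m x ∈_) (prefixes-of x) (prefix⇒∈-prefixes (m x) (m x) (prefix-refl _)))))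
    where
    prefixes-of : ∀ z → prefixes (m z) ≡ lmap (λ y → m (proj₂ y)) (neList (α R z))
    prefixes-of z = trans (cong (λ t → lmap proj₂ (neList t)) (meq z))
                      (trans (cong (lmap proj₂) (neList-map (map₂ m) (α R z))) (sym (Listₚ.map-∘ (neList (α R z)))))

  module StrategyEmbedding (w₀ : ExPres noVars emptyEnv emptyEnv) where
    f : NE (Fin n × CA) → NE (Fin n × CB)
    f = strategy w₀
    open PnMorphism f (strategy-pinits w₀)

    homomorphism : Preserves (PnStruct n (J A)) (PnStruct n (J B)) f
    homomorphism r ss (c , h) = PebbleCoherent-preserved ss c , Equivalence.to (coherent-plays-respected w₀ r ss c) h

    isMor : IsMor (Cofree (J A)) (Cofree (J B)) f
    isMor = homomorphism , strategy-pinits w₀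

    pathwise : IsPathwiseEmbedding (Cofree (J A)) (Cofree (J B)) f
    pathwise R (_ , (_ , _ , _ , _ , total)) m ((m-hom , m-coalg) , m-inj , m-refl) = (hom∘ , coalg∘) , inj∘ , refl∘
      where
      chain : ∀ x y → Comparable (neList (m x)) (neList (m y))
      chain x y with total x y
      ... | inj₁ p = inj₁ (morphism-monotone R m m-coalg x y p)
      ... | inj₂ p = inj₂ (morphism-monotone R m m-coalg y x p)
      hom∘ : Preserves (Ob R) (PnStruct n (J B)) (λ x → f (m x))
      hom∘ r xs h = subst (rel (PnStruct n (J B)) r) (sym (Vecₚ.map-∘ f m xs)) (homomorphism r (vmap m xs) (m-hom r xs h))
      coalg∘ : ∀ x → pinits (f (m x)) ≡ neMap (map₂ (λ x → f (m x))) (α R x)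
      coalg∘ x = trans (strategy-pinits w₀ (m x)) (trans (cong (neMap (map₂ f)) (m-coalg x)) (neMap-∘ (map₂ f) (map₂ m) (α R x)))
      inj∘ : ∀ x y → f (m x) ≡ f (m y) → x ≡ y
      inj∘ x y e = m-inj x y (neList-injective (m x) (m y) (comparable-length-≡ (chain x y)
        (trans (sym (length-preserved (m x))) (trans (cong (λ z → length (neList z)) e) (length-preserved (m y))))))
      refl∘ : ReflectsRel (Ob R) (PnStruct n (J B)) (λ x → f (m x))
      refl∘ r xs (c-B , h) =
        m-refl r xs (coherent , Equivalence.from (coherent-plays-respected w₀ r (vmap m xs) coherent)
                                  (subst (relJ B r) (cong (vmap (λ s → proj₂ (neLast s))) (Vecₚ.map-∘ f m xs)) h))
        where
        coherent : PebbleCoherent (vmap m xs)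
        coherent i j = subst₂ PebbleCompatible (sym (Vecₚ.lookup-map i m xs)) (sym (Vecₚ.lookup-map j m xs))
          (chain (lookup xs i) (lookup xs j) ,
           λ p → NotMovedBetween-reflected _ _ p
                   (proj₂ (subst₂ PebbleCompatible (Vecₚ.lookup-map i (λ x → f (m x)) xs) (Vecₚ.lookup-map j (λ x → f (m x)) xs) (c-B i j))
                     (prefix-preserved _ _ p)))

  ExPres⇒PWE : ExPres noVars emptyEnv emptyEnv → PWEᴾ σ n A B
  ExPres⇒PWE w₀ = StrategyEmbedding.f w₀ , StrategyEmbedding.isMor w₀ , StrategyEmbedding.pathwise w₀

module PnPlays {σ : Sig} (n : ℕ) where
  open Lists
  open Indices
  open Plays

  playPrefix : {X : Set} {ℓ : ℕ} → Vec (Fin n × X) ℓ → Fin ℓ → NE (Fin n × X)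
  playPrefix v i = toNE (playUpTo v i) (playUpTo-nonempty v i)

  -- No later move (later moves have smaller indices) uses the pebble of move x.
  NotMovedAfter : {X : Set} {ℓ : ℕ} → Vec (Fin n × X) ℓ → Fin ℓ → Set
  NotMovedAfter v x = ∀ y → toℕ y < toℕ x → ¬ proj₁ (lookup v y) ≡ proj₁ (lookup v x)

  module _ {X : Set} {ℓ : ℕ} (v : Vec (Fin n × X) ℓ) where

    neList-playPrefix : ∀ i → neList (playPrefix v i) ≡ playUpTo v i
    neList-playPrefix i = neList-toNE _ _

    length-playPrefix : ∀ i → length (neList (playPrefix v i)) ≡ length (downTo i)
    length-playPrefix i = trans (cong length (neList-playPrefix i)) (length-playUpTo v i)

    neLast-playPrefix : ∀ i → neLast (playPrefix v i) ≡ lookup v i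
    neLast-playPrefix i = neLast-∷ʳ (playPrefix v i) _ (lookup v i) (trans (neList-playPrefix i) (proj₂ (playUpTo-∷ʳ v i)))

    labels-playPrefix : ∀ i → labels (playPrefix v i) ≡ lmap (proj₁ ∘ lookup v) (downTo i)
    labels-playPrefix i = trans (cong (lmap proj₁) (neList-playPrefix i)) (sym (Listₚ.map-∘ (downTo i)))

    playPrefix-comparable : ∀ i i′ → Comparable (neList (playPrefix v i)) (neList (playPrefix v i′))
    playPrefix-comparable i i′ =
      subst₂ Comparable (sym (neList-playPrefix i)) (sym (neList-playPrefix i′))
        (prefixes-comparable (playUpTo-prefix v i) (playUpTo-prefix v i′))

    playPrefix-NotMovedBetween : ∀ x x′ → NotMovedAfter v x → Prefix (neList (playPrefix v x)) (neList (playPrefix v x′)) →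
                                 NotMovedBetween (playPrefix v x) (playPrefix v x′)
    playPrefix-NotMovedBetween x x′ not-moved p u e mem =
      not-moved (proj₁ moved) (downTo-extension-< x x′ u₀ e₀ (proj₁ (proj₂ moved)))
        (trans (sym (proj₂ (proj₂ moved))) (cong proj₁ (neLast-playPrefix x)))
      where
      indices-prefix : Prefix (downTo x) (downTo x′)
      indices-prefix = comparable-length-≤ (downTo-comparable x x′)
        (subst₂ _≤_ (length-playPrefix x) (length-playPrefix x′) (prefix-length p))
      u₀ = proj₁ indices-prefix
      e₀ = proj₂ indices-prefix
      u≡ : u ≡ lmap (lookup v) u₀
      u≡ = Listₚ.++-cancelˡ (playUpTo v x) _ _
             (trans (cong (_++ u) (sym (neList-playPrefix x))) (trans e (trans (neList-playPrefix x′)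
               (trans (cong (lmap (lookup v)) (sym e₀)) (map-++ (lookup v) (downTo x) u₀)))))
      moved : Σ (Fin ℓ) λ y → (y ∈ u₀) × (proj₁ (neLast (playPrefix v x)) ≡ proj₁ (lookup v y))
      moved with ∈-map⁻ proj₁ mem
      ... | mv , mv∈u , e₁ with ∈-map⁻ (lookup v) (subst (mv ∈_) u≡ mv∈u)
      ... | y , y∈u₀ , refl = y , y∈u₀ , e₁

    playPrefixes-coherent : ∀ {m} (xs : Vec (Fin ℓ) m) → (∀ i → NotMovedAfter v (lookup xs i)) →
                            PebbleCoherent (vmap (playPrefix v) xs)
    playPrefixes-coherent xs not-moved i j =
      subst₂ PebbleCompatible (sym (Vecₚ.lookup-map i (playPrefix v) xs)) (sym (Vecₚ.lookup-map j (playPrefix v) xs))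
        (playPrefix-comparable (lookup xs i) (lookup xs j) ,
         playPrefix-NotMovedBetween (lookup xs i) (lookup xs j) (not-moved i))

    prefixes-playPrefix : ∀ x → lmap neList (prefixes (playPrefix v x)) ≡ lmap (neList ∘ playPrefix v) (downTo x)
    prefixes-playPrefix x = begin
        lmap neList (prefixes (playPrefix v x))
      ≡⟨ prefixes-list (playPrefix v x) ⟩
        inits⁺ (neList (playPrefix v x))
      ≡⟨ cong inits⁺ (neList-playPrefix x) ⟩
        inits⁺ (lmap (lookup v) (downTo x))
      ≡⟨ inits⁺-map (lookup v) (downTo x) ⟩
        lmap (lmap (lookup v)) (inits⁺ (downTo x))
      ≡⟨ cong (lmap (lmap (lookup v))) (inits⁺-downTo x) ⟩
        lmap (lmap (lookup v)) (lmap downTo (downTo x))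
      ≡⟨ sym (Listₚ.map-∘ (downTo x)) ⟩
        lmap (playUpTo v) (downTo x)
      ≡⟨ sym (Listₚ.map-cong neList-playPrefix (downTo x)) ⟩
        lmap (neList ∘ playPrefix v) (downTo x)
      ∎
      where open ≡-Reasoning

  playPrefix-suc : {X : Set} {ℓ : ℕ} (mv : Fin n × X) (v : Vec (Fin n × X) ℓ) (i : Fin ℓ) →
                   playPrefix (mv ∷ v) (suc i) ≡ playPrefix v i
  playPrefix-suc mv v i = toNE-cong _ _ (playUpTo-suc mv v i)

  neList-playPrefix-zero : {X : Set} {ℓ : ℕ} (mv : Fin n × X) (v : Vec (Fin n × X) ℓ) →
                           neList (playPrefix (mv ∷ v) zero) ≡ play v ++ mv ∷ []
  neList-playPrefix-zero mv v = trans (neList-playPrefix (mv ∷ v) zero) (play-∷ mv v)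

  -- The path of prefixes of the play ms, coded by the positions of its moves with the same pebbles.
  module PlayPath {A : Struct σ} {ℓ : ℕ} (ms : Vec (Fin n × Carrier A) ℓ) where
    open EMCat (Pn (σ ᴵ) n)

    pebble : Fin ℓ → Fin n
    pebble y = proj₁ (lookup ms y)

    positions : Vec (Fin n × Fin ℓ) ℓ
    positions = tabulate (λ y → (pebble y , y))

    lookup-positions : ∀ y → lookup positions y ≡ (pebble y , y)
    lookup-positions y = Vecₚ.lookup∘tabulate _ y

    ι : Fin ℓ → NE (Fin n × Carrier A)
    ι = playPrefix ms

    α′ : Fin ℓ → NE (Fin n × Fin ℓ)
    α′ = playPrefix positions

    Rs : Struct (σ ᴵ)
    Rs = record { Carrier = Fin ℓ ; rel = λ r xs → rel (PnStruct n (J A)) r (vmap ι xs) }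

    R : PreCoalg
    R = Rs ,ᶜ α′

    positions-α′ : ∀ x → lmap proj₂ (neList (α′ x)) ≡ downTo x
    positions-α′ x = trans (cong (lmap proj₂) (neList-playPrefix positions x))
                      (trans (sym (Listₚ.map-∘ (downTo x)))
                        (trans (Listₚ.map-cong (λ y → cong proj₂ (lookup-positions y)) (downTo x)) (Listₚ.map-id (downTo x))))

    labels-α′ : ∀ x → labels (α′ x) ≡ lmap pebble (downTo x)
    labels-α′ x = trans (labels-playPrefix positions x) (Listₚ.map-cong (λ y → cong proj₁ (lookup-positions y)) (downTo x))

    α′-prefix⇒ι-prefix : ∀ x y → Prefix (neList (α′ x)) (neList (α′ y)) → Prefix (neList (ι x)) (neList (ι y))
    α′-prefix⇒ι-prefix x y p = subst₂ Prefix (sym (neList-playPrefix ms x)) (sym (neList-playPrefix ms y))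
      (prefix-map (lookup ms) (subst₂ Prefix (positions-α′ x) (positions-α′ y) (prefix-map proj₂ p)))

    playPrefix-coalgebraic : {X : Set} (v : Vec (Fin n × X) ℓ) → (∀ y → proj₁ (lookup v y) ≡ pebble y) →
                             ∀ x → pinits (playPrefix v x) ≡ neMap (map₂ (playPrefix v)) (α′ x)
    playPrefix-coalgebraic v same-pebbles x = neList-injective _ _ (map-proj-injective _ _ same-labels same-prefixes)
      where
      open ≡-Reasoning
      image-list : lmap proj₂ (neList (neMap (map₂ (playPrefix v)) (α′ x))) ≡ lmap (playPrefix v ∘ proj₂) (neList (α′ x))
      image-list = trans (cong (lmap proj₂) (neList-map (map₂ (playPrefix v)) (α′ x))) (sym (Listₚ.map-∘ (neList (α′ x))))
      same-labels : lmap proj₁ (neList (pinits (playPrefix v x))) ≡ lmap proj₁ (neList (neMap (map₂ (playPrefix v)) (α′ x)))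
      same-labels = begin
          lmap proj₁ (neList (pinits (playPrefix v x)))
        ≡⟨ labels-pinits (playPrefix v x) ⟩
          labels (playPrefix v x)
        ≡⟨ trans (labels-playPrefix v x) (Listₚ.map-cong same-pebbles (downTo x)) ⟩
          lmap pebble (downTo x)
        ≡⟨ sym (labels-α′ x) ⟩
          labels (α′ x)
        ≡⟨ trans (Listₚ.map-∘ (neList (α′ x))) (cong (lmap proj₁) (sym (neList-map (map₂ (playPrefix v)) (α′ x)))) ⟩
          lmap proj₁ (neList (neMap (map₂ (playPrefix v)) (α′ x)))
        ∎
      same-prefixes : prefixes (playPrefix v x) ≡ lmap proj₂ (neList (neMap (map₂ (playPrefix v)) (α′ x)))
      same-prefixes = Listₚ.map-injective (neList-injective _ _) (begin
          lmap neList (prefixes (playPrefix v x))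
        ≡⟨ prefixes-playPrefix v x ⟩
          lmap (neList ∘ playPrefix v) (downTo x)
        ≡⟨ cong (lmap (neList ∘ playPrefix v)) (sym (positions-α′ x)) ⟩
          lmap (neList ∘ playPrefix v) (lmap proj₂ (neList (α′ x)))
        ≡⟨ trans (sym (Listₚ.map-∘ (neList (α′ x)))) (Listₚ.map-∘ (neList (α′ x))) ⟩
          lmap neList (lmap (playPrefix v ∘ proj₂) (neList (α′ x)))
        ≡⟨ cong (lmap neList) (sym image-list) ⟩
          lmap neList (lmap proj₂ (neList (neMap (map₂ (playPrefix v)) (α′ x))))
        ∎)

    α′-counit : ∀ x → proj₂ (neLast (α′ x)) ≡ x
    α′-counit x = trans (cong proj₂ (neLast-playPrefix positions x)) (cong proj₂ (lookup-positions x))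

    α′-hom : Preserves Rs (PnStruct n Rs) α′
    α′-hom r xs (c , h) = coherent , subst (rel Rs r) (sym lasts) (c , h)
      where
      lasts : vmap (λ s → proj₂ (neLast s)) (vmap α′ xs) ≡ xs
      lasts = trans (sym (Vecₚ.map-∘ _ α′ xs)) (trans (map-cong-entries _ id xs (λ i → α′-counit (lookup xs i))) (Vecₚ.map-id xs))
      same-labels : ∀ x → labels (ι x) ≡ labels (α′ x)
      same-labels x = trans (labels-playPrefix ms x) (sym (labels-α′ x))
      coherent : PebbleCoherent (vmap α′ xs)
      coherent i j = subst₂ PebbleCompatible (sym (Vecₚ.lookup-map i α′ xs)) (sym (Vecₚ.lookup-map j α′ xs))
        (playPrefix-comparable positions (lookup xs i) (lookup xs j) ,
         λ p → NotMovedBetween-transfer (ι (lookup xs i)) (ι (lookup xs j)) (α′ (lookup xs i)) (α′ (lookup xs j))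
                 (same-labels _) (same-labels _) (α′-prefix⇒ι-prefix _ _ p)
                 (proj₂ (subst₂ PebbleCompatible (Vecₚ.lookup-map i ι xs) (Vecₚ.lookup-map j ι xs) (c i j)) (α′-prefix⇒ι-prefix _ _ p)))

    isPath : IsPath R
    isPath = (α′-hom , α′-counit ,
              (λ x → sym (playPrefix-coalgebraic positions (λ y → cong proj₁ (lookup-positions y)) x))) ,
             (ℓ , ↔-id (Fin ℓ)) ,
             (λ x → prefix-refl _) ,
             (λ x y z → prefix-trans) ,
             (λ x y p q → downTo-length-injective x y
                (trans (sym (length-playPrefix positions x))
                  (trans (≤-antisym (prefix-length p) (prefix-length q)) (length-playPrefix positions y)))) ,
             playPrefix-comparable positions

    ι-embedding : IsEmbedding R (Cofree (J A)) ι
    ι-embedding =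
      ((λ r xs h → h) , playPrefix-coalgebraic ms (λ y → refl)) ,
      (λ x y e → downTo-length-injective x y
         (trans (sym (length-playPrefix ms x)) (trans (cong (length ∘ neList) e) (length-playPrefix ms y)))) ,
      (λ r xs h → h)

module PnEmbeddingStrategy {σ : Sig} (n : ℕ) (A B : Struct σ) where
  open Lists
  open Indices
  open Plays
  open Scopes n
  open ExistentialLinf {σ} {n}
  open EMCat (Pn (σ ᴵ) n)
  open PnPlays {σ} n

  CA CB : Set
  CA = Carrier A
  CB = Carrier B

  module _ (f : NE (Fin n × CA) → NE (Fin n × CB)) (f-mor : IsMor (Cofree (J A)) (Cofree (J B)) f)
           (f-pathwise : IsPathwiseEmbedding (Cofree (J A)) (Cofree (J B)) f) where
    open PnMorphism f (proj₂ f-mor)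

    MapsPlay : ∀ {ℓ} → Vec (Fin n × CA) ℓ → Vec (Fin n × CB) ℓ → Set
    MapsPlay ms ms′ = ∀ i → f (playPrefix ms i) ≡ playPrefix ms′ i

    MapsPlay-same-pebbles : ∀ {ℓ} (ms : Vec (Fin n × CA) ℓ) ms′ → MapsPlay ms ms′ → ∀ i → proj₁ (lookup ms′ i) ≡ proj₁ (lookup ms i)
    MapsPlay-same-pebbles ms ms′ maps i =
      trans (sym (cong proj₁ (neLast-playPrefix ms′ i)))
        (trans (cong (proj₁ ∘ neLast) (sym (maps i)))
          (trans (same-labels⇒same-last-pebble (f (playPrefix ms i)) (playPrefix ms i) (labels-preserved (playPrefix ms i)))
                 (cong proj₁ (neLast-playPrefix ms i))))

    Tracks : ∀ {ℓ} (S : Scope n) → Env CA S → Env CB S → Vec (Fin n × CA) ℓ → Vec (Fin n × CB) ℓ → Set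
    Tracks {ℓ} S eA eB ms ms′ = ∀ i (p : T (S i)) → Σ (Fin ℓ) λ x →
      (lookup ms x ≡ (i , eA i p)) × (lookup ms′ x ≡ (i , eB i p)) × (∀ y → toℕ y < toℕ x → ¬ proj₁ (lookup ms y) ≡ i)

    module _ {ℓ} {S : Scope n} {eA : Env CA S} {eB : Env CB S} (ms : Vec (Fin n × CA) ℓ) (ms′ : Vec (Fin n × CB) ℓ)
             (maps : MapsPlay ms ms′) (tracks : Tracks S eA eB ms ms′) where

      moves : ∀ {m} (vs : Vec (Fin n) m) → InScope S vs → Vec (Fin ℓ) m
      moves [] [] = []
      moves (v ∷ vs) (p ∷ ps) = proj₁ (tracks v p) ∷ moves vs ps

      moves-not-movedA : ∀ {m} (vs : Vec (Fin n) m) (ps : InScope S vs) i → NotMovedAfter ms (lookup (moves vs ps) i)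
      moves-not-movedA (v ∷ vs) (p ∷ ps) zero y lt e =
        proj₂ (proj₂ (proj₂ (tracks v p))) y lt (trans e (cong proj₁ (proj₁ (proj₂ (tracks v p)))))
      moves-not-movedA (v ∷ vs) (p ∷ ps) (suc i) = moves-not-movedA vs ps i

      moves-not-movedB : ∀ {m} (vs : Vec (Fin n) m) (ps : InScope S vs) i → NotMovedAfter ms′ (lookup (moves vs ps) i)
      moves-not-movedB vs ps i y lt e =
        moves-not-movedA vs ps i y lt (trans (sym (MapsPlay-same-pebbles ms ms′ maps y)) (trans e (MapsPlay-same-pebbles ms ms′ maps _)))

      lastsA : ∀ {m} (vs : Vec (Fin n) m) (ps : InScope S vs) →
               vmap (λ s → proj₂ (neLast s)) (vmap (playPrefix ms) (moves vs ps)) ≡ evalVars vs ps eA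
      lastsA [] [] = refl
      lastsA (v ∷ vs) (p ∷ ps) =
        cong₂ _∷_ (trans (cong proj₂ (neLast-playPrefix ms _)) (cong proj₂ (proj₁ (proj₂ (tracks v p))))) (lastsA vs ps)

      lastsB : ∀ {m} (vs : Vec (Fin n) m) (ps : InScope S vs) →
               vmap (λ s → proj₂ (neLast s)) (vmap (playPrefix ms′) (moves vs ps)) ≡ evalVars vs ps eB
      lastsB [] [] = refl
      lastsB (v ∷ vs) (p ∷ ps) =
        cong₂ _∷_ (trans (cong proj₂ (neLast-playPrefix ms′ _)) (cong proj₂ (proj₁ (proj₂ (proj₂ (tracks v p)))))) (lastsB vs ps)

      image : ∀ {m} (xs : Vec (Fin ℓ) m) → vmap f (vmap (playPrefix ms) xs) ≡ vmap (playPrefix ms′) xs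
      image xs = trans (sym (Vecₚ.map-∘ f (playPrefix ms) xs)) (map-cong-entries _ _ xs (λ i → maps (lookup xs i)))

      tracked-relations : ∀ r vs ps → relJ A r (evalVars vs ps eA) ⇔ relJ B r (evalVars vs ps eB)
      tracked-relations r vs ps = mk⇔ forth back
        where
        xs = moves vs ps
        open PlayPath {A} ms
        forth : relJ A r (evalVars vs ps eA) → relJ B r (evalVars vs ps eB)
        forth h = subst (relJ B r) (trans (cong (vmap (λ s → proj₂ (neLast s))) (image xs)) (lastsB vs ps))
          (proj₂ (proj₁ f-mor r (vmap (playPrefix ms) xs)
            (playPrefixes-coherent ms xs (moves-not-movedA vs ps) , subst (relJ A r) (sym (lastsA vs ps)) h)))
        back : relJ B r (evalVars vs ps eB) → relJ A r (evalVars vs ps eA)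
        back hb = subst (relJ A r) (lastsA vs ps) (proj₂ (proj₂ (proj₂ (f-pathwise R isPath ι ι-embedding)) r xs
          (subst (rel (PnStruct n (J B)) r) (trans (sym (image xs)) (sym (Vecₚ.map-∘ f ι xs)))
            (playPrefixes-coherent ms′ xs (moves-not-movedB vs ps) , subst (relJ B r) (sym (lastsB vs ps)) hb))))

    play-prefix-preserved : ∀ {ℓ} (ms : Vec (Fin n × CA) ℓ) (ms′ : Vec (Fin n × CB) ℓ) → MapsPlay ms ms′ →
                            (s : NE (Fin n × CA)) → Prefix (play ms) (neList s) → Prefix (play ms′) (neList (f s))
    play-prefix-preserved [] [] maps s p = prefix-[] _
    play-prefix-preserved (a ∷ ms) (b ∷ ms′) maps s p =
      subst (λ l → Prefix l (neList (f s))) (trans (cong neList (maps zero)) (neList-playPrefix (b ∷ ms′) zero))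
        (prefix-preserved _ s (subst (λ l → Prefix l (neList s)) (sym (neList-playPrefix (a ∷ ms) zero)) p))

    MapsPlay-extend : ∀ {ℓ} (ms : Vec (Fin n × CA) ℓ) (ms′ : Vec (Fin n × CB) ℓ) → MapsPlay ms ms′ →
                      ∀ i a → Σ CB λ b → MapsPlay ((i , a) ∷ ms) ((i , b) ∷ ms′)
    MapsPlay-extend {ℓ} ms ms′ maps i a = b , maps′
      where
      s = playPrefix ((i , a) ∷ ms) zero
      b = proj₂ (neLast (f s))
      extends : ∃ λ y → neList (f s) ≡ play ms′ ++ y ∷ []
      extends = prefix-length-suc
        (play-prefix-preserved ms ms′ maps s (subst (Prefix (play ms)) (sym (neList-playPrefix-zero (i , a) ms)) (prefix-++ _ _)))
        (trans (length-preserved s) (trans (length-playPrefix ((i , a) ∷ ms) zero)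
          (trans (length-allFinDesc (suc ℓ)) (cong suc (sym (length-play ms′))))))
      pebble-i : proj₁ (neLast (f s)) ≡ i
      pebble-i = trans (same-labels⇒same-last-pebble (f s) s (labels-preserved s)) (cong proj₁ (neLast-playPrefix ((i , a) ∷ ms) zero))
      neList-fs : neList (f s) ≡ play ms′ ++ (i , b) ∷ []
      neList-fs with extends
      ... | y , e = trans e (cong (λ w → play ms′ ++ w ∷ []) (trans (sym (neLast-∷ʳ (f s) (play ms′) y e)) (cong (_, b) pebble-i)))
      maps′ : MapsPlay ((i , a) ∷ ms) ((i , b) ∷ ms′)
      maps′ zero = neList-injective _ _ (trans neList-fs (sym (neList-playPrefix-zero (i , b) ms′)))
      maps′ (suc y) = trans (cong f (playPrefix-suc (i , a) ms y)) (trans (maps y) (sym (playPrefix-suc (i , b) ms′ y)))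

    Tracks-extend : ∀ {ℓ} {S : Scope n} {eA : Env CA S} {eB : Env CB S} (ms : Vec (Fin n × CA) ℓ) (ms′ : Vec (Fin n × CB) ℓ) →
                    Tracks S eA eB ms ms′ → ∀ i a b → Tracks (bind S i) (extend eA i a) (extend eB i b) ((i , a) ∷ ms) ((i , b) ∷ ms′)
    Tracks-extend {S = S} {eA} {eB} ms ms′ tracks i a b j p = by-cases (j ≟ i)
      where
      by-cases : Dec (j ≡ i) → Σ (Fin _) λ x →
        (lookup ((i , a) ∷ ms) x ≡ (j , extend eA i a j p)) × (lookup ((i , b) ∷ ms′) x ≡ (j , extend eB i b j p)) ×
        (∀ y → toℕ y < toℕ x → ¬ proj₁ (lookup ((i , a) ∷ ms) y) ≡ j)
      by-cases (yes refl) = zero , cong (i ,_) (sym (extend-self eA i a p)) , cong (i ,_) (sym (extend-self eB i b p)) , (λ y ())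
      by-cases (no j≢i) = suc x , trans eA-x (cong (j ,_) (sym (extend-other eA i a j p q j≢i))) ,
                           trans eB-x (cong (j ,_) (sym (extend-other eB i b j p q j≢i))) , not-moved
        where
        q : T (S j)
        q = unbind S i j j≢i p
        x = proj₁ (tracks j q)
        eA-x = proj₁ (proj₂ (tracks j q))
        eB-x = proj₁ (proj₂ (proj₂ (tracks j q)))
        not-moved : ∀ y → toℕ y < toℕ (suc x) → ¬ proj₁ (lookup ((i , a) ∷ ms) y) ≡ j
        not-moved zero lt e = j≢i (sym e)
        not-moved (suc y) (s≤s lt) e = proj₂ (proj₂ (proj₂ (tracks j q))) y lt e

    MapsPlay⇒ExPres : ∀ {S : Scope n} (φ : ELinf σ n S) {ℓ} (ms : Vec (Fin n × CA) ℓ) (ms′ : Vec (Fin n × CB) ℓ)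
                      (eA : Env CA S) (eB : Env CB S) → MapsPlay ms ms′ → Tracks S eA eB ms ms′ → ⟦ φ ⟧ˡ A eA → ⟦ φ ⟧ˡ B eB
    MapsPlay⇒ExPres (atom r vs ps) ms ms′ eA eB maps tracks h =
      Equivalence.to (tracked-relations ms ms′ maps tracks (inj₂ r) vs ps) h
    MapsPlay⇒ExPres (natom r vs ps) ms ms′ eA eB maps tracks h hb =
      h (Equivalence.from (tracked-relations ms ms′ maps tracks (inj₂ r) vs ps) hb)
    MapsPlay⇒ExPres (eq i j p q) ms ms′ eA eB maps tracks h =
      Equivalence.to (tracked-relations ms ms′ maps tracks (inj₁ tt) (i ∷ j ∷ []) (p ∷ q ∷ [])) h
    MapsPlay⇒ExPres (neq i j p q) ms ms′ eA eB maps tracks h hb =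
      h (Equivalence.from (tracked-relations ms ms′ maps tracks (inj₁ tt) (i ∷ j ∷ []) (p ∷ q ∷ [])) hb)
    MapsPlay⇒ExPres (⋀ I φs) ms ms′ eA eB maps tracks h = λ x → MapsPlay⇒ExPres (φs x) ms ms′ eA eB maps tracks (h x)
    MapsPlay⇒ExPres (⋁ I φs) ms ms′ eA eB maps tracks (x , h) = x , MapsPlay⇒ExPres (φs x) ms ms′ eA eB maps tracks h
    MapsPlay⇒ExPres (ex i φ) ms ms′ eA eB maps tracks (a , h) =
      b , MapsPlay⇒ExPres φ ((i , a) ∷ ms) ((i , b) ∷ ms′) (extend eA i a) (extend eB i b) maps′ (Tracks-extend ms ms′ tracks i a b) h
      where
      b = proj₁ (MapsPlay-extend ms ms′ maps i a)
      maps′ = proj₂ (MapsPlay-extend ms ms′ maps i a)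

  PWE⇒ExPres : PWEᴾ σ n A B → ExPresLinf σ n A B
  PWE⇒ExPres (f , f-mor , f-pathwise) φ = MapsPlay⇒ExPres f f-mor f-pathwise φ [] [] emptyEnv emptyEnv (λ ()) (λ i ())

module ModalGame (em : ExcludedMiddle 0ℓ) (p q : ℕ) (A B : Pointed (modalSig p q)) where
  open Lists
  open Modal p q

  KA KB : Kripke
  KA = struct A
  KB = struct B
  CA CB : Set
  CA = Carrier KA
  CB = Carrier KB

  SameAtoms : CA → CB → Set
  SameAtoms x y = ∀ i → Pu KA i x ⇔ Pu KB i y

  -- Duplicator wins the j-round forth-only bisimulation game from (x , y).
  Sim : ℕ → CA → CB → Set
  Sim zero x y = SameAtoms x y
  Sim (suc j) x y = SameAtoms x y × (∀ l x′ → Rb KA l x x′ → Σ CB λ y′ → Rb KB l y y′ × Sim j x′ y′)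

  Sim⇒SameAtoms : ∀ j {x y} → Sim j x y → SameAtoms x y
  Sim⇒SameAtoms zero g = g
  Sim⇒SameAtoms (suc j) g = proj₁ g

  ExPres : ℕ → CA → CB → Set
  ExPres j x y = ∀ φ → depth φ ≤ j → sat φ KA x → sat φ KB y

  Sim⇒ExPres : ∀ j x y → Sim j x y → ExPres j x y
  Sim⇒ExPres j x y g ⊤ᵐ d h = tt
  Sim⇒ExPres j x y g (var i) d h = Equivalence.to (Sim⇒SameAtoms j g i) h
  Sim⇒ExPres j x y g (nvar i) d h hb = h (Equivalence.from (Sim⇒SameAtoms j g i) hb)
  Sim⇒ExPres j x y g (φ ∧ᵐ ψ) d (h₁ , h₂) =
    Sim⇒ExPres j x y g φ (m⊔n≤o⇒m≤o (depth φ) (depth ψ) d) h₁ , Sim⇒ExPres j x y g ψ (m⊔n≤o⇒n≤o (depth φ) (depth ψ) d) h₂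
  Sim⇒ExPres j x y g (φ ∨ᵐ ψ) d (inj₁ h) = inj₁ (Sim⇒ExPres j x y g φ (m⊔n≤o⇒m≤o (depth φ) (depth ψ) d) h)
  Sim⇒ExPres j x y g (φ ∨ᵐ ψ) d (inj₂ h) = inj₂ (Sim⇒ExPres j x y g ψ (m⊔n≤o⇒n≤o (depth φ) (depth ψ) d) h)
  Sim⇒ExPres (suc j) x y g (◇ l φ) (s≤s d) (x′ , r , h) with proj₂ g l x′ r
  ... | y′ , r′ , g′ = y′ , r′ , Sim⇒ExPres j x′ y′ g′ φ d h

  ExPres⇒SameAtoms : ∀ j x y → ExPres j x y → SameAtoms x y
  ExPres⇒SameAtoms j x y pres i = mk⇔ (pres (var i) z≤n) back
    where
    back : Pu KB i y → Pu KA i x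
    back hb with em {Pu KA i x}
    ... | yes h = h
    ... | no nh = ⊥-elim (pres (nvar i) z≤n nh hb)

  conj : MForm → List MForm → MForm
  conj = foldr _∧ᵐ_

  module _ (K : Kripke) (x : Carrier K) where
    conj-intro : ∀ s L → sat s K x → (∀ {φ} → φ ∈ L → sat φ K x) → sat (conj s L) K x
    conj-intro s [] hs hL = hs
    conj-intro s (y ∷ L) hs hL = hL (here refl) , conj-intro s L hs (λ m → hL (there m))

    conj-seed : ∀ s L → sat (conj s L) K x → sat s K x
    conj-seed s [] h = h
    conj-seed s (y ∷ L) h = conj-seed s L (proj₂ h)

    conj-∈ : ∀ s L → sat (conj s L) K x → ∀ {φ} → φ ∈ L → sat φ K x
    conj-∈ s (y ∷ L) h (here refl) = proj₁ h
    conj-∈ s (y ∷ L) h (there m) = conj-∈ s L (proj₂ h) m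

  depth-conj : ∀ j s L → depth s ≤ j → (∀ {φ} → φ ∈ L → depth φ ≤ j) → depth (conj s L) ≤ j
  depth-conj j s [] hs hL = hs
  depth-conj j s (y ∷ L) hs hL = ⊔-lub (hL (here refl)) (depth-conj j s L hs (λ m → hL (there m)))

  literal : CA → Fin p → MForm
  literal x i with em {Pu KA i x}
  ... | yes _ = var i
  ... | no _ = nvar i

  literal-cases : ∀ x i → (literal x i ≡ var i) ⊎ (literal x i ≡ nvar i)
  literal-cases x i with em {Pu KA i x}
  ... | yes _ = inj₁ refl
  ... | no _ = inj₂ refl

  depth-literal : ∀ x i → depth (literal x i) ≡ 0
  depth-literal x i with em {Pu KA i x}
  ... | yes _ = refl
  ... | no _ = refl

  literal-holds : ∀ x i → sat (literal x i) KA x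
  literal-holds x i with em {Pu KA i x}
  ... | yes h = h
  ... | no nh = nh

  literal⇒⇔ : ∀ x y i → sat (literal x i) KB y → Pu KA i x ⇔ Pu KB i y
  literal⇒⇔ x y i h with em {Pu KA i x}
  ... | yes ha = mk⇔ (λ _ → h) (λ _ → ha)
  ... | no nh = mk⇔ (λ ha → ⊥-elim (nh ha)) (λ hb → ⊥-elim (h hb))

  atomicType : CA → MForm
  atomicType x = conj ⊤ᵐ (lmap (literal x) (allFin p))

  depth-atomicType : ∀ x j → depth (atomicType x) ≤ j
  depth-atomicType x j = depth-conj j ⊤ᵐ (lmap (literal x) (allFin p)) z≤n literal-depth
    where
    literal-depth : ∀ {φ} → φ ∈ lmap (literal x) (allFin p) → depth φ ≤ j
    literal-depth m with ∈-map⁻ (literal x) m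
    ... | i , _ , refl = subst (_≤ j) (sym (depth-literal x i)) z≤n

  atomicType-holds : ∀ x → sat (atomicType x) KA x
  atomicType-holds x = conj-intro KA x ⊤ᵐ _ tt literal-true
    where
    literal-true : ∀ {φ} → φ ∈ lmap (literal x) (allFin p) → sat φ KA x
    literal-true m with ∈-map⁻ (literal x) m
    ... | i , _ , refl = literal-holds x i

  atomicType⇒SameAtoms : ∀ x y → sat (atomicType x) KB y → SameAtoms x y
  atomicType⇒SameAtoms x y h i = literal⇒⇔ x y i (conj-∈ KB y ⊤ᵐ _ h (∈-map⁺ (literal x) (∈-allFin i)))

  Realized : ℕ → CA → MForm → Set
  Realized j x φ = depth φ ≤ j × sat φ KA x

  realized? : ∀ j x → U.Decidable (Realized j x)
  realized? j x φ = (depth φ ≤? j) ×-dec em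

  literalChoices : List (List MForm)
  literalChoices = choices var nvar (allFin p)

  diamonds : List MForm → List MForm
  diamonds L = concatMap (λ l → lmap (◇ l) L) (allFin q)

  -- A finite list containing every Hintikka formula of depth j.
  candidates : ℕ → List MForm
  candidates zero = lmap (conj ⊤ᵐ) literalChoices
  candidates (suc j) = concatMap (λ ls → lmap (conj (conj ⊤ᵐ ls)) (sublists (diamonds (candidates j)))) literalChoices

  realizedDiamonds : ℕ → CA → List MForm
  realizedDiamonds j x = filter (realized? (suc j) x) (diamonds (candidates j))

  ∈-realizedDiamonds⁻ : ∀ j x {φ} → φ ∈ realizedDiamonds j x → Realized (suc j) x φ
  ∈-realizedDiamonds⁻ j x m = proj₂ (∈-filter⁻ (realized? (suc j) x) {xs = diamonds (candidates j)} m)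

  hintikka : ℕ → CA → MForm
  hintikka zero x = atomicType x
  hintikka (suc j) x = conj (atomicType x) (realizedDiamonds j x)

  depth-hintikka : ∀ j x → depth (hintikka j x) ≤ j
  depth-hintikka zero x = depth-atomicType x zero
  depth-hintikka (suc j) x =
    depth-conj (suc j) (atomicType x) (realizedDiamonds j x) (depth-atomicType x (suc j)) (λ m → proj₁ (∈-realizedDiamonds⁻ j x m))

  hintikka-holds : ∀ j x → sat (hintikka j x) KA x
  hintikka-holds zero x = atomicType-holds x
  hintikka-holds (suc j) x =
    conj-intro KA x (atomicType x) (realizedDiamonds j x) (atomicType-holds x) (λ m → proj₂ (∈-realizedDiamonds⁻ j x m))

  literals∈literalChoices : ∀ x → lmap (literal x) (allFin p) ∈ literalChoices
  literals∈literalChoices x = ∈-choices var nvar (literal x) (literal-cases x) (allFin p)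

  hintikka∈candidates : ∀ j x → hintikka j x ∈ candidates j
  hintikka∈candidates zero x = ∈-map⁺ (conj ⊤ᵐ) (literals∈literalChoices x)
  hintikka∈candidates (suc j) x =
    ∈-concatMap⁺ (λ ls → lmap (conj (conj ⊤ᵐ ls)) (sublists (diamonds (candidates j))))
      (literals∈literalChoices x) (∈-map⁺ (conj (atomicType x)) (filter∈sublists (realized? (suc j) x) (diamonds (candidates j))))

  hintikka⇒Sim : ∀ j x y → sat (hintikka j x) KB y → Sim j x y
  hintikka⇒Sim zero x y h = atomicType⇒SameAtoms x y h
  hintikka⇒Sim (suc j) x y h = atomicType⇒SameAtoms x y (conj-seed KB y (atomicType x) (realizedDiamonds j x) h) , forth
    where
    forth : ∀ l x′ → Rb KA l x x′ → Σ CB λ y′ → Rb KB l y y′ × Sim j x′ y′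
    forth l x′ r with conj-∈ KB y (atomicType x) (realizedDiamonds j x) h
                        (∈-filter⁺ (realized? (suc j) x)
                          (∈-concatMap⁺ (λ l → lmap (◇ l) (candidates j)) (∈-allFin l) (∈-map⁺ (◇ l) (hintikka∈candidates j x′)))
                          (s≤s (depth-hintikka j x′) , x′ , r , hintikka-holds j x′))
    ... | y′ , r′ , hb = y′ , r′ , hintikka⇒Sim j x′ y′ hb

  ExPres⇒Sim : ∀ j x y → ExPres j x y → Sim j x y
  ExPres⇒Sim zero x y pres = ExPres⇒SameAtoms zero x y pres
  ExPres⇒Sim (suc j) x y pres = ExPres⇒SameAtoms (suc j) x y pres , forth
    where
    forth : ∀ l x′ → Rb KA l x x′ → Σ CB λ y′ → Rb KB l y y′ × Sim j x′ y′
    forth l x′ r with pres (◇ l (hintikka j x′)) (s≤s (depth-hintikka j x′)) (x′ , r , hintikka-holds j x′)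
    ... | y′ , r′ , hb = y′ , r′ , hintikka⇒Sim j x′ y′ hb

module ModalPaths (p q : ℕ) where
  open Lists
  open Modal p q

  MPath-≡ : ∀ {K : Pointed σM} {j} (π π′ : MPath K j) → steps π ≡ steps π′ → π ≡ π′
  MPath-≡ (mpath st _ _) (mpath .st _ _) refl = refl

  labels-go : ∀ {K : Pointed σM} {j} (cur : MPath K j) rest .v .b → lmap proj₁ (go K cur rest v b) ≡ lmap proj₁ rest
  labels-go cur [] v b = refl
  labels-go (mpath st b₀ v₀) ((l , y) ∷ rest) v b = cong (l ∷_) (labels-go _ rest _ _)

  prefixes-go : ∀ {K : Pointed σM} {j} (cur : MPath K j) rest .v .b →
                lmap (steps ∘ proj₂) (go K cur rest v b) ≡ lmap (steps cur ++_) (inits⁺ rest)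
  prefixes-go cur [] v b = refl
  prefixes-go (mpath st b₀ v₀) ((l , y) ∷ rest) v b =
    cong ((st ++ (l , y) ∷ []) ∷_) (trans (prefixes-go _ rest _ _)
      (trans (Listₚ.map-cong (λ u → ++-assoc st ((l , y) ∷ []) u) (inits⁺ rest)) (Listₚ.map-∘ (inits⁺ rest))))

  labels-Mδ : ∀ {K : Pointed σM} {k} (π : MPath K k) → lmap proj₁ (steps (Mδ K π)) ≡ lmap proj₁ (steps π)
  labels-Mδ (mpath st b v) = labels-go (mpath [] z≤n tt) st v b

  prefixes-Mδ : ∀ {K : Pointed σM} {k} (π : MPath K k) → lmap (steps ∘ proj₂) (steps (Mδ K π)) ≡ inits⁺ (steps π)
  prefixes-Mδ (mpath st b v) = trans (prefixes-go (mpath [] z≤n tt) st v b) (Listₚ.map-id (inits⁺ st))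

  Mmap-∘ : ∀ {k} {K₁ K₂ K₃ : Pointed σM} (f : Carrier (struct K₂) → Carrier (struct K₃)) (g : Carrier (struct K₁) → Carrier (struct K₂))
           hf hg hfg (π : MPath K₁ k) → Mmap {k} {K₂} {K₃} f hf (Mmap {k} {K₁} {K₂} g hg π) ≡ Mmap {k} {K₁} {K₃} (f ∘ g) hfg π
  Mmap-∘ f g hf hg hfg (mpath st b v) = MPath-≡ _ _ (sym (Listₚ.map-∘ st))

  Valid-∷ʳ⁻ : ∀ (K : Kripke) x st l y → Valid K x (st ++ (l , y) ∷ []) → Rb K l (endpt x st) y
  Valid-∷ʳ⁻ K x [] l y (r , _) = r
  Valid-∷ʳ⁻ K x ((l′ , z) ∷ st) l y (_ , v) = Valid-∷ʳ⁻ K z st l y v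

  -- A one-step extension along R_l is recognised from the labels alone, given comparability.
  extension-transfer : ∀ {X Y : Set} (u v : List (Fin q × X)) (u′ v′ : List (Fin q × Y)) {l : Fin q} {y′ : Y} →
    Comparable u v → lmap proj₁ u ≡ lmap proj₁ u′ → lmap proj₁ v ≡ lmap proj₁ v′ → v′ ≡ u′ ++ (l , y′) ∷ [] →
    ∃ λ y → v ≡ u ++ (l , y) ∷ []
  extension-transfer u v u′ v′ {l} {y′} c lu lv e =
    last-step (prefix-length-suc (comparable-length-≤ c (subst (length u ≤_) (sym lengths) (n≤1+n _))) lengths)
    where
    lengths : length v ≡ suc (length u)
    lengths = trans (sym (length-map proj₁ v)) (trans (cong length lv) (trans (length-map proj₁ v′) (trans (cong length e)
                (trans (length-++ u′) (trans (+-comm _ 1)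
                  (cong suc (trans (sym (length-map proj₁ u′)) (trans (cong length (sym lu)) (length-map proj₁ u)))))))))
    last-step : (∃ λ w → v ≡ u ++ w ∷ []) → ∃ λ y → v ≡ u ++ (l , y) ∷ []
    last-step ((l″ , y) , e′) = y , trans e′ (cong (λ l‴ → u ++ (l‴ , y) ∷ []) last-label)
      where
      last-label : l″ ≡ l
      last-label = Listₚ.∷ʳ-injectiveʳ (lmap proj₁ u) (lmap proj₁ u′)
        (trans (sym (map-++ proj₁ u ((l″ , y) ∷ []))) (trans (cong (lmap proj₁) (sym e′)) (trans lv
          (trans (cong (lmap proj₁) e) (map-++ proj₁ u′ ((l , y′) ∷ []))))))

module MkStrategy (em : ExcludedMiddle 0ℓ) (p q k : ℕ) (A B : Pointed (modalSig p q)) where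
  open Lists
  open Modal p q
  open ModalPaths p q
  open ModalGame em p q A B
  open EMCat (Mk k)

  -- Follow a path of A step by step with the answers of the simulation; the fallback [] is never
  -- reached on valid paths of length at most j.
  mutual
    respond : ∀ j {x y} → Sim j x y → List (Fin q × CA) → List (Fin q × CB)
    respond j g [] = []
    respond zero g (_ ∷ _) = []
    respond (suc j) {x} g ((l , x′) ∷ st) = respond-step j g l x′ (em {Rb KA l x x′}) st

    respond-step : ∀ j {x y} → Sim (suc j) x y → ∀ l x′ → Dec (Rb KA l x x′) → List (Fin q × CA) → List (Fin q × CB)
    respond-step j g l x′ (yes r) st = (l , proj₁ (proj₂ g l x′ r)) ∷ respond j (proj₂ (proj₂ (proj₂ g l x′ r))) st
    respond-step j g l x′ (no _) st = []

  length-respond : ∀ j {x y} (g : Sim j x y) st → Valid KA x st → length st ≤ j → length (respond j g st) ≡ length st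
  length-respond j g [] v bd = refl
  length-respond (suc j) {x} g ((l , x′) ∷ st) (r , v) (s≤s bd) with em {Rb KA l x x′}
  ... | yes r′ = cong suc (length-respond j _ st v bd)
  ... | no nr = ⊥-elim (nr r)

  labels-respond : ∀ j {x y} (g : Sim j x y) st → Valid KA x st → length st ≤ j → lmap proj₁ (respond j g st) ≡ lmap proj₁ st
  labels-respond j g [] v bd = refl
  labels-respond (suc j) {x} g ((l , x′) ∷ st) (r , v) (s≤s bd) with em {Rb KA l x x′}
  ... | yes r′ = cong (l ∷_) (labels-respond j _ st v bd)
  ... | no nr = ⊥-elim (nr r)

  respond-valid : ∀ j {x y} (g : Sim j x y) st → Valid KA x st → length st ≤ j → Valid KB y (respond j g st)
  respond-valid j g [] v bd = tt
  respond-valid (suc j) {x} g ((l , x′) ∷ st) (r , v) (s≤s bd) with em {Rb KA l x x′}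
  ... | yes r′ = proj₁ (proj₂ (proj₂ g l x′ r′)) , respond-valid j _ st v bd
  ... | no nr = ⊥-elim (nr r)

  respond-endpoints : ∀ j {x y} (g : Sim j x y) st → Valid KA x st → length st ≤ j →
                      ∃ λ j′ → Sim j′ (endpt x st) (endpt y (respond j g st))
  respond-endpoints j g [] v bd = j , g
  respond-endpoints (suc j) {x} g ((l , x′) ∷ st) (r , v) (s≤s bd) with em {Rb KA l x x′}
  ... | yes r′ = respond-endpoints j _ st v bd
  ... | no nr = ⊥-elim (nr r)

  respond-prefix : ∀ j {x y} (g : Sim j x y) st₁ st₂ → Prefix (respond j g st₁) (respond j g (st₁ ++ st₂))
  respond-prefix j g [] st₂ = prefix-[] _
  respond-prefix zero g (_ ∷ _) st₂ = prefix-refl _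
  respond-prefix (suc j) {x} g ((l , x′) ∷ st₁) st₂ with em {Rb KA l x x′}
  ... | yes r′ = prefix-∷ (respond-prefix j _ st₁ st₂)
  ... | no nr = prefix-refl _

  mutual
    inits⁺-respond : ∀ j {x y} (g : Sim j x y) st → Valid KA x st → length st ≤ j →
                     inits⁺ (respond j g st) ≡ lmap (respond j g) (inits⁺ st)
    inits⁺-respond j g [] v bd = refl
    inits⁺-respond (suc j) {x} g ((l , x′) ∷ st) (r , v) (s≤s bd) =
      trans (inits⁺-respond-step j g l x′ (em {Rb KA l x x′}) st r v bd)
            (cong (respond (suc j) g ((l , x′) ∷ []) ∷_) (Listₚ.map-∘ (inits⁺ st)))

    inits⁺-respond-step : ∀ j {x y} (g : Sim (suc j) x y) l x′ (d : Dec (Rb KA l x x′)) st → Rb KA l x x′ →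
                          Valid KA x′ st → length st ≤ j →
                          inits⁺ (respond-step j g l x′ d st) ≡ respond-step j g l x′ d [] ∷ lmap (respond-step j g l x′ d) (inits⁺ st)
    inits⁺-respond-step j g l x′ (yes r′) st r v bd =
      cong (((l , proj₁ (proj₂ g l x′ r′)) ∷ []) ∷_)
        (trans (cong (lmap ((l , proj₁ (proj₂ g l x′ r′)) ∷_)) (inits⁺-respond j _ st v bd)) (sym (Listₚ.map-∘ (inits⁺ st))))
    inits⁺-respond-step j g l x′ (no nr) st r v bd = ⊥-elim (nr r)

  morphism-monotone : (R : PreCoalg) (m : Carrier (struct (Ob R)) → MPath A k) → IsMor R (Cofree A) m →
                      ∀ x y → Order R x y → Prefix (steps (m x)) (steps (m y))
  morphism-monotone R m (_ , meq) x y p with steps (m x) in e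
  ... | [] = prefix-[] _
  ... | z ∷ zs = ∈-inits⁺⇒prefix (steps (m y))
          (subst ((z ∷ zs) ∈_) (sym (prefixes-of y))
            (prefix-∈ (prefix-map (steps ∘ m ∘ proj₂) p)
              (subst ((z ∷ zs) ∈_) (trans (cong inits⁺ (sym e)) (prefixes-of x)) (prefix⇒∈-inits⁺ z zs (z ∷ zs) (prefix-refl _)))))
    where
    prefixes-of : ∀ w → inits⁺ (steps (m w)) ≡ lmap (steps ∘ m ∘ proj₂) (steps (α R w))
    prefixes-of w = trans (sym (prefixes-Mδ (m w)))
                      (trans (cong (lmap (steps ∘ proj₂) ∘ steps) (meq w)) (sym (Listₚ.map-∘ (steps (α R w)))))

  module StrategyEmbedding (g₀ : Sim k (point A) (point B)) where
    f : MPath A k → MPath B k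
    f (mpath st bd v) = mpath (respond k g₀ st) (subst (_≤ k) (sym (length-respond k g₀ st v bd)) bd) (respond-valid k g₀ st v bd)

    length-f : ∀ π → length (steps (f π)) ≡ length (steps π)
    length-f (mpath st b v) = length-respond k g₀ st (recompute em v) (recompute (_ ≤? k) b)

    labels-f : ∀ π → lmap proj₁ (steps (f π)) ≡ lmap proj₁ (steps π)
    labels-f (mpath st b v) = labels-respond k g₀ st (recompute em v) (recompute (_ ≤? k) b)

    f-endpoints : ∀ π → ∃ λ j → Sim j (endpt (point A) (steps π)) (endpt (point B) (steps (f π)))
    f-endpoints (mpath st b v) = respond-endpoints k g₀ st (recompute em v) (recompute (_ ≤? k) b)

    inits⁺-f : ∀ π → inits⁺ (steps (f π)) ≡ lmap (respond k g₀) (inits⁺ (steps π))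
    inits⁺-f (mpath st b v) = inits⁺-respond k g₀ st (recompute em v) (recompute (_ ≤? k) b)

    f-prefix : ∀ π π′ → Prefix (steps π) (steps π′) → Prefix (steps (f π)) (steps (f π′))
    f-prefix π π′ (u , e) = subst (λ l → Prefix (respond k g₀ (steps π)) (respond k g₀ l)) e (respond-prefix k g₀ (steps π) u)

    f-Ext : ∀ π π′ l → Ext {A} l π π′ → Ext {B} l (f π) (f π′)
    f-Ext π π′ l (z , e) =
      extension-transfer (steps (f π)) (steps (f π′)) (steps π) (steps π′)
        (inj₁ (f-prefix π π′ (_ , sym e))) (labels-f π) (labels-f π′) e

    homomorphism : Preserves (MStruct k A) (MStruct k B) f × (f (mpath [] z≤n tt) ≡ mpath [] z≤n tt)
    homomorphism = preserves , refl
      where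
      preserves : Preserves (MStruct k A) (MStruct k B) f
      preserves (inj₁ i) (π ∷ []) h = Equivalence.to (Sim⇒SameAtoms _ (proj₂ (f-endpoints π)) i) h
      preserves (inj₂ l) (π ∷ π′ ∷ []) h = f-Ext π π′ l h

    coalgebraic : ∀ π → Mδ B (f π) ≡ Mmap {k} {MPt k A} {MPt k B} f homomorphism (Mδ A π)
    coalgebraic π = MPath-≡ _ _ (map-proj-injective _ _ same-labels (Listₚ.map-injective (MPath-≡ _ _) same-prefixes))
      where
      open ≡-Reasoning
      same-labels : lmap proj₁ (steps (Mδ B (f π))) ≡ lmap proj₁ (steps (Mmap {k} {MPt k A} {MPt k B} f homomorphism (Mδ A π)))
      same-labels = trans (labels-Mδ (f π)) (trans (labels-f π) (trans (sym (labels-Mδ π)) (Listₚ.map-∘ (steps (Mδ A π)))))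
      same-prefixes : lmap steps (lmap proj₂ (steps (Mδ B (f π)))) ≡
                      lmap steps (lmap proj₂ (steps (Mmap {k} {MPt k A} {MPt k B} f homomorphism (Mδ A π))))
      same-prefixes = begin
          lmap steps (lmap proj₂ (steps (Mδ B (f π))))
        ≡⟨ sym (Listₚ.map-∘ (steps (Mδ B (f π)))) ⟩
          lmap (steps ∘ proj₂) (steps (Mδ B (f π)))
        ≡⟨ prefixes-Mδ (f π) ⟩
          inits⁺ (steps (f π))
        ≡⟨ inits⁺-f π ⟩
          lmap (respond k g₀) (inits⁺ (steps π))
        ≡⟨ cong (lmap (respond k g₀)) (sym (prefixes-Mδ π)) ⟩
          lmap (respond k g₀) (lmap (steps ∘ proj₂) (steps (Mδ A π)))
        ≡⟨ sym (Listₚ.map-∘ (steps (Mδ A π))) ⟩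
          lmap (steps ∘ f ∘ proj₂) (steps (Mδ A π))
        ≡⟨ Listₚ.map-∘ (steps (Mδ A π)) ⟩
          lmap steps (lmap (f ∘ proj₂) (steps (Mδ A π)))
        ≡⟨ cong (lmap steps) (Listₚ.map-∘ (steps (Mδ A π))) ⟩
          lmap steps (lmap proj₂ (lmap (map₂ f) (steps (Mδ A π))))
        ∎

    isMor : IsMor (Cofree A) (Cofree B) f
    isMor = homomorphism , coalgebraic

    pathwise : IsPathwiseEmbedding (Cofree A) (Cofree B) f
    pathwise R (_ , (_ , _ , _ , _ , total)) m (m-mor@((m-hom , m-point) , m-coalg) , m-inj , m-refl) =
      ((hom∘ , cong f m-point) , coalg∘) , inj∘ , refl∘
      where
      K = Ob R
      chain : ∀ x y → Comparable (steps (m x)) (steps (m y))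
      chain x y with total x y
      ... | inj₁ p = inj₁ (morphism-monotone R m m-mor x y p)
      ... | inj₂ p = inj₂ (morphism-monotone R m m-mor y x p)
      hom∘ : Preserves (struct K) (MStruct k B) (f ∘ m)
      hom∘ r xs h = subst (rel (MStruct k B) r) (sym (Vecₚ.map-∘ f m xs)) (proj₁ homomorphism r (vmap m xs) (m-hom r xs h))
      coalg∘ : ∀ x → Mδ B (f (m x)) ≡ Mmap {k} {K} {MPt k B} (f ∘ m) (hom∘ , cong f m-point) (α R x)
      coalg∘ x = trans (coalgebraic (m x)) (trans (cong (Mmap {k} {MPt k A} {MPt k B} f homomorphism) (m-coalg x))
                   (Mmap-∘ f m homomorphism (m-hom , m-point) (hom∘ , cong f m-point) (α R x)))
      inj∘ : ∀ x y → f (m x) ≡ f (m y) → x ≡ y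
      inj∘ x y e = m-inj x y (MPath-≡ (m x) (m y) (comparable-length-≡ (chain x y)
        (trans (sym (length-f (m x))) (trans (cong (length ∘ steps) e) (length-f (m y))))))
      refl∘ : ReflectsRel (struct K) (MStruct k B) (f ∘ m)
      refl∘ (inj₁ i) (x ∷ []) h = m-refl (inj₁ i) (x ∷ []) (Equivalence.from (Sim⇒SameAtoms _ (proj₂ (f-endpoints (m x))) i) h)
      refl∘ (inj₂ l) (x ∷ y ∷ []) (_ , e) =
        m-refl (inj₂ l) (x ∷ y ∷ []) (extension-transfer (steps (m x)) (steps (m y)) (steps (f (m x))) (steps (f (m y)))
                                        (chain x y) (sym (labels-f (m x))) (sym (labels-f (m y))) e)

  Sim⇒PWE : Sim k (point A) (point B) → PWEᴹ p q k A B
  Sim⇒PWE g₀ = StrategyEmbedding.f g₀ , StrategyEmbedding.isMor g₀ , StrategyEmbedding.pathwise g₀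

module ModalPlays (p q k : ℕ) (A : Pointed (modalSig p q)) where
  open Lists
  open Modal p q
  open ModalPaths p q
  open EMCat (Mk k)

  prefixAt : {Y : Set} (st : List Y) → Fin (suc (length st)) → List Y
  prefixAt st zero = []
  prefixAt (y ∷ st) (suc i) = y ∷ prefixAt st i

  -- The path 0 → 1 → ⋯ → i in Fin (1 + length st), labelled like st.
  indexPath : {X : Set} (st : List (Fin q × X)) → Fin (suc (length st)) → List (Fin q × Fin (suc (length st)))
  indexPath st zero = []
  indexPath ((l , x) ∷ st) (suc i) = (l , suc zero) ∷ lmap (map₂ suc) (indexPath st i)

  module _ {Y : Set} where

    length-prefixAt : (st : List Y) (i : Fin (suc (length st))) → length (prefixAt st i) ≡ toℕ i
    length-prefixAt st zero = refl
    length-prefixAt (y ∷ st) (suc i) = cong suc (length-prefixAt st i)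

    prefixAt-last : (st : List Y) → prefixAt st (fromℕ (length st)) ≡ st
    prefixAt-last [] = refl
    prefixAt-last (y ∷ st) = cong (y ∷_) (prefixAt-last st)

    prefixAt-prefix : (st : List Y) (i : Fin (suc (length st))) → Prefix (prefixAt st i) st
    prefixAt-prefix st zero = prefix-[] _
    prefixAt-prefix (y ∷ st) (suc i) = prefix-∷ (prefixAt-prefix st i)

  module _ {X : Set} where

    labels-indexPath : ∀ (st : List (Fin q × X)) i → lmap proj₁ (indexPath st i) ≡ lmap proj₁ (prefixAt st i)
    labels-indexPath st zero = refl
    labels-indexPath ((l , x) ∷ st) (suc i) = cong (l ∷_) (trans (sym (Listₚ.map-∘ (indexPath st i))) (labels-indexPath st i))

    endpt-map-suc : ∀ {m : ℕ} (a : Fin m) (L : List (Fin q × Fin m)) → endpt (suc a) (lmap (map₂ suc) L) ≡ suc (endpt a L)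
    endpt-map-suc a [] = refl
    endpt-map-suc a ((l , y) ∷ L) = endpt-map-suc y L

    endpt-indexPath : ∀ (st : List (Fin q × X)) i → endpt zero (indexPath st i) ≡ i
    endpt-indexPath st zero = refl
    endpt-indexPath ((l , x) ∷ st) (suc i) = trans (endpt-map-suc zero (indexPath st i)) (cong suc (endpt-indexPath st i))

    indexPath-comparable : ∀ (st : List (Fin q × X)) i j → Comparable (indexPath st i) (indexPath st j)
    indexPath-comparable st zero j = inj₁ (prefix-[] _)
    indexPath-comparable ((l , x) ∷ st) (suc i) zero = inj₂ (prefix-[] _)
    indexPath-comparable ((l , x) ∷ st) (suc i) (suc j) = comparable-∷ (comparable-map (map₂ suc) (indexPath-comparable st i j))

    length-indexPath : ∀ (st : List (Fin q × X)) i → length (indexPath st i) ≡ length (prefixAt st i)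
    length-indexPath st i =
      trans (sym (length-map proj₁ (indexPath st i))) (trans (cong length (labels-indexPath st i)) (length-map proj₁ (prefixAt st i)))

    inits⁺-indexPath : ∀ (st : List (Fin q × X)) i → inits⁺ (indexPath st i) ≡ lmap (indexPath st ∘ proj₂) (indexPath st i)
    inits⁺-indexPath st zero = refl
    inits⁺-indexPath ((l , x) ∷ st) (suc i) = cong (((l , suc zero) ∷ []) ∷_) (begin
        lmap ((l , suc zero) ∷_) (inits⁺ (lmap (map₂ suc) (indexPath st i)))
      ≡⟨ cong (lmap ((l , suc zero) ∷_)) (inits⁺-map (map₂ suc) (indexPath st i)) ⟩
        lmap ((l , suc zero) ∷_) (lmap (lmap (map₂ suc)) (inits⁺ (indexPath st i)))
      ≡⟨ cong (λ L → lmap ((l , suc zero) ∷_) (lmap (lmap (map₂ suc)) L)) (inits⁺-indexPath st i) ⟩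
        lmap ((l , suc zero) ∷_) (lmap (lmap (map₂ suc)) (lmap (indexPath st ∘ proj₂) (indexPath st i)))
      ≡⟨ trans (cong (lmap ((l , suc zero) ∷_)) (sym (Listₚ.map-∘ (indexPath st i)))) (sym (Listₚ.map-∘ (indexPath st i))) ⟩
        lmap (λ e → (l , suc zero) ∷ lmap (map₂ suc) (indexPath st (proj₂ e))) (indexPath st i)
      ≡⟨ Listₚ.map-∘ (indexPath st i) ⟩
        lmap (indexPath ((l , x) ∷ st) ∘ proj₂) (lmap (map₂ suc) (indexPath st i))
      ∎)
      where open ≡-Reasoning

    inits⁺-prefixAt : ∀ (st : List (Fin q × X)) i → inits⁺ (prefixAt st i) ≡ lmap (prefixAt st ∘ proj₂) (indexPath st i)
    inits⁺-prefixAt st zero = refl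
    inits⁺-prefixAt ((l , x) ∷ st) (suc i) = cong (((l , x) ∷ []) ∷_) (begin
        lmap ((l , x) ∷_) (inits⁺ (prefixAt st i))
      ≡⟨ cong (lmap ((l , x) ∷_)) (inits⁺-prefixAt st i) ⟩
        lmap ((l , x) ∷_) (lmap (prefixAt st ∘ proj₂) (indexPath st i))
      ≡⟨ sym (Listₚ.map-∘ (indexPath st i)) ⟩
        lmap (λ e → (l , x) ∷ prefixAt st (proj₂ e)) (indexPath st i)
      ≡⟨ Listₚ.map-∘ (indexPath st i) ⟩
        lmap (prefixAt ((l , x) ∷ st) ∘ proj₂) (lmap (map₂ suc) (indexPath st i))
      ∎)
      where open ≡-Reasoning

    Extends : (st : List (Fin q × X)) → Fin (suc (length st)) → List (Fin q × Fin (suc (length st))) → Set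
    Extends st x [] = ⊤
    Extends st x ((l , y) ∷ L) = (∃ λ z → prefixAt st y ≡ prefixAt st x ++ (l , z) ∷ []) × Extends st y L

    Extends-map-suc : ∀ l (x₀ : X) st a L → Extends st a L → Extends ((l , x₀) ∷ st) (suc a) (lmap (map₂ suc) L)
    Extends-map-suc l x₀ st a [] _ = tt
    Extends-map-suc l x₀ st a ((l′ , y) ∷ L) ((z , e) , ext) = (z , cong ((l , x₀) ∷_) e) , Extends-map-suc l x₀ st y L ext

    Extends-indexPath : ∀ (st : List (Fin q × X)) i → Extends st zero (indexPath st i)
    Extends-indexPath st zero = tt
    Extends-indexPath ((l , x) ∷ st) (suc i) = (x , refl) , Extends-map-suc l x st zero (indexPath st i) (Extends-indexPath st i)

  Valid-prefixAt : ∀ (K : Kripke) x st i → Valid K x st → Valid K x (prefixAt st i)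
  Valid-prefixAt K x st zero v = tt
  Valid-prefixAt K x ((l , y) ∷ st) (suc i) (r , v) = r , Valid-prefixAt K y st i v

  -- The path whose elements are the prefixes of the path st of A.
  module PlayPath (st : List (Fin q × Carrier (struct A))) .(v : Valid (struct A) (point A) st) (bounded : length st ≤ k) where
    N : ℕ
    N = suc (length st)

    ι : Fin N → MPath A k
    ι i = mpath (prefixAt st i) (≤-trans (prefix-length (prefixAt-prefix st i)) bounded) (Valid-prefixAt (struct A) (point A) st i v)

    Rs : Kripke
    Rs = record { Carrier = Fin N ; rel = λ r xs → rel (MStruct k A) r (vmap ι xs) }

    RK : Pointed σM
    RK = Rs ,* zero

    Extends⇒Valid : ∀ x L → Extends st x L → Valid Rs x L
    Extends⇒Valid x [] _ = tt
    Extends⇒Valid x ((l , y) ∷ L) (h , ext) = h , Extends⇒Valid y L ext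

    α′ : Fin N → MPath RK k
    α′ i = mpath (indexPath st i) (≤-trans (≤-reflexive (length-indexPath st i)) (≤-trans (prefix-length (prefixAt-prefix st i)) bounded))
                 (Extends⇒Valid zero (indexPath st i) (Extends-indexPath st i))

    R : PreCoalg
    R = RK ,ᶜ α′

    α′-hom : Preserves Rs (MStruct k RK) α′
    α′-hom (inj₁ i) (x ∷ []) h = subst (λ z → Pu (struct A) i (endpt (point A) (prefixAt st z))) (sym (endpt-indexPath st x)) h
    α′-hom (inj₂ l) (x ∷ y ∷ []) (z , e) =
      extension-transfer (indexPath st x) (indexPath st y) (prefixAt st x) (prefixAt st y)
        (indexPath-comparable st x y) (labels-indexPath st x) (labels-indexPath st y) e

    α′-coalgebraic : ∀ x → Mmap {k} {RK} {MPt k RK} α′ (α′-hom , refl) (α′ x) ≡ Mδ RK (α′ x)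
    α′-coalgebraic x = MPath-≡ _ _ (map-proj-injective _ _ same-labels same-prefixes)
      where
      same-labels : lmap proj₁ (lmap (map₂ α′) (indexPath st x)) ≡ lmap proj₁ (steps (Mδ RK (α′ x)))
      same-labels = trans (sym (Listₚ.map-∘ (indexPath st x))) (sym (labels-Mδ (α′ x)))
      same-prefixes : lmap proj₂ (lmap (map₂ α′) (indexPath st x)) ≡ lmap proj₂ (steps (Mδ RK (α′ x)))
      same-prefixes = Listₚ.map-injective (MPath-≡ _ _)
        (trans (sym (Listₚ.map-∘ (lmap (map₂ α′) (indexPath st x))))
          (trans (sym (Listₚ.map-∘ (indexPath st x)))
            (trans (sym (inits⁺-indexPath st x)) (trans (sym (prefixes-Mδ (α′ x))) (Listₚ.map-∘ (steps (Mδ RK (α′ x))))))))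

    ι-coalgebraic : ∀ x → Mδ A (ι x) ≡ Mmap {k} {RK} {MPt k A} ι ((λ r xs h → h) , refl) (α′ x)
    ι-coalgebraic x = MPath-≡ _ _ (map-proj-injective _ _ same-labels same-prefixes)
      where
      same-labels : lmap proj₁ (steps (Mδ A (ι x))) ≡ lmap proj₁ (lmap (map₂ ι) (indexPath st x))
      same-labels = trans (labels-Mδ (ι x)) (trans (sym (labels-indexPath st x)) (Listₚ.map-∘ (indexPath st x)))
      same-prefixes : lmap proj₂ (steps (Mδ A (ι x))) ≡ lmap proj₂ (lmap (map₂ ι) (indexPath st x))
      same-prefixes = Listₚ.map-injective (MPath-≡ _ _)
        (trans (sym (Listₚ.map-∘ (steps (Mδ A (ι x)))))
          (trans (prefixes-Mδ (ι x))
            (trans (inits⁺-prefixAt st x)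
              (trans (Listₚ.map-∘ (indexPath st x)) (Listₚ.map-∘ (lmap (map₂ ι) (indexPath st x)))))))

    isPath : IsPath R
    isPath = ((α′-hom , refl) , endpt-indexPath st , α′-coalgebraic) ,
             (N , ↔-id (Fin N)) ,
             (λ x → prefix-refl _) ,
             (λ x y z → prefix-trans) ,
             (λ x y p₁ p₂ → trans (sym (endpt-indexPath st x))
                (trans (cong (endpt zero) (prefix-length-≡ p₁ (≤-antisym (prefix-length p₁) (prefix-length p₂)))) (endpt-indexPath st y))) ,
             indexPath-comparable st

    ι-embedding : IsEmbedding R (Cofree A) ι
    ι-embedding =
      (((λ r xs h → h) , refl) , ι-coalgebraic) ,
      (λ x y e → toℕ-injective (trans (sym (length-prefixAt st x)) (trans (cong (length ∘ steps) e) (length-prefixAt st y)))) ,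
      (λ r xs h → h)

    last : Fin N
    last = fromℕ (length st)

    ι-last : ι last ≡ mpath st bounded v
    ι-last = MPath-≡ _ _ (prefixAt-last st)

module MkEmbeddingStrategy (em : ExcludedMiddle 0ℓ) (p q k : ℕ) (A B : Pointed (modalSig p q)) where
  open Modal p q
  open ModalPaths p q
  open ModalGame em p q A B
  open EMCat (Mk k)
  open ModalPlays p q k A

  module _ (f : MPath A k → MPath B k) (f-mor : IsMor (Cofree A) (Cofree B) f)
           (f-pathwise : IsPathwiseEmbedding (Cofree A) (Cofree B) f) where
    f-hom : Preserves (MStruct k A) (MStruct k B) f
    f-hom = proj₁ (proj₁ f-mor)

    valid-steps : (π : MPath B k) → Valid KB (point B) (steps π)
    valid-steps (mpath st b v) = recompute em v

    endpoints-SameAtoms : ∀ st .(v : Valid KA (point A) st) .(b : length st ≤ k) (bounded : length st ≤ k) →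
                          SameAtoms (endpt (point A) st) (endpt (point B) (steps (f (mpath st b v))))
    endpoints-SameAtoms st v b bounded i = mk⇔ (f-hom (inj₁ i) (mpath st b v ∷ [])) back
      where
      open PlayPath st v bounded
      back : Pu KB i (endpt (point B) (steps (f (mpath st b v)))) → Pu KA i (endpt (point A) st)
      back hb = subst (λ z → Pu KA i (endpt (point A) z)) (prefixAt-last st)
                  (proj₂ (proj₂ (f-pathwise R isPath ι ι-embedding)) (inj₁ i) (last ∷ [])
                    (subst (λ z → Pu KB i (endpt (point B) (steps (f z)))) (sym ι-last) hb))

    endpoints-Sim : ∀ j (π : MPath A k) → length (steps π) + j ≤ k → Sim j (endpt (point A) (steps π)) (endpt (point B) (steps (f π)))
    endpoints-Sim zero (mpath st b v) bounded = endpoints-SameAtoms st v b (≤-trans (m≤m+n _ 0) bounded)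
    endpoints-Sim (suc j) π@(mpath st b v) bounded = endpoints-SameAtoms st v b (≤-trans (m≤m+n _ (suc j)) bounded) , forth
      where
      forth : ∀ l x′ → Rb KA l (endpt (point A) st) x′ → Σ CB λ y′ → Rb KB l (endpt (point B) (steps (f π))) y′ × Sim j x′ y′
      forth l x′ r = y′ , step-B , subst₂ (Sim j) (endpt-snoc (point A) st l x′) end-B (endpoints-Sim j π′ bounded′)
        where
        bounded′ : length (st ++ (l , x′) ∷ []) + j ≤ k
        bounded′ = subst (_≤ k) (trans (sym (+-assoc (length st) 1 j)) (cong (_+ j) (sym (length-++ st)))) bounded
        π′ : MPath A k
        π′ = mpath (st ++ (l , x′) ∷ []) (≤-trans (m≤m+n _ j) bounded′) (valid-snoc KA (point A) st l x′ v r)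
        extension : Ext {B} l (f π) (f π′)
        extension = f-hom (inj₂ l) (π ∷ π′ ∷ []) (x′ , refl)
        y′ = proj₁ extension
        step-B : Rb KB l (endpt (point B) (steps (f π))) y′
        step-B = Valid-∷ʳ⁻ KB (point B) (steps (f π)) l y′ (subst (Valid KB (point B)) (proj₂ extension) (valid-steps (f π′)))
        end-B : endpt (point B) (steps (f π′)) ≡ y′
        end-B = trans (cong (endpt (point B)) (proj₂ extension)) (endpt-snoc (point B) (steps (f π)) l y′)

  PWE⇒Sim : PWEᴹ p q k A B → Sim k (point A) (point B)
  PWE⇒Sim (f , f-mor , f-pathwise) =
    subst (λ z → Sim k (point A) (endpt (point B) (steps z))) (proj₂ (proj₁ f-mor))
      (endpoints-Sim f f-mor f-pathwise k (mpath [] z≤n tt) ≤-refl)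

theorem7p4 :
    ExcludedMiddle 0ℓ → ExcludedMiddle (lsuc 0ℓ) →
      ((σ : Sig) → FiniteSet (Sym σ) → (k : ℕ) (A B : Struct σ) →
         (ExPresFO σ k A B → PWEᴱ σ k A B) × (PWEᴱ σ k A B → ExPresFO σ k A B))
    × ((σ : Sig) → FiniteSet (Sym σ) → (n : ℕ) (A B : Struct σ) →
         (ExPresLinf σ n A B → PWEᴾ σ n A B) × (PWEᴾ σ n A B → ExPresLinf σ n A B))
    × ((p q k : ℕ) (A B : Pointed (modalSig p q)) →
         (Modal.ModalPres p q k A B → PWEᴹ p q k A B)
         × (PWEᴹ p q k A B → Modal.ModalPres p q k A B))
theorem7p4 em₀ em₁ = firstOrder , infinitary , modal
  where
  firstOrder : (σ : Sig) → FiniteSet (Sym σ) → (k : ℕ) (A B : Struct σ) →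
               (ExPresFO σ k A B → PWEᴱ σ k A B) × (PWEᴱ σ k A B → ExPresFO σ k A B)
  firstOrder σ fin k A B =
    (λ pres → EkStrategy.Sim⇒PWE k A B (HintikkaFO.ExPres⇒Sim em₀ fin A B k [] [] pres)) ,
    (λ pwe → ExistentialGame.Sim⇒ExPres A B k [] [] (EkEmbeddingStrategy.PWE⇒Sim k A B pwe))

  infinitary : (σ : Sig) → FiniteSet (Sym σ) → (n : ℕ) (A B : Struct σ) →
               (ExPresLinf σ n A B → PWEᴾ σ n A B) × (PWEᴾ σ n A B → ExPresLinf σ n A B)
  infinitary σ _ n A B = PnStrategy.ExPres⇒PWE em₀ em₁ n A B , PnEmbeddingStrategy.PWE⇒ExPres n A B

  modal : (p q k : ℕ) (A B : Pointed (modalSig p q)) →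
          (Modal.ModalPres p q k A B → PWEᴹ p q k A B) × (PWEᴹ p q k A B → Modal.ModalPres p q k A B)
  modal p q k A B =
    (λ pres → MkStrategy.Sim⇒PWE em₀ p q k A B (ModalGame.ExPres⇒Sim em₀ p q A B k (point A) (point B) pres)) ,
    (λ pwe → ModalGame.Sim⇒ExPres em₀ p q A B k (point A) (point B) (MkEmbeddingStrategy.PWE⇒Sim em₀ p q k A B pwe))
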